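{- Consider an execution of the DRL transition system and a time $t$. Let $S$ be a set of actors that is closed at time $t$ and all of whose actors are terminated at time $t$, and let $Q$ be a set of snapshots with $\mathrm{dom}(Q)=S$ that is consistent at time $t$. Then $Q$ is finalized.
   Context: DRL transition system. Refobs are triples $x: A\to B$ (token $x$, owner $A$, target $B$). Facts: $\mathrm{Created}(x)$, $\mathrm{Released}(x)$, $\mathrm{CreatedUsing}(x,y)$, $\mathrm{Activated}(x)$, $\mathrm{Unreleased}(x)$, $\mathrm{SentCount}(x,n)$, $\mathrm{RecvCount}(x,n)$. A knowledge set $\Phi$ is a finite set of facts; $\Phi\vdash\varphi$ means derivability in first-order logic plus: if no $\mathrm{SentCount}(x,n)\in\Phi$ then $\Phi\vdash\mathrm{SentCount}(x,0)$; likewise for $\mathrm{RecvCount}$; $\Phi\vdash\mathrm{Created}(x)\wedge\neg\mathrm{Released}(x)$ gives $\Phi\vdash\mathrm{Unreleased}(x)$; $\Phi\vdash\mathrm{CreatedUsing}(x,y)$ gives $\Phi\vdash\mathrm{Created}(y)$. $\mathrm{IncSent}/\mathrm{IncRecv}(x,\Phi)$ increment (or create with value $1$) the corresponding count. Messages: $\mathrm{App}(x,R)$, $\mathrm{Info}(y,z,B)$, $\mathrm{Release}(x,n)$. A configuration $(\alpha,\mu,\rho,\chi)$: $\alpha$ maps internal actors to busy $[\Phi]$ or idle $(\Phi)$ states; $\mu$ gives undelivered messages of each actor; receptionists $\rho\subseteq\mathrm{dom}(\alpha)$; external actors $\chi$. Initial configuration: one busy actor $A$ with $\{\mathrm{Activated}(x:A\to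 E),\mathrm{Created}(y:A\to A),\mathrm{Activated}(y:A\to A)\}$, no messages, $\rho=\emptyset$, $\chi=\{E\}$. Events: Spawn$(x,A,B)$: busy $A$, fresh $x,y,B$; $A$ adds $\mathrm{Activated}(x:A\to B)$; new busy $B$ with $\{\mathrm{Created}(x:A\to B),\mathrm{Created}(y:B\to B),\mathrm{Activated}(y:B\to B)\}$. Send$(x,\vec y,\vec z,A,B,\vec C)$: busy $A$ with $\Phi\vdash\mathrm{Activated}(x:A\to B)$ and $\Phi\vdash\mathrm{Activated}(y_i:A\to C_i)$, fresh $z_i$; $A$'s set becomes $\mathrm{IncSent}(x,\Phi)\cup\{\mathrm{CreatedUsing}(y_i,z_i)\}$; $\mathrm{App}(x,\{z_i:B\to C_i\})$ sent to $B$. Receive$(x,B,R)$: idle $B$ consumes $\mathrm{App}(x,R)$, becomes busy with $\mathrm{IncRecv}(x,\Phi)\cup\{\mathrm{Activated}(z):z\in R\}$. Idle$(A)$: busy $A$ becomes idle. SendInfo$(y,z,A,B,C)$: busy $A$ containing $\mathrm{CreatedUsing}(y:A\to C,z:B\to C)$ removes it, increments send count of $y$, sends $\mathrm{Info}(y,z,B)$ to $C$. Info$(y,z,B,C)$: idle $C$ consumes it, stays idle with $\mathrm{IncRecv}(y,\Phi)\cup\{\mathrm{Created}(z:B\to C)\}$. SendRelease$(x,A,B)$: busy $A$ with set $\Phi\cup\{\mathrm{Activated}(x:A\to B),\mathrm{SentCount}(x,n)\}$, no $\mathrm{CreatedUsing}(x,y)\in\Phi$: set becomes $\Phi$; sends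 $\mathrm{Release}(x,n)$ to $B$. Release$(x,A,B)$: idle $B$ consumes $\mathrm{Release}(x,n)$ only if $\Phi\vdash\mathrm{RecvCount}(x,n)$; adds $\mathrm{Released}(x)$; $x$ is released. Compaction$(x,B,C)$: idle $C$ containing $\mathrm{Created}(x:B\to C),\mathrm{Released}(x)$ removes them and any $\mathrm{RecvCount}(x,n)$. Snapshot$(A,\Phi)$: idle $A$; no change; records $\Phi$ as $A$'s snapshot. In$(x,A,R)$: $A\in\rho$ receives from outside $\mathrm{App}(x,R)$ with fresh refobs owned by $A$ whose internal targets lie in $\rho$; external targets join $\chi$. Out$(x,B,R)$: $B\in\chi$ consumes $\mathrm{App}(x,R)$; internal targets of $R$ join $\rho$. ReleaseOut/InfoOut: Release/Info messages to external actors are dropped. Times index the configurations $\kappa_t$ of an execution; $\alpha_t$ is the first component of $\kappa_t$. A refob is unreleased once created until its target performs Release for it. A set $S$ is closed at time $t$ if $B\in S$ and $x:A\to B$ unreleased at time $t$ imply $A\in S$. An actor is terminated at time $t$ if it is idle in $\kappa_t$ and no finite sequence of events from $\kappa_t$ leads to a configuration where it has an undelivered message. A set of snapshots $Q$ maps actors to knowledge sets recorded by their Snapshot events (at most one per actor). $Q$ is consistent at time $t$ if for all facts $\varphi$ and $A\in\mathrm{dom}(Q)$, $Q(A)\vdash\varphi$ iff $\alpha_t(A)\vdash\varphi$. For a refob $x:A\to B$: $Q\vdash\mathrm{Activated}(x)$, $Q\vdash\mathrm{SentCount}(x,n)$, $Q\vdash\mathrm{CreatedUsing}(x,y)$ mean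 $A\in\mathrm{dom}(Q)$ and $Q(A)$ derives the fact; $Q\vdash\mathrm{Created}(x)$, $Q\vdash\mathrm{Released}(x)$, $Q\vdash\mathrm{RecvCount}(x,n)$ mean $B\in\mathrm{dom}(Q)$ and $Q(B)$ derives the fact. $Q\vdash\mathrm{Chain}(x:A\to B)$ iff there are refobs $x_1:A_1\to B,\dots,x_n:A_n\to B$ with $Q\vdash\mathrm{Created}(x_1)$, $Q\not\vdash\mathrm{Released}(x_1)$, and for all $i<n$, $Q\vdash\mathrm{CreatedUsing}(x_i,x_{i+1})$ and $Q\not\vdash\mathrm{Released}(x_{i+1})$, and $A_n=A$, $x_n=x$. $Q\vdash\mathrm{Relevant}(x)$ iff for some $n$, $Q\vdash\mathrm{Activated}(x)$, $Q\vdash\mathrm{SentCount}(x,n)$ and $Q\vdash\mathrm{RecvCount}(x,n)$. $Q$ is finalized if for all $B\in\mathrm{dom}(Q)$ and all refobs $x:A\to B$, $Q\vdash\mathrm{Chain}(x)$ implies $A\in\mathrm{dom}(Q)$ and $Q\vdash\mathrm{Relevant}(x)$. -}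

module Defs where

open import Data.Bool using (Bool; true; false; if_then_else_; not; _∧_)
open import Data.Nat using (ℕ; zero; suc; _<_; _≤_; _≡ᵇ_)
open import Data.List using (List; []; _∷_; _++_; map; filterᵇ; concatMap)
open import Data.List.Membership.Propositional using (_∈_; _∉_)
open import Data.List.Relation.Unary.All using (All)
open import Data.List.Relation.Unary.Unique.Propositional using (Unique)
open import Data.Maybe using (Maybe; just; nothing; is-just; is-nothing)
open import Data.Product using (Σ; ∃; _×_; _,_; proj₁; proj₂)
open import Data.Sum using (_⊎_)
open import Data.Empty using (⊥)
open import Relation.Nullary using (¬_)
open import Relation.Binary.PropositionalEquality using (_≡_; _≢_)
open import Relation.Binary.Construct.Closure.ReflexiveTransitive using (Star)

Actor : Set
Actor = ℕ

Token : Set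
Token = ℕ

record Refob : Set where
  constructor ref
  field
    token  : Token
    owner  : Actor
    target : Actor
open Refob public

data Fact : Set where
  Created      : Refob → Fact
  Released     : Refob → Fact
  CreatedUsing : Refob → Refob → Fact
  Activated    : Refob → Fact
  Unreleased   : Refob → Fact
  SentCount    : Refob → ℕ → Fact
  RecvCount    : Refob → ℕ → Fact

KSet : Set
KSet = List Fact

-- derivability  Φ ⊢ φ  (facts are atoms; closed-world reading of ¬Released)
data _⊢_ (Φ : KSet) : Fact → Set where
  ax      : ∀ {φ} → φ ∈ Φ → Φ ⊢ φ
  sent0   : ∀ {x} → (∀ n → SentCount x n ∉ Φ) → Φ ⊢ SentCount x 0
  recv0   : ∀ {x} → (∀ n → RecvCount x n ∉ Φ) → Φ ⊢ RecvCount x 0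
  unrel   : ∀ {x} → Φ ⊢ Created x → Released x ∉ Φ → Φ ⊢ Unreleased x
  cu⇒cr   : ∀ {x y} → Φ ⊢ CreatedUsing x y → Φ ⊢ Created y

eqR : Refob → Refob → Bool
eqR (ref x a b) (ref y c d) = (x ≡ᵇ y) ∧ (a ≡ᵇ c) ∧ (b ≡ᵇ d)

eqF : Fact → Fact → Bool
eqF (Created x)        (Created y)        = eqR x y
eqF (Released x)       (Released y)       = eqR x y
eqF (CreatedUsing x y) (CreatedUsing u v) = eqR x u ∧ eqR y v
eqF (Activated x)      (Activated y)      = eqR x y
eqF (Unreleased x)     (Unreleased y)     = eqR x y
eqF (SentCount x n)    (SentCount y m)    = eqR x y ∧ (n ≡ᵇ m)
eqF (RecvCount x n)    (RecvCount y m)    = eqR x y ∧ (n ≡ᵇ m)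
eqF _ _ = false

remove : Fact → KSet → KSet
remove φ = filterᵇ (λ ψ → not (eqF φ ψ))

isSentOf : Refob → Fact → Bool
isSentOf x (SentCount y _) = eqR x y
isSentOf x _ = false

isRecvOf : Refob → Fact → Bool
isRecvOf x (RecvCount y _) = eqR x y
isRecvOf x _ = false

removeSent removeRecv : Refob → KSet → KSet
removeSent x = filterᵇ (λ ψ → not (isSentOf x ψ))
removeRecv x = filterᵇ (λ ψ → not (isRecvOf x ψ))

anyᵇ : (Fact → Bool) → KSet → Bool
anyᵇ p [] = false
anyᵇ p (φ ∷ Φ) = if p φ then true else anyᵇ p Φ

bumpSent bumpRecv : Refob → Fact → Fact
bumpSent x (SentCount y n) = if eqR x y then SentCount y (suc n) else SentCount y n
bumpSent x φ = φ
bumpRecv x (RecvCount y n) = if eqR x y then RecvCount y (suc n) else RecvCount y n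
bumpRecv x φ = φ

IncSent IncRecv : Refob → KSet → KSet
IncSent x Φ = if anyᵇ (isSentOf x) Φ then map (bumpSent x) Φ else SentCount x 1 ∷ Φ
IncRecv x Φ = if anyᵇ (isRecvOf x) Φ then map (bumpRecv x) Φ else RecvCount x 1 ∷ Φ

data Msg : Set where
  App     : Refob → List Refob → Msg
  Info    : Refob → Refob → Actor → Msg
  Release : Refob → ℕ → Msg

data AState : Set where
  busy : KSet → AState
  idle : KSet → AState

knowledge : AState → KSet
knowledge (busy Φ) = Φ
knowledge (idle Φ) = Φ

-- (α, μ, ρ, χ); α is a partial map (nothing = not an internal actor),
-- μ A is the multiset (list) of undelivered messages of A.
record Config : Set where
  constructor cfg
  field
    α : Actor → Maybe AState
    μ : Actor → List Msg
    ρ : List Actor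
    χ : List Actor
open Config public

upd : {X : Set} → (Actor → X) → Actor → X → (Actor → X)
upd f a v b = if a ≡ᵇ b then v else f b

refActors : Refob → List Actor
refActors x = owner x ∷ target x ∷ []

factRefobs : Fact → List Refob
factRefobs (Created x)        = x ∷ []
factRefobs (Released x)       = x ∷ []
factRefobs (CreatedUsing x y) = x ∷ y ∷ []
factRefobs (Activated x)      = x ∷ []
factRefobs (Unreleased x)     = x ∷ []
factRefobs (SentCount x _)    = x ∷ []
factRefobs (RecvCount x _)    = x ∷ []

msgRefobs : Msg → List Refob
msgRefobs (App x R)      = x ∷ R
msgRefobs (Info y z _)   = y ∷ z ∷ []
msgRefobs (Release x _)  = x ∷ []

msgActors : Msg → List Actor
msgActors (App x R)     = concatMap refActors (x ∷ R)
msgActors (Info y z B)  = B ∷ refActors y ++ refActors z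
msgActors (Release x _) = refActors x

FreshToken : Config → Token → Set
FreshToken κ x =
  (∀ A s → α κ A ≡ just s → ∀ φ → φ ∈ knowledge s → ∀ r → r ∈ factRefobs φ → token r ≢ x) ×
  (∀ A m → m ∈ μ κ A → ∀ r → r ∈ msgRefobs m → token r ≢ x)

FreshActor : Config → Actor → Set
FreshActor κ B =
  (α κ B ≡ nothing) × (B ∉ χ κ) ×
  (∀ A s → α κ A ≡ just s → ∀ φ → φ ∈ knowledge s → ∀ r → r ∈ factRefobs φ → B ∉ refActors r) ×
  (∀ A m → m ∈ μ κ A → B ∉ msgActors m)

data Event : Set where
  spawnE       : Refob → Refob → Event
  sendE        : Refob → List (Refob × Token) → Actor → Event
                 -- Send(x, ys, zs, A, B, Cs): x : A → B, pairs (y_i : A → C_i , z_i)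
  receiveE     : Refob → Actor → List Refob → Event
  idleE        : Actor → Event
  sendInfoE    : Refob → Refob → Event
  infoE        : Refob → Refob → Actor → Actor → Event
  sendReleaseE : Refob → ℕ → Event
  releaseE     : Refob → ℕ → Event
  compactionE  : Refob → Event
  snapshotE    : Actor → KSet → Event
  inE          : Refob → Actor → List Refob → Event
  outE         : Refob → Actor → List Refob → Event
  releaseOutE  : Actor → Msg → Event
  infoOutE     : Actor → Msg → Event

sendCreated : Actor → List (Refob × Token) → List Refob
sendCreated B = map (λ p → ref (proj₂ p) B (target (proj₁ p)))

sendCU : Actor → List (Refob × Token) → KSet
sendCU B = map (λ p → CreatedUsing (proj₁ p) (ref (proj₂ p) B (target (proj₁ p))))

Consume : (Actor → List Msg) → Actor → Msg → (Actor → List Msg) → Set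
Consume μ₀ B m μ₁ = Σ (List Msg) λ l₁ → Σ (List Msg) λ l₂ →
  (μ₀ B ≡ l₁ ++ m ∷ l₂) × (μ₁ ≡ upd μ₀ B (l₁ ++ l₂))

put : (Actor → List Msg) → Actor → Msg → (Actor → List Msg)
put μ₀ B m = upd μ₀ B (μ₀ B ++ m ∷ [])

externalTargets internalTargets : (Actor → Maybe AState) → List Refob → List Actor
externalTargets α₀ R = map target (filterᵇ (λ r → is-nothing (α₀ (target r))) R)
internalTargets α₀ R = map target (filterᵇ (λ r → is-just (α₀ (target r))) R)

data Step : Config → Event → Config → Set where

  Spawn : ∀ {α μ ρ χ Φ} (x y : Refob) →
    let A = owner x ; B = target x in
    α A ≡ just (busy Φ) →
    owner y ≡ B → target y ≡ B → token x ≢ token y →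
    FreshToken (cfg α μ ρ χ) (token x) → FreshToken (cfg α μ ρ χ) (token y) →
    FreshActor (cfg α μ ρ χ) B →
    Step (cfg α μ ρ χ) (spawnE x y)
         (cfg (upd (upd α A (just (busy (Activated x ∷ Φ))))
                   B (just (busy (Created x ∷ Created y ∷ Activated y ∷ []))))
              μ ρ χ)

  Send : ∀ {α μ ρ χ Φ} (x : Refob) (yz : List (Refob × Token)) (A : Actor) →
    let B = target x in
    α A ≡ just (busy Φ) → owner x ≡ A → Φ ⊢ Activated x →
    All (λ p → owner (proj₁ p) ≡ A × Φ ⊢ Activated (proj₁ p)) yz →
    Unique (map proj₂ yz) →
    All (λ p → FreshToken (cfg α μ ρ χ) (proj₂ p)) yz →
    Step (cfg α μ ρ χ) (sendE x yz A)
         (cfg (upd α A (just (busy (IncSent x Φ ++ sendCU B yz))))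
              (put μ B (App x (sendCreated B yz))) ρ χ)

  Receive : ∀ {α μ μ' ρ χ Φ} (x : Refob) (B : Actor) (R : List Refob) →
    α B ≡ just (idle Φ) → Consume μ B (App x R) μ' →
    Step (cfg α μ ρ χ) (receiveE x B R)
         (cfg (upd α B (just (busy (IncRecv x Φ ++ map Activated R)))) μ' ρ χ)

  Idle : ∀ {α μ ρ χ Φ} (A : Actor) →
    α A ≡ just (busy Φ) →
    Step (cfg α μ ρ χ) (idleE A) (cfg (upd α A (just (idle Φ))) μ ρ χ)

  SendInfo : ∀ {α μ ρ χ Φ} (y z : Refob) →
    let A = owner y ; B = owner z ; C = target y in
    α A ≡ just (busy Φ) → target z ≡ C → CreatedUsing y z ∈ Φ →
    Step (cfg α μ ρ χ) (sendInfoE y z)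
         (cfg (upd α A (just (busy (IncSent y (remove (CreatedUsing y z) Φ)))))
              (put μ C (Info y z B)) ρ χ)

  InfoStep : ∀ {α μ μ' ρ χ Φ} (y z : Refob) (B C : Actor) →
    α C ≡ just (idle Φ) → Consume μ C (Info y z B) μ' →
    Step (cfg α μ ρ χ) (infoE y z B C)
         (cfg (upd α C (just (idle (IncRecv y Φ ++ Created z ∷ [])))) μ' ρ χ)

  SendRelease : ∀ {α μ ρ χ Φ} (x : Refob) (n : ℕ) →
    let A = owner x ; B = target x in
    α A ≡ just (busy Φ) → Activated x ∈ Φ → Φ ⊢ SentCount x n →
    (∀ y → CreatedUsing x y ∉ Φ) →
    Step (cfg α μ ρ χ) (sendReleaseE x n)
         (cfg (upd α A (just (busy (removeSent x (remove (Activated x) Φ)))))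
              (put μ B (Release x n)) ρ χ)

  ReleaseStep : ∀ {α μ μ' ρ χ Φ} (x : Refob) (n : ℕ) →
    let B = target x in
    α B ≡ just (idle Φ) → Consume μ B (Release x n) μ' → Φ ⊢ RecvCount x n →
    Step (cfg α μ ρ χ) (releaseE x n)
         (cfg (upd α B (just (idle (Released x ∷ Φ)))) μ' ρ χ)

  Compaction : ∀ {α μ ρ χ Φ} (x : Refob) →
    let C = target x in
    α C ≡ just (idle Φ) → Created x ∈ Φ → Released x ∈ Φ →
    Step (cfg α μ ρ χ) (compactionE x)
         (cfg (upd α C (just (idle (removeRecv x (remove (Released x) (remove (Created x) Φ))))))
              μ ρ χ)

  Snapshot : ∀ {α μ ρ χ} (A : Actor) (Φ : KSet) →
    α A ≡ just (idle Φ) →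
    Step (cfg α μ ρ χ) (snapshotE A Φ) (cfg α μ ρ χ)

  In : ∀ {α μ ρ χ} (x : Refob) (A : Actor) (R : List Refob) →
    A ∈ ρ → target x ≡ A → α (owner x) ≡ nothing →
    All (λ r → owner r ≡ A) R →
    All (λ r → FreshToken (cfg α μ ρ χ) (token r)) R →
    Unique (map token R) →
    All (λ r → (Σ AState λ s → α (target r) ≡ just s) → target r ∈ ρ) R →
    Step (cfg α μ ρ χ) (inE x A R)
         (cfg α (put μ A (App x R)) ρ (χ ++ externalTargets α R))

  Out : ∀ {α μ μ' ρ χ} (x : Refob) (B : Actor) (R : List Refob) →
    B ∈ χ → Consume μ B (App x R) μ' →
    Step (cfg α μ ρ χ) (outE x B R)
         (cfg α μ' (ρ ++ internalTargets α R) χ)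

  ReleaseOut : ∀ {α μ μ' ρ χ} (B : Actor) (x : Refob) (n : ℕ) →
    B ∈ χ → Consume μ B (Release x n) μ' →
    Step (cfg α μ ρ χ) (releaseOutE B (Release x n)) (cfg α μ' ρ χ)

  InfoOut : ∀ {α μ μ' ρ χ} (B C : Actor) (y z : Refob) →
    C ∈ χ → Consume μ C (Info y z B) μ' →
    Step (cfg α μ ρ χ) (infoOutE C (Info y z B)) (cfg α μ' ρ χ)

_⟶_ : Config → Config → Set
κ ⟶ κ' = Σ Event λ e → Step κ e κ'

_⟶*_ : Config → Config → Set
_⟶*_ = Star _⟶_

initialConfig : Actor → Actor → Token → Token → Config
initialConfig A E x y =
  cfg (λ B → if A ≡ᵇ B
               then just (busy (Activated (ref x A E) ∷ Created (ref y A A) ∷ Activated (ref y A A) ∷ []))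
               else nothing)
      (λ _ → []) [] (E ∷ [])

record Execution : Set where
  field
    A₀ E₀  : Actor
    x₀ y₀  : Token
    A₀≢E₀  : A₀ ≢ E₀
    x₀≢y₀  : x₀ ≢ y₀
    len    : ℕ
    κ      : ℕ → Config
    ev     : ℕ → Event
    start  : κ 0 ≡ initialConfig A₀ E₀ x₀ y₀
    steps  : ∀ s → s < len → Step (κ s) (ev s) (κ (suc s))
open Execution public

initialRefobs : Execution → List Refob
initialRefobs ex = ref (x₀ ex) (A₀ ex) (E₀ ex) ∷ ref (y₀ ex) (A₀ ex) (A₀ ex) ∷ []

Creates : Event → Refob → Set
Creates (spawnE x y)   r = r ≡ x ⊎ r ≡ y
Creates (sendE x yz A) r = r ∈ sendCreated (target x) yz
Creates (inE x A R)    r = r ∈ R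
Creates _              r = ⊥

Releases : Event → Refob → Set
Releases (releaseE x n) r = x ≡ r
Releases _              r = ⊥

-- r exists from time s on (created initially, s = 0, or by the event at time s-1)
CreatedAt : Execution → Refob → ℕ → Set
CreatedAt ex r zero    = r ∈ initialRefobs ex
CreatedAt ex r (suc s) = s < len ex × Creates (ev ex s) r

UnreleasedAt : Execution → ℕ → Refob → Set
UnreleasedAt ex t r = Σ ℕ λ s → s ≤ t × CreatedAt ex r s ×
  (∀ s' → s ≤ s' → s' < t → ¬ Releases (ev ex s') r)

Closed : Execution → ℕ → (Actor → Set) → Set
Closed ex t S = ∀ (x : Refob) → S (target x) → UnreleasedAt ex t x → S (owner x)

Terminated : Execution → ℕ → Actor → Set
Terminated ex t A =
  (Σ KSet λ Φ → α (κ ex t) A ≡ just (idle Φ)) ×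
  (∀ κ' → κ ex t ⟶* κ' → μ κ' A ≡ [])

Snapshots : Set
Snapshots = Actor → Maybe KSet

InDom : Snapshots → Actor → Set
InDom Q A = Σ KSet λ Φ → Q A ≡ just Φ

RecordedIn : Execution → Snapshots → Set
RecordedIn ex Q = ∀ A Φ → Q A ≡ just Φ → Σ ℕ λ s → s < len ex × ev ex s ≡ snapshotE A Φ

Consistent : Execution → ℕ → Snapshots → Set
Consistent ex t Q = ∀ A Φ → Q A ≡ just Φ →
  Σ AState λ st → α (κ ex t) A ≡ just st ×
    (∀ φ → (Φ ⊢ φ → knowledge st ⊢ φ) × (knowledge st ⊢ φ → Φ ⊢ φ))

_⊢at_∶_ : Snapshots → Actor → Fact → Set
Q ⊢at A ∶ φ = Σ KSet λ Φ → Q A ≡ just Φ × Φ ⊢ φ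

QActivated : Snapshots → Refob → Set
QActivated Q x = Q ⊢at owner x ∶ Activated x

QSentCount : Snapshots → Refob → ℕ → Set
QSentCount Q x n = Q ⊢at owner x ∶ SentCount x n

QCreatedUsing : Snapshots → Refob → Refob → Set
QCreatedUsing Q x y = Q ⊢at owner x ∶ CreatedUsing x y

QCreated : Snapshots → Refob → Set
QCreated Q x = Q ⊢at target x ∶ Created x

QReleased : Snapshots → Refob → Set
QReleased Q x = Q ⊢at target x ∶ Released x

QRecvCount : Snapshots → Refob → ℕ → Set
QRecvCount Q x n = Q ⊢at target x ∶ RecvCount x n

data QChain (Q : Snapshots) : Refob → Set where
  chain-base : ∀ {x} → QCreated Q x → ¬ QReleased Q x → QChain Q x
  chain-step : ∀ {x y} → QChain Q x → target y ≡ target x →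
               QCreatedUsing Q x y → ¬ QReleased Q y → QChain Q y

QRelevant : Snapshots → Refob → Set
QRelevant Q x = Σ ℕ λ n → QActivated Q x × QSentCount Q x n × QRecvCount Q x n

Finalized : Snapshots → Set
Finalized Q = ∀ (x : Refob) → InDom Q (target x) → QChain Q x →
  InDom Q (owner x) × QRelevant Q x

-- Everything follows from an invariant of all configurations reachable in an execution.
-- For a refob x : A → B, let presence(x) count the App messages carrying x to A, the fact
-- Activated x in A's knowledge, and the Release messages for x on their way to B.  It never
-- exceeds 1; it is 1 whenever B records x (by Created x, by a pending CreatedUsing, or by an
-- Info in transit), has not released it, and A is internal; and while x is held by A or on its
-- way to A, the SentCount of x at A equals the RecvCount of x at B plus the App and Info
-- messages sent along x that still wait in B's mailbox.
--
-- At time t the actors of S are terminated, so their mailboxes are empty.  If x ends a chain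
-- into B ∈ S, consistency turns the snapshot facts into facts of the configuration, so x is
-- recorded and not released at B; by the invariant x is unreleased, hence A ∈ S by closedness.
-- With both mailboxes empty, presence(x) = 1 says that A holds Activated x, and the count
-- equation becomes SentCount(x, n) at A together with RecvCount(x, n) at B.

module Submission where

open import Defs
open import Data.Nat using (ℕ; _≤_; zero; suc; _+_; _*_; _<_; z≤n; s≤s; _≟_; _≡ᵇ_)
open import Data.Nat.Properties
  using ( ≡ᵇ⇒≡; ≡⇒≡ᵇ; +-comm; +-assoc; ≤-refl; ≤-trans; m≤n⇒m≤1+n; ≤⇒≯
        ; ≤-pred; +-suc; m≤m+n; m≤n+m; +-identityʳ; n≤0⇒n≡0; ≤-reflexive
        ; +-monoˡ-≤; +-mono-≤; +-cancelʳ-≤; <⇒≤; *-zeroʳ; m≤n⇒m<n∨m≡n; n<1⇒n≡0; ≰⇒> )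
open import Data.Product using (_×_; Σ; _,_; proj₁; proj₂)
open import Data.Bool using (Bool; true; false; if_then_else_; not; _∧_; T)
open import Data.Bool.Properties using (T?)
open import Data.Unit using (tt; ⊤)
open import Data.List using (List; []; _∷_; _++_; map; filterᵇ; length; concatMap)
open import Data.List.Properties using (++-assoc; map-++; ++-identityʳ)
open import Data.List.Membership.Propositional using (_∈_; _∉_)
open import Data.List.Membership.Propositional.Properties using (∈-++⁺ˡ; ∈-++⁺ʳ; ∈-++⁻; ∈-map⁺; ∈-map⁻; ∈-filter⁺; ∈-filter⁻)
open import Data.List.Relation.Unary.Any using (here; there; any?)
open import Data.List.Relation.Unary.Any.Properties using (¬Any[])
open import Data.List.Relation.Unary.All using (All; []; _∷_; lookup)
open import Data.List.Relation.Unary.All.Properties using (map⁻)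
open import Data.List.Relation.Unary.AllPairs using ([]; _∷_)
open import Data.List.Relation.Unary.Unique.Propositional using (Unique)
open import Data.Maybe using (Maybe; just; nothing; is-nothing)
open import Data.Sum using (_⊎_; inj₁; inj₂; [_,_]′)
open import Data.Empty using (⊥; ⊥-elim)
open import Function using (_∘_)
open import Relation.Nullary using (¬_; Dec; yes; no)
open import Relation.Binary.Construct.Closure.ReflexiveTransitive using (ε)
open import Relation.Binary.PropositionalEquality using (_≡_; _≢_; refl; sym; trans; cong; cong₂; subst)

true≢false : true ≢ false
true≢false ()

T⇒≡true : ∀ {b} → T b → b ≡ true
T⇒≡true {true} _ = refl

≡true⇒T : ∀ {b} → b ≡ true → T b
≡true⇒T refl = tt

≡ᵇ-true⇒≡ : ∀ {m n} → (m ≡ᵇ n) ≡ true → m ≡ n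
≡ᵇ-true⇒≡ {m} {n} h = ≡ᵇ⇒≡ m n (≡true⇒T h)

≡ᵇ-refl : ∀ n → (n ≡ᵇ n) ≡ true
≡ᵇ-refl n = T⇒≡true (≡⇒≡ᵇ n n refl)

≢⇒≡ᵇ-false : ∀ {m n} → m ≢ n → (m ≡ᵇ n) ≡ false
≢⇒≡ᵇ-false {m} {n} m≢n with m ≡ᵇ n in e
... | true = ⊥-elim (m≢n (≡ᵇ-true⇒≡ e))
... | false = refl

∧-true⇒ : ∀ {a b} → (a ∧ b) ≡ true → a ≡ true × b ≡ true
∧-true⇒ {true} h = refl , h

eqR⇒≡ : ∀ r s → eqR r s ≡ true → r ≡ s
eqR⇒≡ (ref x a b) (ref y c d) h
  with ∧-true⇒ {x ≡ᵇ y} h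
... | x≡y , h′ with ∧-true⇒ {a ≡ᵇ c} h′
... | a≡c , b≡d
  rewrite ≡ᵇ-true⇒≡ {x} x≡y | ≡ᵇ-true⇒≡ {a} a≡c | ≡ᵇ-true⇒≡ {b} b≡d = refl

eqR-refl : ∀ r → eqR r r ≡ true
eqR-refl (ref x a b) rewrite ≡ᵇ-refl x | ≡ᵇ-refl a | ≡ᵇ-refl b = refl

≢⇒eqR-false : ∀ {r s} → r ≢ s → eqR r s ≡ false
≢⇒eqR-false {r} {s} r≢s with eqR r s in e
... | true = ⊥-elim (r≢s (eqR⇒≡ r s e))
... | false = refl

_≟R_ : (r s : Refob) → Dec (r ≡ s)
r ≟R s with eqR r s in e
... | true = yes (eqR⇒≡ r s e)
... | false = no λ { refl → true≢false (trans (sym (eqR-refl r)) e) }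

eqF⇒≡ : ∀ φ ψ → eqF φ ψ ≡ true → φ ≡ ψ
eqF⇒≡ (Created x) (Created y) h = cong Created (eqR⇒≡ x y h)
eqF⇒≡ (Released x) (Released y) h = cong Released (eqR⇒≡ x y h)
eqF⇒≡ (CreatedUsing x x′) (CreatedUsing y y′) h with ∧-true⇒ {eqR x y} h
... | p , q = cong₂ CreatedUsing (eqR⇒≡ x y p) (eqR⇒≡ x′ y′ q)
eqF⇒≡ (Activated x) (Activated y) h = cong Activated (eqR⇒≡ x y h)
eqF⇒≡ (Unreleased x) (Unreleased y) h = cong Unreleased (eqR⇒≡ x y h)
eqF⇒≡ (SentCount x m) (SentCount y n) h with ∧-true⇒ {eqR x y} h
... | p , q = cong₂ SentCount (eqR⇒≡ x y p) (≡ᵇ-true⇒≡ q)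
eqF⇒≡ (RecvCount x m) (RecvCount y n) h with ∧-true⇒ {eqR x y} h
... | p , q = cong₂ RecvCount (eqR⇒≡ x y p) (≡ᵇ-true⇒≡ q)
eqF⇒≡ (Created _) (Released _) ()
eqF⇒≡ (Created _) (CreatedUsing _ _) ()
eqF⇒≡ (Created _) (Activated _) ()
eqF⇒≡ (Created _) (Unreleased _) ()
eqF⇒≡ (Created _) (SentCount _ _) ()
eqF⇒≡ (Created _) (RecvCount _ _) ()
eqF⇒≡ (Released _) (Created _) ()
eqF⇒≡ (Released _) (CreatedUsing _ _) ()
eqF⇒≡ (Released _) (Activated _) ()
eqF⇒≡ (Released _) (Unreleased _) ()
eqF⇒≡ (Released _) (SentCount _ _) ()
eqF⇒≡ (Released _) (RecvCount _ _) ()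
eqF⇒≡ (CreatedUsing _ _) (Created _) ()
eqF⇒≡ (CreatedUsing _ _) (Released _) ()
eqF⇒≡ (CreatedUsing _ _) (Activated _) ()
eqF⇒≡ (CreatedUsing _ _) (Unreleased _) ()
eqF⇒≡ (CreatedUsing _ _) (SentCount _ _) ()
eqF⇒≡ (CreatedUsing _ _) (RecvCount _ _) ()
eqF⇒≡ (Activated _) (Created _) ()
eqF⇒≡ (Activated _) (Released _) ()
eqF⇒≡ (Activated _) (CreatedUsing _ _) ()
eqF⇒≡ (Activated _) (Unreleased _) ()
eqF⇒≡ (Activated _) (SentCount _ _) ()
eqF⇒≡ (Activated _) (RecvCount _ _) ()
eqF⇒≡ (Unreleased _) (Created _) ()
eqF⇒≡ (Unreleased _) (Released _) ()
eqF⇒≡ (Unreleased _) (CreatedUsing _ _) ()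
eqF⇒≡ (Unreleased _) (Activated _) ()
eqF⇒≡ (Unreleased _) (SentCount _ _) ()
eqF⇒≡ (Unreleased _) (RecvCount _ _) ()
eqF⇒≡ (SentCount _ _) (Created _) ()
eqF⇒≡ (SentCount _ _) (Released _) ()
eqF⇒≡ (SentCount _ _) (CreatedUsing _ _) ()
eqF⇒≡ (SentCount _ _) (Activated _) ()
eqF⇒≡ (SentCount _ _) (Unreleased _) ()
eqF⇒≡ (SentCount _ _) (RecvCount _ _) ()
eqF⇒≡ (RecvCount _ _) (Created _) ()
eqF⇒≡ (RecvCount _ _) (Released _) ()
eqF⇒≡ (RecvCount _ _) (CreatedUsing _ _) ()
eqF⇒≡ (RecvCount _ _) (Activated _) ()
eqF⇒≡ (RecvCount _ _) (Unreleased _) ()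
eqF⇒≡ (RecvCount _ _) (SentCount _ _) ()

eqF-refl : ∀ φ → eqF φ φ ≡ true
eqF-refl (Created x) = eqR-refl x
eqF-refl (Released x) = eqR-refl x
eqF-refl (CreatedUsing x y) rewrite eqR-refl x | eqR-refl y = refl
eqF-refl (Activated x) = eqR-refl x
eqF-refl (Unreleased x) = eqR-refl x
eqF-refl (SentCount x n) rewrite eqR-refl x | ≡ᵇ-refl n = refl
eqF-refl (RecvCount x n) rewrite eqR-refl x | ≡ᵇ-refl n = refl

≢⇒eqF-false : ∀ {φ ψ} → φ ≢ ψ → eqF φ ψ ≡ false
≢⇒eqF-false {φ} {ψ} φ≢ψ with eqF φ ψ in e
... | true = ⊥-elim (φ≢ψ (eqF⇒≡ φ ψ e))
... | false = refl

_≟F_ : (φ ψ : Fact) → Dec (φ ≡ ψ)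
φ ≟F ψ with eqF φ ψ in e
... | true = yes (eqF⇒≡ φ ψ e)
... | false = no λ { refl → true≢false (trans (sym (eqF-refl φ)) e) }

∈-filterᵇ⁻ : ∀ {A : Set} (p : A → Bool) {x : A} xs → x ∈ filterᵇ p xs → x ∈ xs × p x ≡ true
∈-filterᵇ⁻ p xs h with ∈-filter⁻ (T? ∘ p) {xs = xs} h
... | x∈xs , px = x∈xs , T⇒≡true px

∈-filterᵇ⁺ : ∀ {A : Set} (p : A → Bool) {x : A} xs → x ∈ xs → p x ≡ true → x ∈ filterᵇ p xs
∈-filterᵇ⁺ p xs x∈xs px = ∈-filter⁺ (T? ∘ p) {xs = xs} x∈xs (≡true⇒T px)

∈-remove⁻ : ∀ φ {ψ} Φ → ψ ∈ remove φ Φ → ψ ∈ Φ × ψ ≢ φ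
∈-remove⁻ φ Φ h with ∈-filterᵇ⁻ (λ ψ → not (eqF φ ψ)) Φ h
... | ψ∈Φ , keep = ψ∈Φ , λ { refl → true≢false (trans (sym keep) (cong not (eqF-refl φ))) }

∈-remove⁺ : ∀ φ {ψ} Φ → ψ ∈ Φ → ψ ≢ φ → ψ ∈ remove φ Φ
∈-remove⁺ φ Φ ψ∈Φ ψ≢φ =
  ∈-filterᵇ⁺ (λ ψ → not (eqF φ ψ)) Φ ψ∈Φ (cong not (≢⇒eqF-false λ e → ψ≢φ (sym e)))

⊢Activated⁻ : ∀ {Φ x} → Φ ⊢ Activated x → Activated x ∈ Φ
⊢Activated⁻ (ax h) = h

⊢CreatedUsing⁻ : ∀ {Φ x y} → Φ ⊢ CreatedUsing x y → CreatedUsing x y ∈ Φ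
⊢CreatedUsing⁻ (ax h) = h

⊢Created⁻ : ∀ {Φ x} → Φ ⊢ Created x → Created x ∈ Φ ⊎ Σ Refob λ w → CreatedUsing w x ∈ Φ
⊢Created⁻ (ax h) = inj₁ h
⊢Created⁻ (cu⇒cr d) = inj₂ (_ , ⊢CreatedUsing⁻ d)

-- Counters in knowledge sets

data Counter : Set where
  sent received : Counter

counterFact : Counter → Refob → ℕ → Fact
counterFact sent = SentCount
counterFact received = RecvCount

isCounterOf : Counter → Refob → Fact → Bool
isCounterOf sent = isSentOf
isCounterOf received = isRecvOf

bump : Counter → Refob → Fact → Fact
bump sent = bumpSent
bump received = bumpRecv

increment : Counter → Refob → KSet → KSet
increment sent = IncSent
increment received = IncRecv

clear : Counter → Refob → KSet → KSet
clear sent = removeSent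
clear received = removeRecv

NotCounter : Counter → Fact → Set
NotCounter sent (SentCount _ _) = ⊥
NotCounter received (RecvCount _ _) = ⊥
NotCounter _ _ = ⊤

reading : Counter → Refob → Fact → List ℕ
reading sent x (SentCount y n) = if eqR x y then n ∷ [] else []
reading received x (RecvCount y n) = if eqR x y then n ∷ [] else []
reading _ _ _ = []

readings : Counter → Refob → KSet → List ℕ
readings k x [] = []
readings k x (φ ∷ Φ) = reading k x φ ++ readings k x Φ

-- An absent counter reads as 0, matching the derivation rules sent0 and recv0.
headOr0 : List ℕ → ℕ
headOr0 [] = 0
headOr0 (n ∷ _) = n

value : Counter → Refob → KSet → ℕ
value k x Φ = headOr0 (readings k x Φ)

incReadings : List ℕ → List ℕ
incReadings [] = 1 ∷ []
incReadings (n ∷ l) = map suc (n ∷ l)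

-- The only case analysis on the constructors of Fact; the counter lemmas below go through it.
data CounterView (k : Counter) : Fact → Set where
  counter : ∀ y n → CounterView k (counterFact k y n)
  plain : ∀ {φ} → NotCounter k φ → (∀ x → bump k x φ ≡ φ) → (∀ x → isCounterOf k x φ ≡ false) →
          (∀ x → reading k x φ ≡ []) → CounterView k φ

view : ∀ k φ → CounterView k φ
view sent (SentCount y n) = counter y n
view received (RecvCount y n) = counter y n
view sent (Created _) = plain _ (λ _ → refl) (λ _ → refl) (λ _ → refl)
view sent (Released _) = plain _ (λ _ → refl) (λ _ → refl) (λ _ → refl)
view sent (CreatedUsing _ _) = plain _ (λ _ → refl) (λ _ → refl) (λ _ → refl)
view sent (Activated _) = plain _ (λ _ → refl) (λ _ → refl) (λ _ → refl)
view sent (Unreleased _) = plain _ (λ _ → refl) (λ _ → refl) (λ _ → refl)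
view sent (RecvCount _ _) = plain _ (λ _ → refl) (λ _ → refl) (λ _ → refl)
view received (Created _) = plain _ (λ _ → refl) (λ _ → refl) (λ _ → refl)
view received (Released _) = plain _ (λ _ → refl) (λ _ → refl) (λ _ → refl)
view received (CreatedUsing _ _) = plain _ (λ _ → refl) (λ _ → refl) (λ _ → refl)
view received (Activated _) = plain _ (λ _ → refl) (λ _ → refl) (λ _ → refl)
view received (Unreleased _) = plain _ (λ _ → refl) (λ _ → refl) (λ _ → refl)
view received (SentCount _ _) = plain _ (λ _ → refl) (λ _ → refl) (λ _ → refl)

counterFact-isCounter : ∀ k {y n} → NotCounter k (counterFact k y n) → ⊥
counterFact-isCounter sent ()
counterFact-isCounter received ()

counterFact-mentions : ∀ k {x n} → x ∈ factRefobs (counterFact k x n)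
counterFact-mentions sent = here refl
counterFact-mentions received = here refl

bump-counterFact : ∀ k x y n → bump k x (counterFact k y n) ≡ counterFact k y (if eqR x y then suc n else n)
bump-counterFact sent x y n with eqR x y
... | true = refl
... | false = refl
bump-counterFact received x y n with eqR x y
... | true = refl
... | false = refl

isCounterOf-counterFact : ∀ k x y n → isCounterOf k x (counterFact k y n) ≡ eqR x y
isCounterOf-counterFact sent x y n = refl
isCounterOf-counterFact received x y n = refl

reading-counterFact : ∀ k x y n → reading k x (counterFact k y n) ≡ (if eqR x y then n ∷ [] else [])
reading-counterFact sent x y n = refl
reading-counterFact received x y n = refl

bump-NotCounter : ∀ k x {φ} → NotCounter k φ → bump k x φ ≡ φ
bump-NotCounter k x {φ} nc with view k φ
... | counter y n = ⊥-elim (counterFact-isCounter k nc)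
... | plain _ b _ _ = b x

reading-NotCounter : ∀ k x {φ} → NotCounter k φ → reading k x φ ≡ []
reading-NotCounter k x {φ} nc with view k φ
... | counter y n = ⊥-elim (counterFact-isCounter k nc)
... | plain _ _ _ r = r x

NotCounter-bump⁻ : ∀ k x φ → NotCounter k (bump k x φ) → NotCounter k φ
NotCounter-bump⁻ k x φ nc with view k φ
... | counter y n rewrite bump-counterFact k x y n = ⊥-elim (counterFact-isCounter k nc)
... | plain nc′ _ _ _ = nc′

increment-unfold : ∀ k x Φ → increment k x Φ ≡
  (if anyᵇ (isCounterOf k x) Φ then map (bump k x) Φ else counterFact k x 1 ∷ Φ)
increment-unfold sent x Φ = refl
increment-unfold received x Φ = refl

clear-unfold : ∀ k x Φ → clear k x Φ ≡ filterᵇ (λ ψ → not (isCounterOf k x ψ)) Φ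
clear-unfold sent x Φ = refl
clear-unfold received x Φ = refl

∈-increment⁻ : ∀ k x Φ {φ} → NotCounter k φ → φ ∈ increment k x Φ → φ ∈ Φ
∈-increment⁻ k x Φ {φ} nc h rewrite increment-unfold k x Φ with anyᵇ (isCounterOf k x) Φ
... | true with ∈-map⁻ (bump k x) h
...   | ψ , ψ∈Φ , refl rewrite bump-NotCounter k x (NotCounter-bump⁻ k x ψ nc) = ψ∈Φ
∈-increment⁻ k x Φ nc (here refl) | false = ⊥-elim (counterFact-isCounter k nc)
∈-increment⁻ k x Φ nc (there h) | false = h

∈-increment⁺ : ∀ k x Φ {φ} → NotCounter k φ → φ ∈ Φ → φ ∈ increment k x Φ
∈-increment⁺ k x Φ {φ} nc h rewrite increment-unfold k x Φ with anyᵇ (isCounterOf k x) Φ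
... | true = subst (_∈ map (bump k x) Φ) (bump-NotCounter k x nc) (∈-map⁺ (bump k x) h)
... | false = there h

∈-clear⁻ : ∀ k x Φ {φ} → φ ∈ clear k x Φ → φ ∈ Φ
∈-clear⁻ k x Φ h rewrite clear-unfold k x Φ = proj₁ (∈-filterᵇ⁻ _ Φ h)

∈-clear⁺ : ∀ k x Φ {φ} → NotCounter k φ → φ ∈ Φ → φ ∈ clear k x Φ
∈-clear⁺ k x Φ {φ} nc h rewrite clear-unfold k x Φ with view k φ
... | counter y n = ⊥-elim (counterFact-isCounter k nc)
... | plain _ _ c _ = ∈-filterᵇ⁺ _ Φ h (cong not (c x))

readings-++ : ∀ k x Φ Ψ → readings k x (Φ ++ Ψ) ≡ readings k x Φ ++ readings k x Ψ
readings-++ k x [] Ψ = refl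
readings-++ k x (φ ∷ Φ) Ψ rewrite readings-++ k x Φ Ψ = sym (++-assoc (reading k x φ) _ _)

readings-map : ∀ {A : Set} k x (f : A → Fact) → (∀ a → NotCounter k (f a)) → ∀ as → readings k x (map f as) ≡ []
readings-map k x f nc [] = refl
readings-map k x f nc (a ∷ as) rewrite reading-NotCounter k x (nc a) = readings-map k x f nc as

readings-++-map : ∀ {A : Set} k x Φ (f : A → Fact) → (∀ a → NotCounter k (f a)) → ∀ as →
                  readings k x (Φ ++ map f as) ≡ readings k x Φ
readings-++-map k x Φ f nc as
  rewrite readings-++ k x Φ (map f as) | readings-map k x f nc as = ++-identityʳ _

reading-counterFact-other : ∀ k k′ x y n → (k′ , y) ≢ (k , x) → reading k′ y (counterFact k x n) ≡ []
reading-counterFact-other sent sent x y n ne rewrite ≢⇒eqR-false (λ e → ne (cong (sent ,_) e)) = refl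
reading-counterFact-other sent received x y n _ = refl
reading-counterFact-other received sent x y n _ = refl
reading-counterFact-other received received x y n ne rewrite ≢⇒eqR-false (λ e → ne (cong (received ,_) e)) = refl

reading-bump-same : ∀ k x φ → reading k x (bump k x φ) ≡ map suc (reading k x φ)
reading-bump-same k x φ with view k φ
... | plain _ b _ r rewrite b x | r x = refl
... | counter y n rewrite bump-counterFact k x y n | reading-counterFact k x y (if eqR x y then suc n else n)
                        | reading-counterFact k x y n with eqR x y
...   | true = refl
...   | false = refl

reading-bump-other : ∀ k k′ x y φ → (k′ , y) ≢ (k , x) → reading k′ y (bump k x φ) ≡ reading k′ y φ
reading-bump-other k k′ x y φ ne with view k φ
... | plain _ b _ _ rewrite b x = refl
... | counter z n rewrite bump-counterFact k x z n = byCounter k k′ ne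
  where
  m = if eqR x z then suc n else n

  sameCounter : ∀ k → y ≢ x → reading k y (counterFact k z m) ≡ reading k y (counterFact k z n)
  sameCounter k y≢x rewrite reading-counterFact k y z m | reading-counterFact k y z n with eqR y z in e
  ... | false = refl
  ... | true with eqR⇒≡ y z e
  ...   | refl rewrite ≢⇒eqR-false (λ x≡y → y≢x (sym x≡y)) = refl

  byCounter : ∀ k k′ → (k′ , y) ≢ (k , x) → reading k′ y (counterFact k z m) ≡ reading k′ y (counterFact k z n)
  byCounter sent sent ne = sameCounter sent λ e → ne (cong (sent ,_) e)
  byCounter sent received _ = refl
  byCounter received sent _ = refl
  byCounter received received ne = sameCounter received λ e → ne (cong (received ,_) e)

readings-map-bump-same : ∀ k x Φ → readings k x (map (bump k x) Φ) ≡ map suc (readings k x Φ)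
readings-map-bump-same k x [] = refl
readings-map-bump-same k x (φ ∷ Φ)
  rewrite reading-bump-same k x φ | readings-map-bump-same k x Φ = sym (map-++ suc (reading k x φ) _)

readings-map-bump-other : ∀ k k′ x y Φ → (k′ , y) ≢ (k , x) → readings k′ y (map (bump k x) Φ) ≡ readings k′ y Φ
readings-map-bump-other k k′ x y [] ne = refl
readings-map-bump-other k k′ x y (φ ∷ Φ) ne
  rewrite reading-bump-other k k′ x y φ ne | readings-map-bump-other k k′ x y Φ ne = refl

isCounterOf-false : ∀ k x φ → isCounterOf k x φ ≡ false → reading k x φ ≡ []
isCounterOf-false k x φ h with view k φ
... | plain _ _ _ r = r x
... | counter y n rewrite isCounterOf-counterFact k x y n | reading-counterFact k x y n | h = refl

isCounterOf-true : ∀ k x φ → isCounterOf k x φ ≡ true → Σ ℕ λ n → φ ≡ counterFact k x n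
isCounterOf-true k x φ h with view k φ
... | plain _ _ c _ = ⊥-elim (true≢false (trans (sym h) (c x)))
... | counter y n rewrite isCounterOf-counterFact k x y n | eqR⇒≡ x y h = n , refl

readings-none : ∀ k x Φ → anyᵇ (isCounterOf k x) Φ ≡ false → readings k x Φ ≡ []
readings-none k x [] _ = refl
readings-none k x (φ ∷ Φ) h with isCounterOf k x φ in e
... | false rewrite isCounterOf-false k x φ e = readings-none k x Φ h

readings-some : ∀ k x Φ → anyᵇ (isCounterOf k x) Φ ≡ true → readings k x Φ ≢ []
readings-some k x (φ ∷ Φ) h with isCounterOf k x φ in e
... | false rewrite isCounterOf-false k x φ e = readings-some k x Φ h
... | true with isCounterOf-true k x φ e
...   | n , refl rewrite reading-counterFact k x x n | eqR-refl x = λ ()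

readings-increment-same : ∀ k x Φ → readings k x (increment k x Φ) ≡ incReadings (readings k x Φ)
readings-increment-same k x Φ rewrite increment-unfold k x Φ with anyᵇ (isCounterOf k x) Φ in e
... | true = trans (readings-map-bump-same k x Φ) (nonempty (readings k x Φ) (readings-some k x Φ e))
  where
  nonempty : ∀ l → l ≢ [] → map suc l ≡ incReadings l
  nonempty [] l≢[] = ⊥-elim (l≢[] refl)
  nonempty (_ ∷ _) _ = refl
... | false rewrite readings-none k x Φ e | reading-counterFact k x x 1 | eqR-refl x = refl

readings-increment-other : ∀ k k′ x y Φ → (k′ , y) ≢ (k , x) → readings k′ y (increment k x Φ) ≡ readings k′ y Φ
readings-increment-other k k′ x y Φ ne rewrite increment-unfold k x Φ with anyᵇ (isCounterOf k x) Φ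
... | true = readings-map-bump-other k k′ x y Φ ne
... | false = cong (_++ readings k′ y Φ) (reading-counterFact-other k k′ x y 1 ne)

readings-filter : ∀ k x (p : Fact → Bool) Φ → (∀ φ → p φ ≡ false → reading k x φ ≡ []) →
                  readings k x (filterᵇ p Φ) ≡ readings k x Φ
readings-filter k x p [] _ = refl
readings-filter k x p (φ ∷ Φ) dropped with p φ in e
... | true = cong (reading k x φ ++_) (readings-filter k x p Φ dropped)
... | false rewrite dropped φ e = readings-filter k x p Φ dropped

readings-remove : ∀ k x φ Φ → NotCounter k φ → readings k x (remove φ Φ) ≡ readings k x Φ
readings-remove k x φ Φ nc = readings-filter k x _ Φ dropped
  where
  dropped : ∀ ψ → not (eqF φ ψ) ≡ false → reading k x ψ ≡ []
  dropped ψ e with eqF φ ψ in e′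
  dropped ψ refl | true rewrite eqF⇒≡ φ ψ e′ = reading-NotCounter k x nc

readings-clear-same : ∀ k x Φ → readings k x (clear k x Φ) ≡ []
readings-clear-same k x Φ rewrite clear-unfold k x Φ = go Φ
  where
  go : ∀ Φ → readings k x (filterᵇ (λ ψ → not (isCounterOf k x ψ)) Φ) ≡ []
  go [] = refl
  go (φ ∷ Φ) with isCounterOf k x φ in e
  ... | true = go Φ
  ... | false rewrite isCounterOf-false k x φ e = go Φ

readings-clear-other : ∀ k k′ x y Φ → (k′ , y) ≢ (k , x) → readings k′ y (clear k x Φ) ≡ readings k′ y Φ
readings-clear-other k k′ x y Φ ne rewrite clear-unfold k x Φ = readings-filter k′ y _ Φ dropped
  where
  dropped : ∀ φ → not (isCounterOf k x φ) ≡ false → reading k′ y φ ≡ []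
  dropped φ e with isCounterOf k x φ in e′
  dropped φ refl | true with isCounterOf-true k x φ e′
  ... | n , refl = reading-counterFact-other k k′ x y n ne

∈readings⇒∈ : ∀ k x n Φ → n ∈ readings k x Φ → counterFact k x n ∈ Φ
∈readings⇒∈ k x n (φ ∷ Φ) h with ∈-++⁻ (reading k x φ) h
... | inj₂ i = there (∈readings⇒∈ k x n Φ i)
... | inj₁ i with view k φ
...   | plain _ _ _ r rewrite r x = ⊥-elim (¬Any[] i)
...   | counter y m rewrite reading-counterFact k x y m with eqR x y in e
...     | true rewrite eqR⇒≡ x y e with i
...       | here refl = here refl

∈⇒∈readings : ∀ k x n Φ → counterFact k x n ∈ Φ → n ∈ readings k x Φ
∈⇒∈readings k x n (φ ∷ Φ) (here refl) rewrite reading-counterFact k x x n | eqR-refl x = here refl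
∈⇒∈readings k x n (φ ∷ Φ) (there h) = ∈-++⁺ʳ (reading k x φ) (∈⇒∈readings k x n Φ h)

absent⇒readings-empty : ∀ k {Φ x} → (∀ n → counterFact k x n ∉ Φ) → readings k x Φ ≡ []
absent⇒readings-empty k {Φ} {x} absent with readings k x Φ in e
... | [] = refl
... | n ∷ _ = ⊥-elim (absent n (∈readings⇒∈ k x n Φ (subst (n ∈_) (sym e) (here refl))))

⊢counter⁻ : ∀ k {Φ x n} → Φ ⊢ counterFact k x n → n ∈ readings k x Φ ⊎ (readings k x Φ ≡ [] × n ≡ 0)
⊢counter⁻ sent {Φ} {x} {n} (ax h) = inj₁ (∈⇒∈readings sent x n Φ h)
⊢counter⁻ sent (sent0 absent) = inj₂ (absent⇒readings-empty sent absent , refl)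
⊢counter⁻ received {Φ} {x} {n} (ax h) = inj₁ (∈⇒∈readings received x n Φ h)
⊢counter⁻ received (recv0 absent) = inj₂ (absent⇒readings-empty received absent , refl)

⊢value : ∀ k x Φ → Φ ⊢ counterFact k x (value k x Φ)
⊢value k x Φ with readings k x Φ in e
... | n ∷ _ = ax (∈readings⇒∈ k x n Φ (subst (n ∈_) (sym e) (here refl)))
... | [] = zero-by-default k λ n h → ¬Any[] (subst (n ∈_) e (∈⇒∈readings k x n Φ h))
  where
  zero-by-default : ∀ k → (∀ n → counterFact k x n ∉ Φ) → Φ ⊢ counterFact k x 0
  zero-by-default sent = sent0
  zero-by-default received = recv0

⊢counter-unique : ∀ k {Φ x n} → length (readings k x Φ) ≤ 1 → Φ ⊢ counterFact k x n → n ≡ value k x Φ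
⊢counter-unique k {Φ} {x} le d with ⊢counter⁻ k d
... | inj₂ (e , refl) rewrite e = refl
... | inj₁ i = singleton (readings k x Φ) le i
  where
  singleton : ∀ {n} l → length l ≤ 1 → n ∈ l → n ≡ headOr0 l
  singleton (_ ∷ []) _ (here refl) = refl
  singleton (_ ∷ _ ∷ _) (s≤s ()) _

headOr0-incReadings : ∀ l → headOr0 (incReadings l) ≡ suc (headOr0 l)
headOr0-incReadings [] = refl
headOr0-incReadings (_ ∷ _) = refl

length-incReadings : ∀ l → length l ≤ 1 → length (incReadings l) ≤ 1
length-incReadings [] _ = s≤s z≤n
length-incReadings (_ ∷ []) _ = s≤s z≤n
length-incReadings (_ ∷ _ ∷ _) (s≤s ())

-- Configurations, mailboxes and message counts

upd-same : ∀ {X : Set} (f : Actor → X) a v → upd f a v a ≡ v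
upd-same f a v rewrite ≡ᵇ-refl a = refl

upd-other : ∀ {X : Set} (f : Actor → X) a v b → a ≢ b → upd f a v b ≡ f b
upd-other f a v b a≢b rewrite ≢⇒≡ᵇ-false a≢b = refl

knowledgeOf : Maybe AState → KSet
knowledgeOf nothing = []
knowledgeOf (just s) = knowledge s

K : Config → Actor → KSet
K κ A = knowledgeOf (α κ A)

InDomain : (Actor → Maybe AState) → Actor → Set
InDomain a A = Σ AState λ s → a A ≡ just s

Internal : Config → Actor → Set
Internal κ A = InDomain (α κ) A

indicator : ∀ {X : Set} → Dec X → ℕ
indicator (yes _) = 1
indicator (no _) = 0

indicator-yes : ∀ {X : Set} (d : Dec X) → X → indicator d ≡ 1
indicator-yes (yes _) _ = refl
indicator-yes (no ¬x) x = ⊥-elim (¬x x)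

indicator-no : ∀ {X : Set} (d : Dec X) → ¬ X → indicator d ≡ 0
indicator-no (yes x) ¬x = ⊥-elim (¬x x)
indicator-no (no _) _ = refl

indicator≤1 : ∀ {X : Set} (d : Dec X) → indicator d ≤ 1
indicator≤1 (yes _) = s≤s z≤n
indicator≤1 (no _) = z≤n

indicator⇒ : ∀ {X : Set} (d : Dec X) → 1 ≤ indicator d → X
indicator⇒ (yes x) _ = x

indicator-cong : ∀ {X Y : Set} (d : Dec X) (e : Dec Y) → (X → Y) → (Y → X) → indicator d ≡ indicator e
indicator-cong (yes _) (yes _) _ _ = refl
indicator-cong (yes x) (no ¬y) f _ = ⊥-elim (¬y (f x))
indicator-cong (no ¬x) (yes y) _ g = ⊥-elim (¬x (g y))
indicator-cong (no _) (no _) _ _ = refl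

activated : Refob → KSet → ℕ
activated x Φ = indicator (any? (Activated x ≟F_) Φ)

activated-cong : ∀ x Φ Ψ → (Activated x ∈ Φ → Activated x ∈ Ψ) → (Activated x ∈ Ψ → Activated x ∈ Φ) →
                 activated x Φ ≡ activated x Ψ
activated-cong x Φ Ψ = indicator-cong (any? (Activated x ≟F_) Φ) (any? (Activated x ≟F_) Ψ)

_∈R?_ : (r : Refob) (R : List Refob) → Dec (r ∈ R)
r ∈R? R = any? (r ≟R_) R

activated-∈ : ∀ {x Φ} → Activated x ∈ Φ → activated x Φ ≡ 1
activated-∈ {x} {Φ} = indicator-yes (any? (Activated x ≟F_) Φ)

activated-∉ : ∀ {x Φ} → Activated x ∉ Φ → activated x Φ ≡ 0
activated-∉ {x} {Φ} = indicator-no (any? (Activated x ≟F_) Φ)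

activated⇒∈ : ∀ x Φ → 1 ≤ activated x Φ → Activated x ∈ Φ
activated⇒∈ x Φ = indicator⇒ (any? (Activated x ≟F_) Φ)

occurrences : Refob → List Refob → ℕ
occurrences x [] = 0
occurrences x (r ∷ R) = indicator (r ≟R x) + occurrences x R

count : (Msg → ℕ) → List Msg → ℕ
count w [] = 0
count w (m ∷ L) = w m + count w L

carrying releasing introducing along : Refob → Msg → ℕ
carrying x (App _ R) = occurrences x R
carrying x _ = 0
releasing x (Release y _) = indicator (y ≟R x)
releasing x _ = 0
introducing x (Info _ z _) = indicator (z ≟R x)
introducing x _ = 0
along x (App y _) = indicator (y ≟R x)
along x (Info y _ _) = indicator (y ≟R x)
along x _ = 0

count-middle : ∀ w l₁ m l₂ → count w (l₁ ++ m ∷ l₂) ≡ w m + count w (l₁ ++ l₂)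
count-middle w [] m l₂ = refl
count-middle w (a ∷ l₁) m l₂ rewrite count-middle w l₁ m l₂ = +-comm-middle (w a) (w m) (count w (l₁ ++ l₂))
  where
  +-comm-middle : ∀ a b c → a + (b + c) ≡ b + (a + c)
  +-comm-middle a b c rewrite sym (+-assoc a b c) | +-comm a b = +-assoc b a c

count-snoc : ∀ w L m → count w (L ++ m ∷ []) ≡ w m + count w L
count-snoc w L m = trans (count-middle w L m []) (cong (λ l → w m + count w l) (++-identityʳ L))

∈⇒≤count : ∀ w {m} L → m ∈ L → w m ≤ count w L
∈⇒≤count w (a ∷ L) (here refl) = m≤m+n (w a) _
∈⇒≤count w (a ∷ L) (there h) = ≤-trans (∈⇒≤count w L h) (m≤n+m _ (w a))

count⇒∈ : ∀ w L → 1 ≤ count w L → Σ Msg λ m → m ∈ L × 1 ≤ w m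
count⇒∈ w (a ∷ L) h with w a in e
... | zero = let (m , i , p) = count⇒∈ w L h in m , there i , p
... | suc k = a , here refl , subst (1 ≤_) (sym e) (s≤s z≤n)

count≡0 : ∀ w L → (∀ m → m ∈ L → w m ≡ 0) → count w L ≡ 0
count≡0 w [] f = refl
count≡0 w (a ∷ L) f rewrite f a (here refl) = count≡0 w L (λ m i → f m (there i))

occurrences⇒∈ : ∀ x R → 1 ≤ occurrences x R → x ∈ R
occurrences⇒∈ x (r ∷ R) h with r ≟R x
... | yes refl = here refl
... | no _ = there (occurrences⇒∈ x R h)

∈⇒occurrences≥1 : ∀ {x R} → x ∈ R → 1 ≤ occurrences x R
∈⇒occurrences≥1 {x} {r ∷ R} (here refl) rewrite indicator-yes (r ≟R r) refl = s≤s z≤n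
∈⇒occurrences≥1 {x} {r ∷ R} (there i) = ≤-trans (∈⇒occurrences≥1 i) (m≤n+m _ _)

∉⇒occurrences≡0 : ∀ x R → x ∉ R → occurrences x R ≡ 0
∉⇒occurrences≡0 x [] _ = refl
∉⇒occurrences≡0 x (r ∷ R) x∉ rewrite indicator-no (r ≟R x) (λ e → x∉ (here (sym e))) =
  ∉⇒occurrences≡0 x R (λ i → x∉ (there i))

carrying⇒mentioned : ∀ z m → 1 ≤ carrying z m → z ∈ msgRefobs m
carrying⇒mentioned z (App y R) h = there (occurrences⇒∈ z R h)

releasing⇒mentioned : ∀ z m → 1 ≤ releasing z m → z ∈ msgRefobs m
releasing⇒mentioned z (Release y n) h = here (sym (indicator⇒ (y ≟R z) h))

introducing⇒mentioned : ∀ z m → 1 ≤ introducing z m → z ∈ msgRefobs m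
introducing⇒mentioned z (Info a b c) h = there (here (sym (indicator⇒ (b ≟R z) h)))

along⇒mentioned : ∀ z m → 1 ≤ along z m → z ∈ msgRefobs m
along⇒mentioned z (App y R) h = here (sym (indicator⇒ (y ≟R z) h))
along⇒mentioned z (Info y b c) h = here (sym (indicator⇒ (y ≟R z) h))

nothing≢just : ∀ {s : AState} → nothing ≢ just s
nothing≢just ()

Internal⇒≢nothing : ∀ κ C → Internal κ C → α κ C ≢ nothing
Internal⇒≢nothing κ C (s , e) e′ = nothing≢just (trans (sym e′) e)

≢nothing⇒Internal : ∀ κ C → ¬ (α κ C ≡ nothing) → Internal κ C
≢nothing⇒Internal κ C ne with α κ C
... | just s = s , refl
... | nothing = ⊥-elim (ne refl)

upd-≡ : ∀ {X : Set} (f : Actor → X) a v b → a ≡ b → upd f a v b ≡ v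
upd-≡ f a v .a refl = upd-same f a v

data UpdCase {X : Set} (f : Actor → X) (a : Actor) (v : X) (b : Actor) : Set where
  isSame : a ≡ b → upd f a v b ≡ v → UpdCase f a v b
  isOther : a ≢ b → upd f a v b ≡ f b → UpdCase f a v b

updCase : ∀ {X : Set} (f : Actor → X) a v b → UpdCase f a v b
updCase f a v b with a ≟ b
... | yes e = isSame e (upd-≡ f a v b e)
... | no ne = isOther ne (upd-other f a v b ne)

put-same : ∀ (μ₀ : Actor → List Msg) B m → put μ₀ B m B ≡ μ₀ B ++ m ∷ []
put-same μ₀ B m = upd-same μ₀ B _

put-other : ∀ (μ₀ : Actor → List Msg) B m C → B ≢ C → put μ₀ B m C ≡ μ₀ C
put-other μ₀ B m C ne = upd-other μ₀ B _ C ne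

∈-put⁻ : ∀ (μ₀ : Actor → List Msg) B m C {m′} → m′ ∈ put μ₀ B m C → m′ ∈ μ₀ C ⊎ (B ≡ C × m′ ≡ m)
∈-put⁻ μ₀ B m C h with updCase μ₀ B (μ₀ B ++ m ∷ []) C
... | isOther ne e = inj₁ (subst (_ ∈_) e h)
... | isSame refl e with ∈-++⁻ (μ₀ B) (subst (_ ∈_) e h)
... | inj₁ i = inj₁ i
... | inj₂ (here refl) = inj₂ (refl , refl)

count-put-same : ∀ w (μ₀ : Actor → List Msg) B m → count w (put μ₀ B m B) ≡ w m + count w (μ₀ B)
count-put-same w μ₀ B m rewrite put-same μ₀ B m = count-snoc w (μ₀ B) m

count-put : ∀ w (μ₀ : Actor → List Msg) B m C → count w (put μ₀ B m C) ≡ indicator (B ≟ C) * w m + count w (μ₀ C)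
count-put w μ₀ B m C with B ≟ C
... | yes refl rewrite +-identityʳ (w m) = count-put-same w μ₀ B m
... | no ne rewrite put-other μ₀ B m C ne = refl

module Consumed {μ₀ μ₁ : Actor → List Msg} {B : Actor} {m : Msg} (c : Consume μ₀ B m μ₁) where
  l₁ = proj₁ c
  l₂ = proj₁ (proj₂ c)
  e₁ : μ₀ B ≡ l₁ ++ m ∷ l₂
  e₁ = proj₁ (proj₂ (proj₂ c))
  e₂ : μ₁ ≡ upd μ₀ B (l₁ ++ l₂)
  e₂ = proj₂ (proj₂ (proj₂ c))

  other : ∀ C → B ≢ C → μ₁ C ≡ μ₀ C
  other C ne rewrite e₂ = upd-other μ₀ B _ C ne

  same : μ₁ B ≡ l₁ ++ l₂
  same rewrite e₂ = upd-same μ₀ B _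

  m∈ : m ∈ μ₀ B
  m∈ = subst (m ∈_) (sym e₁) (∈-++⁺ʳ l₁ (here refl))

  ∈⁻ : ∀ C {m′} → m′ ∈ μ₁ C → m′ ∈ μ₀ C
  ∈⁻ C {m′} h with B ≟ C
  ... | no ne = subst (m′ ∈_) (other C ne) h
  ... | yes refl with ∈-++⁻ l₁ (subst (m′ ∈_) same h)
  ... | inj₁ i = subst (m′ ∈_) (sym e₁) (∈-++⁺ˡ i)
  ... | inj₂ i = subst (m′ ∈_) (sym e₁) (∈-++⁺ʳ l₁ (there i))

  count-same : ∀ w → count w (μ₀ B) ≡ w m + count w (μ₁ B)
  count-same w rewrite e₁ | same = count-middle w l₁ m l₂

  count-at : ∀ w C → count w (μ₀ C) ≡ indicator (B ≟ C) * w m + count w (μ₁ C)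
  count-at w C with B ≟ C
  ... | yes refl rewrite +-identityʳ (w m) = count-same w
  ... | no ne rewrite other C ne = refl

  count-decreases : ∀ w C → count w (μ₁ C) ≤ count w (μ₀ C)
  count-decreases w C rewrite count-at w C = m≤n+m _ _

knowledge-upd : ∀ (a : Actor → Maybe AState) (A : Actor) {s₀ : AState} (v : AState) → a A ≡ just s₀ →
        (R : KSet → KSet → Set) → R (knowledge v) (knowledge s₀) → (∀ L → R L L) →
        ∀ C → R (knowledgeOf (upd a A (just v) C)) (knowledgeOf (a C))
knowledge-upd a A {s₀} v e R rA rr C with updCase a A (just v) C
... | isSame refl q rewrite q | e = rA
... | isOther _ q rewrite q = rr _

upd-nothing⁺ : ∀ (a : Actor → Maybe AState) (A : Actor) {s₀ : AState} (v : AState) → a A ≡ just s₀ →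
        ∀ C → a C ≡ nothing → upd a A (just v) C ≡ nothing
upd-nothing⁺ a A v e C h with updCase a A (just v) C
... | isSame refl q = ⊥-elim (nothing≢just (trans (sym h) e))
... | isOther _ q = trans q h

upd-Internal⁻ : ∀ (a : Actor → Maybe AState) (A : Actor) {s₀ : AState} (v : AState) → a A ≡ just s₀ → ∀ C →
        InDomain (upd a A (just v)) C → InDomain a C
upd-Internal⁻ a A {s₀} v e C (s , h) with updCase a A (just v) C
... | isSame refl q = s₀ , e
... | isOther _ q = s , trans (sym q) h

count-consume-weightless : ∀ {μ₀ μ₁ : Actor → List Msg} {B m} (c : Consume μ₀ B m μ₁) w → w m ≡ 0 → ∀ C → count w (μ₁ C) ≡ count w (μ₀ C)
count-consume-weightless {μ₀} {μ₁} {B} {m} c w z C rewrite Consumed.count-at {μ₀} {μ₁} {B} {m} c w C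
                                                         | z
                                                         | *-zeroʳ (indicator (B ≟ C)) = refl

count-put-weightless : ∀ (μ₀ : Actor → List Msg) B m w → w m ≡ 0 → ∀ C → count w (put μ₀ B m C) ≡ count w (μ₀ C)
count-put-weightless μ₀ B m w z C rewrite count-put w μ₀ B m C | z | *-zeroʳ (indicator (B ≟ C)) = refl

count-consume : ∀ {μ₀ μ₁ : Actor → List Msg} {B m} (c : Consume μ₀ B m μ₁) w → 1 ≤ w m → count w (μ₁ B) + 1 ≤ count w (μ₀ B)
count-consume {μ₀} {μ₁} {B} {m} c w h rewrite Consumed.count-same {μ₀} {μ₁} {B} {m} c w
                                            | +-comm (count w (μ₁ B)) 1 = +-monoˡ-≤ (count w (μ₁ B)) h

m+1≤n≤1⇒m≡0 : ∀ {m n} → m + 1 ≤ n → n ≤ 1 → m ≡ 0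
m+1≤n≤1⇒m≡0 {m} m+1≤n n≤1 = n≤0⇒n≡0 (+-cancelʳ-≤ 1 m 0 (≤-trans m+1≤n n≤1))

1≤m+n⇒1≤m⊎1≤n : ∀ m n → 1 ≤ m + n → 1 ≤ m ⊎ 1 ≤ n
1≤m+n⇒1≤m⊎1≤n zero n h = inj₂ h
1≤m+n⇒1≤m⊎1≤n (suc m) n h = inj₁ (s≤s z≤n)

Activated-injective : ∀ {x y} → Activated x ≡ Activated y → x ≡ y
Activated-injective refl = refl

CreatedUsing-injective : ∀ {w x w′ x′} → CreatedUsing w x ≡ CreatedUsing w′ x′ → w ≡ w′ × x ≡ x′
CreatedUsing-injective refl = refl , refl

Unique-proj₂-injective : ∀ {A B : Set} (ps : List (A × B)) {p q} → Unique (map proj₂ ps) → p ∈ ps → q ∈ ps →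
                         proj₂ p ≡ proj₂ q → p ≡ q
Unique-proj₂-injective (_ ∷ _) _ (here refl) (here refl) _ = refl
Unique-proj₂-injective (_ ∷ ps) (distinct ∷ _) (here refl) (there j) e = ⊥-elim (lookup (map⁻ distinct) j e)
Unique-proj₂-injective (_ ∷ ps) (distinct ∷ _) (there i) (here refl) e = ⊥-elim (lookup (map⁻ distinct) i (sym e))
Unique-proj₂-injective (_ ∷ ps) (_ ∷ unique) (there i) (there j) e = Unique-proj₂-injective ps unique i j e

Unique⇒occurrences≡1 : ∀ R {r} → Unique (map token R) → r ∈ R → occurrences r R ≡ 1
Unique⇒occurrences≡1 (r ∷ R) (distinct ∷ _) (here refl) rewrite indicator-yes (r ≟R r) refl =
  cong suc (∉⇒occurrences≡0 r R (λ i → lookup (map⁻ distinct) i refl))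
Unique⇒occurrences≡1 (r′ ∷ R) {r} (distinct ∷ unique) (there i)
  rewrite indicator-no (r′ ≟R r) (λ e → lookup (map⁻ distinct) i (cong token e)) = Unique⇒occurrences≡1 R unique i

externalTargets-absent : ∀ (a : Actor → Maybe AState) R {B} → B ∈ externalTargets a R → a B ≡ nothing
externalTargets-absent a R i with ∈-map⁻ target i
... | r , j , refl = is-nothing⇒≡nothing (proj₂ (∈-filterᵇ⁻ (λ r → is-nothing (a (target r))) R j))
  where
  is-nothing⇒≡nothing : ∀ {m : Maybe AState} → is-nothing m ≡ true → m ≡ nothing
  is-nothing⇒≡nothing {nothing} _ = refl

-- The invariant

held : Config → Refob → ℕ
held κ x = count (carrying x) (μ κ (owner x)) + activated x (K κ (owner x))

presence : Config → Refob → ℕ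
presence κ x = held κ x + count (releasing x) (μ κ (target x))

ownerCount : Config → Refob → ℕ
ownerCount κ x = value sent x (K κ (owner x))

targetCount : Config → Refob → ℕ
targetCount κ x = value received x (K κ (target x)) + count (along x) (μ κ (target x))

Known : Config → Refob → Set
Known κ x = Created x ∈ K κ (target x)
        ⊎ (Σ Actor λ A → Σ Refob λ w → CreatedUsing w x ∈ K κ A)
        ⊎ (Σ Actor λ C → Σ Refob λ w → Σ Actor λ B → Info w x B ∈ μ κ C)

Live : Config → (Refob → Set) → Refob → Set
Live κ U x = U x × (1 ≤ presence κ x ⊎ α κ (owner x) ≡ nothing)

-- U stands for the set of refobs unreleased at the current time of an execution.
record Invariant (κ : Config) (U : Refob → Set) : Set where
  field
    external-absent : ∀ B → B ∈ χ κ → α κ B ≡ nothing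
    app-addressed : ∀ C x R → App x R ∈ μ κ C → target x ≡ C × All (λ r → owner r ≡ C) R
    info-addressed : ∀ C y z B → Info y z B ∈ μ κ C → target y ≡ C × target z ≡ C
    release-addressed : ∀ C x n → Release x n ∈ μ κ C → target x ≡ C
    createdUsing-owner : ∀ A w z → CreatedUsing w z ∈ K κ A → owner w ≡ A × Activated w ∈ K κ A
    presence≤1 : ∀ x → presence κ x ≤ 1
    released⇒presence≡0 : ∀ x → Released x ∈ K κ (target x) → presence κ x ≡ 0
    createdUsing-unique : ∀ A A′ w w′ x → CreatedUsing w x ∈ K κ A → CreatedUsing w′ x ∈ K κ A′ → A ≡ A′ × w ≡ w′
    createdUsing-pending : ∀ A w x → CreatedUsing w x ∈ K κ A → Created x ∉ K κ (target x) × count (introducing x) (μ κ (target x)) ≡ 0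
    introducing≤1 : ∀ x → count (introducing x) (μ κ (target x)) ≤ 1
    introducing⇒¬Created : ∀ x → 1 ≤ count (introducing x) (μ κ (target x)) → Created x ∉ K κ (target x)
    known⇒live : ∀ x → Known κ x → Internal κ (target x) → Released x ∉ K κ (target x) → Live κ U x
    -- SendRelease sends whichever count its knowledge derives, so that count must be unique.
    sent-readings≤1 : ∀ A x → length (readings sent x (K κ A)) ≤ 1
    counts-agree : ∀ x → Internal κ (owner x) → Internal κ (target x) →
          1 ≤ held κ x → ownerCount κ x ≡ targetCount κ x
    release-count : ∀ x n → Internal κ (owner x) → Internal κ (target x) → Release x n ∈ μ κ (target x) → n ≡ targetCount κ x
open Invariant

UnreleasedStep : Event → (Refob → Set) → (Refob → Set) → Set
UnreleasedStep e U U′ = (∀ y → U y → ¬ Releases e y → U′ y) × (∀ y → Creates e y → U′ y)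

release⇒releasing≥1 : ∀ κ x n → Release x n ∈ μ κ (target x) → 1 ≤ count (releasing x) (μ κ (target x))
release⇒releasing≥1 κ x n i = subst (_≤ count (releasing x) (μ κ (target x))) (indicator-yes (x ≟R x) refl) (∈⇒≤count (releasing x) _ i)

activated⇒held≥1 : ∀ κ x → Activated x ∈ K κ (owner x) → 1 ≤ held κ x
activated⇒held≥1 κ x a = ≤-trans (≤-reflexive (sym (activated-∈ a))) (m≤n+m _ _)

release⇒presence≥1 : ∀ κ x n → Release x n ∈ μ κ (target x) → 1 ≤ presence κ x
release⇒presence≥1 κ x n i = ≤-trans (release⇒releasing≥1 κ x n i) (m≤n+m _ (held κ x))

activated+release⇒presence≥2 : ∀ κ x n → Activated x ∈ K κ (owner x) → Release x n ∈ μ κ (target x) → 2 ≤ presence κ x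
activated+release⇒presence≥2 κ x n a i = +-mono-≤ (activated⇒held≥1 κ x a) (release⇒releasing≥1 κ x n i)

held⇒presence≥1 : ∀ κ y → 1 ≤ held κ y → 1 ≤ presence κ y
held⇒presence≥1 κ y h = ≤-trans h (m≤m+n _ _)

info⇒introducing≥1 : ∀ κ {U} → Invariant κ U → ∀ C w y B → Info w y B ∈ μ κ C → 1 ≤ count (introducing y) (μ κ (target y))
info⇒introducing≥1 κ I C w y B i with info-addressed I C w y B i
... | _ , refl = subst (_≤ count (introducing y) (μ κ (target y))) (indicator-yes (y ≟R y) refl) (∈⇒≤count (introducing y) _ i)

≡0⇒≱1 : ∀ {a} → a ≡ 0 → 1 ≤ a → ⊥
≡0⇒≱1 refl ()

-- Fresh names

module FreshTokenLemmas (κ : Config) (t : Token) (F : FreshToken κ t) (z : Refob) (z↦t : token z ≡ t) where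
  ∉knowledge : ∀ A {φ} → φ ∈ K κ A → z ∉ factRefobs φ
  ∉knowledge A {φ} i j with α κ A in e
  ... | just s = proj₁ F A s e φ i z j z↦t
  ... | nothing = ¬Any[] i

  ∉mailbox : ∀ A {m} → m ∈ μ κ A → z ∉ msgRefobs m
  ∉mailbox A i j = proj₂ F A _ i z j z↦t

  activated≡0 : ∀ A → activated z (K κ A) ≡ 0
  activated≡0 A = activated-∉ (λ i → ∉knowledge A i (here refl))

  readings≡[] : ∀ k A → readings k z (K κ A) ≡ []
  readings≡[] k A = absent⇒readings-empty k (λ n i → ∉knowledge A i (counterFact-mentions k))

  unmentioned⇒count≡0 : ∀ (w : Refob → Msg → ℕ) → (∀ m → 1 ≤ w z m → z ∈ msgRefobs m) → ∀ C → count (w z) (μ κ C) ≡ 0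
  unmentioned⇒count≡0 w mentioned C = count≡0 (w z) (μ κ C) λ m i → n<1⇒n≡0 (≰⇒> λ h → ∉mailbox C i (mentioned m h))

  carrying≡0 : ∀ C → count (carrying z) (μ κ C) ≡ 0
  carrying≡0 = unmentioned⇒count≡0 carrying (carrying⇒mentioned z)

  releasing≡0 : ∀ C → count (releasing z) (μ κ C) ≡ 0
  releasing≡0 = unmentioned⇒count≡0 releasing (releasing⇒mentioned z)

  introducing≡0 : ∀ C → count (introducing z) (μ κ C) ≡ 0
  introducing≡0 = unmentioned⇒count≡0 introducing (introducing⇒mentioned z)

  along≡0 : ∀ C → count (along z) (μ κ C) ≡ 0
  along≡0 = unmentioned⇒count≡0 along (along⇒mentioned z)

∈-concatMap-refActors : ∀ {a r} L → r ∈ L → a ∈ refActors r → a ∈ concatMap refActors L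
∈-concatMap-refActors (r ∷ L) (here refl) j = ∈-++⁺ˡ j
∈-concatMap-refActors (r′ ∷ L) (there i) j = ∈-++⁺ʳ (refActors r′) (∈-concatMap-refActors L i j)

msgRefobs⇒msgActors : ∀ m {r a} → r ∈ msgRefobs m → a ∈ refActors r → a ∈ msgActors m
msgRefobs⇒msgActors (App x R) i j = ∈-concatMap-refActors (x ∷ R) i j
msgRefobs⇒msgActors (Info y z B) (here refl) j = there (∈-++⁺ˡ j)
msgRefobs⇒msgActors (Info y z B) (there (here refl)) j = there (∈-++⁺ʳ (refActors y) j)
msgRefobs⇒msgActors (Release x n) (here refl) j = j

module FreshActorLemmas (κ : Config) (B : Actor) (F : FreshActor κ B) where
  fresh-in-knowledge : ∀ A {φ r} → φ ∈ K κ A → r ∈ factRefobs φ → owner r ≢ B × target r ≢ B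
  fresh-in-knowledge A {φ} {r} i j with α κ A in e
  ... | just s = (λ { refl → proj₁ (proj₂ (proj₂ F)) A s e φ i r j (here refl) }) ,
                 (λ { refl → proj₁ (proj₂ (proj₂ F)) A s e φ i r j (there (here refl)) })
  ... | nothing = ⊥-elim (¬Any[] i)

  fresh-in-mailbox : ∀ A {m r} → m ∈ μ κ A → r ∈ msgRefobs m → owner r ≢ B × target r ≢ B
  fresh-in-mailbox A {m} {r} i j = (λ { refl → proj₂ (proj₂ (proj₂ F)) A m i (msgRefobs⇒msgActors m j (here refl)) }) ,
                      (λ { refl → proj₂ (proj₂ (proj₂ F)) A m i (msgRefobs⇒msgActors m j (there (here refl))) })

-- Preservation of the invariant by each event

-- In each After… module, κ₀ and κ₁ are the configurations before and after the event, and a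
-- primed lemma proves the invariant field of the same name for κ₁.

module AfterSilentStep {κ₀ κ₁ : Config} {U U′ : Refob → Set} (I : Invariant κ₀ U) (U⊆U′ : ∀ y → U y → U′ y)
  (same-K : ∀ C → K κ₁ C ≡ K κ₀ C) (external-kept : ∀ C → α κ₀ C ≡ nothing → α κ₁ C ≡ nothing)
  (same-μ : ∀ C → μ κ₁ C ≡ μ κ₀ C) (same-χ : ∀ B → B ∈ χ κ₁ → B ∈ χ κ₀) where

  Internal-before : ∀ {C} → Internal κ₁ C → Internal κ₀ C
  Internal-before {C} i = ≢nothing⇒Internal κ₀ C (λ e → Internal⇒≢nothing κ₁ C i (external-kept C e))

  presence-unchanged : ∀ x → presence κ₁ x ≡ presence κ₀ x
  presence-unchanged x rewrite same-K (owner x) | same-μ (owner x) | same-μ (target x) = refl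

  Known-before : ∀ x → Known κ₁ x → Known κ₀ x
  Known-before x (inj₁ j) = inj₁ (subst (_ ∈_) (same-K (target x)) j)
  Known-before x (inj₂ (inj₁ (A , w , j))) = inj₂ (inj₁ (A , w , subst (_ ∈_) (same-K A) j))
  Known-before x (inj₂ (inj₂ (C , w , B , j))) = inj₂ (inj₂ (C , w , B , subst (_ ∈_) (same-μ C) j))

  known⇒live′ : ∀ x → Known κ₁ x → Internal κ₁ (target x) → Released x ∉ K κ₁ (target x) → Live κ₁ U′ x
  known⇒live′ x s i nr with known⇒live I x (Known-before x s) (Internal-before i) (λ j → nr (subst (_ ∈_) (sym (same-K (target x))) j))
  ... | u , inj₁ p = U⊆U′ x u , inj₁ (subst (1 ≤_) (sym (presence-unchanged x)) p)
  ... | u , inj₂ e = U⊆U′ x u , inj₂ (external-kept (owner x) e)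

  counts-agree′ : ∀ x → Internal κ₁ (owner x) → Internal κ₁ (target x) →
       1 ≤ held κ₁ x → ownerCount κ₁ x ≡ targetCount κ₁ x
  counts-agree′ x io it h rewrite same-K (owner x)
                                | same-K (target x)
                                | same-μ (owner x)
                                | same-μ (target x) = counts-agree I x (Internal-before io) (Internal-before it) h

  release-count′ : ∀ x n → Internal κ₁ (owner x) → Internal κ₁ (target x) → Release x n ∈ μ κ₁ (target x) → n ≡ targetCount κ₁ x
  release-count′ x n io it h rewrite same-K (target x) | same-μ (target x) = release-count I x n (Internal-before io) (Internal-before it) h

  invariant : Invariant κ₁ U′
  invariant = record
    { external-absent = λ B i → external-kept B (external-absent I B (same-χ B i))
    ; app-addressed = λ C x R i → app-addressed I C x R (subst (_ ∈_) (same-μ C) i)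
    ; info-addressed = λ C y z B i → info-addressed I C y z B (subst (_ ∈_) (same-μ C) i)
    ; release-addressed = λ C x n i → release-addressed I C x n (subst (_ ∈_) (same-μ C) i)
    ; createdUsing-owner = λ A w z i → let (a , b) = createdUsing-owner I A w z (subst (_ ∈_) (same-K A) i) in a , subst (_ ∈_) (sym (same-K A)) b
    ; presence≤1 = λ x → subst (_≤ 1) (sym (presence-unchanged x)) (presence≤1 I x)
    ; released⇒presence≡0 = λ x i → trans (presence-unchanged x) (released⇒presence≡0 I x (subst (_ ∈_) (same-K (target x)) i))
    ; createdUsing-unique = λ A A′ w w′ x i j → createdUsing-unique I A A′ w w′ x (subst (_ ∈_) (same-K A) i) (subst (_ ∈_) (same-K A′) j)
    ; createdUsing-pending = λ A w x i → let (a , b) = createdUsing-pending I A w x (subst (_ ∈_) (same-K A) i) in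
                          (λ j → a (subst (_ ∈_) (same-K (target x)) j)) , trans (cong (count (introducing x)) (same-μ (target x))) b
    ; introducing≤1 = λ x → subst (_≤ 1) (cong (count (introducing x)) (sym (same-μ (target x)))) (introducing≤1 I x)
    ; introducing⇒¬Created = λ x h j → introducing⇒¬Created I x (subst (1 ≤_) (cong (count (introducing x)) (same-μ (target x))) h) (subst (_ ∈_) (same-K (target x)) j)
    ; known⇒live = known⇒live′
    ; sent-readings≤1 = λ A x → subst (λ l → length (readings sent x l) ≤ 1) (sym (same-K A)) (sent-readings≤1 I A x)
    ; counts-agree = counts-agree′
    ; release-count = release-count′
    }

module AfterExternalConsume {a : Actor → Maybe AState} {m₀ m₁ : Actor → List Msg} {r r′ : List Actor} {c : List Actor}
  {U U′ : Refob → Set} {B : Actor} {m : Msg}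
  (I : Invariant (cfg a m₀ r c) U) (uu : ∀ y → U y → U′ y) (Bχ : B ∈ c) (cs : Consume m₀ B m m₁) where

  open Consumed {m₀} {m₁} {B} {m} cs
  κ₀ = cfg a m₀ r c
  κ₁ = cfg a m₁ r′ c

  B-external : a B ≡ nothing
  B-external = external-absent I B Bχ

  presence-decreases : ∀ x → presence κ₁ x ≤ presence κ₀ x
  presence-decreases x = +-mono-≤ (+-mono-≤ (count-decreases (carrying x) (owner x)) ≤-refl) (count-decreases (releasing x) (target x))

  internal≢B : ∀ C → Internal κ₀ C → B ≢ C
  internal≢B C i refl = Internal⇒≢nothing κ₀ C i B-external

  presence-unchanged : ∀ x → B ≢ owner x → B ≢ target x → presence κ₁ x ≡ presence κ₀ x
  presence-unchanged x n1 n2 rewrite other (owner x) n1 | other (target x) n2 = refl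

  Known-before : ∀ x → Known κ₁ x → Known κ₀ x
  Known-before x (inj₁ j) = inj₁ j
  Known-before x (inj₂ (inj₁ j)) = inj₂ (inj₁ j)
  Known-before x (inj₂ (inj₂ (C , w , B′ , j))) = inj₂ (inj₂ (C , w , B′ , ∈⁻ C j))

  known⇒live′ : ∀ x → Known κ₁ x → Internal κ₁ (target x) → Released x ∉ K κ₁ (target x) → Live κ₁ U′ x
  known⇒live′ x s it nr with known⇒live I x (Known-before x s) it nr
  ... | u , inj₂ e = uu x u , inj₂ e
  ... | u , inj₁ p with B ≟ owner x
  ...   | yes refl = uu x u , inj₂ B-external
  ...   | no n1 = uu x u , inj₁ (subst (1 ≤_) (sym (presence-unchanged x n1 (internal≢B (target x) it))) p)

  counts-agree′ : ∀ x → Internal κ₁ (owner x) → Internal κ₁ (target x) →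
       1 ≤ held κ₁ x → ownerCount κ₁ x ≡ targetCount κ₁ x
  counts-agree′ x io it h rewrite other (owner x) (internal≢B (owner x) io)
                                | other (target x) (internal≢B (target x) it) = counts-agree I x io it h

  release-count′ : ∀ x n → Internal κ₁ (owner x) → Internal κ₁ (target x) → Release x n ∈ m₁ (target x) → n ≡ targetCount κ₁ x
  release-count′ x n io it h rewrite other (target x) (internal≢B (target x) it) = release-count I x n io it h

  invariant : Invariant κ₁ U′
  invariant = record
    { external-absent = external-absent I
    ; app-addressed = λ C x R i → app-addressed I C x R (∈⁻ C i)
    ; info-addressed = λ C y z B i → info-addressed I C y z B (∈⁻ C i)
    ; release-addressed = λ C x n i → release-addressed I C x n (∈⁻ C i)
    ; createdUsing-owner = createdUsing-owner I
    ; presence≤1 = λ x → ≤-trans (presence-decreases x) (presence≤1 I x)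
    ; released⇒presence≡0 = λ x i → n≤0⇒n≡0 (subst (presence κ₁ x ≤_) (released⇒presence≡0 I x i) (presence-decreases x))
    ; createdUsing-unique = createdUsing-unique I
    ; createdUsing-pending = λ A w x i → let (p , q) = createdUsing-pending I A w x i in p , n≤0⇒n≡0 (subst (count (introducing x) (m₁ (target x)) ≤_) q (count-decreases (introducing x) (target x)))
    ; introducing≤1 = λ x → ≤-trans (count-decreases (introducing x) (target x)) (introducing≤1 I x)
    ; introducing⇒¬Created = λ x h → introducing⇒¬Created I x (≤-trans h (count-decreases (introducing x) (target x)))
    ; known⇒live = known⇒live′
    ; sent-readings≤1 = sent-readings≤1 I
    ; counts-agree = counts-agree′
    ; release-count = release-count′
    }

module AfterSpawn {α₀ : Actor → Maybe AState} {μ₀ : Actor → List Msg} {ρ₀ χ₀ : List Actor} {Φ : KSet}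
  {U U′ : Refob → Set} (x y : Refob)
  (hα : α₀ (owner x) ≡ just (busy Φ)) (oy : owner y ≡ target x)
  (Fx : FreshToken (cfg α₀ μ₀ ρ₀ χ₀) (token x)) (Fy : FreshToken (cfg α₀ μ₀ ρ₀ χ₀) (token y))
  (FB : FreshActor (cfg α₀ μ₀ ρ₀ χ₀) (target x))
  (I : Invariant (cfg α₀ μ₀ ρ₀ χ₀) U) (us : UnreleasedStep (spawnE x y) U U′) where

  A = owner x
  B = target x
  vA : AState
  vA = busy (Activated x ∷ Φ)
  LB : KSet
  LB = Created x ∷ Created y ∷ Activated y ∷ []
  vB : AState
  vB = busy LB
  α′ = upd α₀ A (just vA)
  α₁ = upd α′ B (just vB)
  κ₀ = cfg α₀ μ₀ ρ₀ χ₀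
  κ₁ = cfg α₁ μ₀ ρ₀ χ₀
  open FreshActorLemmas κ₀ B FB
  module FX = FreshTokenLemmas κ₀ (token x) Fx
  module FY = FreshTokenLemmas κ₀ (token y) Fy

  αB : α₀ B ≡ nothing
  αB = proj₁ FB

  A≢B : A ≢ B
  A≢B e = nothing≢just (trans (sym αB) (trans (cong α₀ (sym e)) hα))

  KB₀ : K κ₀ B ≡ []
  KB₀ rewrite αB = refl

  KA₀ : K κ₀ A ≡ Φ
  KA₀ rewrite hα = refl

  knowledge-upd² : (R : KSet → KSet → Set) → R LB [] → R (Activated x ∷ Φ) Φ → (∀ L → R L L) → ∀ C → R (K κ₁ C) (K κ₀ C)
  knowledge-upd² R rB rA rr C with updCase α′ B (just vB) C
  ... | isSame refl q rewrite q = subst (R LB) (sym KB₀) rB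
  ... | isOther _ q rewrite q with updCase α₀ A (just vA) C
  ...   | isSame refl q′ rewrite q′ = subst (R (Activated x ∷ Φ)) (sym KA₀) rA
  ...   | isOther _ q′ rewrite q′ = rr _

  K-kept : ∀ C {φ} → φ ∈ K κ₀ C → φ ∈ K κ₁ C
  K-kept C {φ} = knowledge-upd² (λ L L′ → φ ∈ L′ → φ ∈ L) (λ ()) there (λ _ h → h) C

  data New (φ : Fact) : Set where
    newA : φ ≡ Activated x → New φ
    newB : φ ∈ LB → New φ

  K-old-or-new : ∀ C {φ} → φ ∈ K κ₁ C → φ ∈ K κ₀ C ⊎ New φ
  K-old-or-new C {φ} = knowledge-upd² (λ L L′ → φ ∈ L → φ ∈ L′ ⊎ New φ) (λ h → inj₂ (newB h)) f (λ _ h → inj₁ h) C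
    where f : φ ∈ Activated x ∷ Φ → φ ∈ Φ ⊎ New φ
          f (here e) = inj₂ (newA e)
          f (there h) = inj₁ h

  sent-unchanged : ∀ C w → readings sent w (K κ₁ C) ≡ readings sent w (K κ₀ C)
  sent-unchanged C w = knowledge-upd² (λ L L′ → readings sent w L ≡ readings sent w L′) refl refl (λ _ → refl) C

  received-unchanged : ∀ C w → readings received w (K κ₁ C) ≡ readings received w (K κ₀ C)
  received-unchanged C w = knowledge-upd² (λ L L′ → readings received w L ≡ readings received w L′) refl refl (λ _ → refl) C

  activated-unchanged : ∀ C w → x ≢ w → y ≢ w → activated w (K κ₁ C) ≡ activated w (K κ₀ C)
  activated-unchanged C w nx ny = activated-cong w _ _ f (K-kept C)
    where f : Activated w ∈ K κ₁ C → Activated w ∈ K κ₀ C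
          f h with K-old-or-new C h
          ... | inj₁ i = i
          ... | inj₂ (newA e) = ⊥-elim (nx (sym (Activated-injective e)))
          ... | inj₂ (newB (there (there (here e)))) = ⊥-elim (ny (sym (Activated-injective e)))
          ... | inj₂ (newB (there (there (there ()))))

  K-old : ∀ C {φ} → φ ∈ K κ₁ C → (∀ r → φ ≢ Activated r) → (∀ r → φ ≢ Created r) → φ ∈ K κ₀ C
  K-old C h na nc with K-old-or-new C h
  ... | inj₁ i = i
  ... | inj₂ (newA e) = ⊥-elim (na _ e)
  ... | inj₂ (newB (here e)) = ⊥-elim (nc _ e)
  ... | inj₂ (newB (there (here e))) = ⊥-elim (nc _ e)
  ... | inj₂ (newB (there (there (here e)))) = ⊥-elim (na _ e)
  ... | inj₂ (newB (there (there (there ()))))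

  Created-old-or-new : ∀ C {w} → Created w ∈ K κ₁ C → Created w ∈ K κ₀ C ⊎ (w ≡ x ⊎ w ≡ y)
  Created-old-or-new C h with K-old-or-new C h
  ... | inj₁ i = inj₁ i
  ... | inj₂ (newA ())
  ... | inj₂ (newB (here refl)) = inj₂ (inj₁ refl)
  ... | inj₂ (newB (there (here refl))) = inj₂ (inj₂ refl)
  ... | inj₂ (newB (there (there (here ()))))
  ... | inj₂ (newB (there (there (there ()))))

  presence-unchanged : ∀ w → x ≢ w → y ≢ w → presence κ₁ w ≡ presence κ₀ w
  presence-unchanged w nx ny rewrite activated-unchanged (owner w) w nx ny = refl

  presence-x : presence κ₁ x ≡ 1
  presence-x rewrite FX.carrying≡0 x refl A | FX.releasing≡0 x refl B = trans (+-identityʳ _) (activated-∈ x∈A)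
    where
    x∈A : Activated x ∈ K κ₁ A
    x∈A rewrite upd-other α′ B (just vB) A (λ e → A≢B (sym e)) | upd-same α₀ A (just vA) = here refl

  presence-y : presence κ₁ y ≡ 1
  presence-y rewrite FY.carrying≡0 y refl (owner y) | FY.releasing≡0 y refl (target y) = trans (+-identityʳ _) (activated-∈ y∈B)
    where
    y∈B : Activated y ∈ K κ₁ (owner y)
    y∈B rewrite oy | upd-same α′ B (just vB) = there (there (here refl))

  Internal-before : ∀ C → B ≢ C → Internal κ₁ C → Internal κ₀ C
  Internal-before C ne (s , h) with updCase α₀ A (just vA) C
  ... | isSame refl q = _ , hα
  ... | isOther _ q = s , trans (sym q) (trans (sym (upd-other α′ B (just vB) C ne)) h)

  nothing-after : ∀ C → B ≢ C → α₀ C ≡ nothing → α₁ C ≡ nothing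
  nothing-after C ne h = trans (upd-other α′ B (just vB) C ne) (upd-nothing⁺ α₀ A vA hα C h)

  B∉knowledge : ∀ C {φ r} → φ ∈ K κ₀ C → r ∈ factRefobs φ → B ≢ owner r × B ≢ target r
  B∉knowledge C i j = let (a , b) = fresh-in-knowledge C i j in (λ e → a (sym e)) , (λ e → b (sym e))
  B∉mailbox : ∀ C {m r} → m ∈ μ₀ C → r ∈ msgRefobs m → B ≢ owner r × B ≢ target r
  B∉mailbox C i j = let (a , b) = fresh-in-mailbox C i j in (λ e → a (sym e)) , (λ e → b (sym e))

  B∉Known : ∀ w → Known κ₀ w → B ≢ owner w × B ≢ target w
  B∉Known w (inj₁ j) = B∉knowledge (target w) j (here refl)
  B∉Known w (inj₂ (inj₁ (A′ , v , j))) = B∉knowledge A′ j (there (here refl))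
  B∉Known w (inj₂ (inj₂ (C , v , B′ , j))) = B∉mailbox C j (there (here refl))

  B∉held : ∀ w → 1 ≤ held κ₀ w → B ≢ owner w × B ≢ target w
  B∉held w h with 1≤m+n⇒1≤m⊎1≤n _ _ h
  ... | inj₁ p = let (m , i , q) = count⇒∈ (carrying w) _ p in B∉mailbox (owner w) i (carrying⇒mentioned w m q)
  ... | inj₂ p = B∉knowledge (owner w) (activated⇒∈ w _ p) (here refl)

  presence≤1′ : ∀ w → presence κ₁ w ≤ 1
  presence≤1′ w with x ≟R w | y ≟R w
  ... | yes refl | _ = ≤-reflexive presence-x
  ... | no _ | yes refl = ≤-reflexive presence-y
  ... | no nx | no ny = subst (_≤ 1) (sym (presence-unchanged w nx ny)) (presence≤1 I w)

  released⇒presence≡0′ : ∀ w → Released w ∈ K κ₁ (target w) → presence κ₁ w ≡ 0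
  released⇒presence≡0′ w j with K-old (target w) j (λ _ ()) (λ _ ())
  ... | k with x ≟R w | y ≟R w
  ...   | yes refl | _ = ⊥-elim (FX.∉knowledge x refl (target x) k (here refl))
  ...   | no _ | yes refl = ⊥-elim (FY.∉knowledge y refl (target y) k (here refl))
  ...   | no nx | no ny = trans (presence-unchanged w nx ny) (released⇒presence≡0 I w k)

  new∉knowledge : ∀ w → (w ≡ x ⊎ w ≡ y) → ∀ C {φ} → φ ∈ K κ₀ C → w ∈ factRefobs φ → ⊥
  new∉knowledge w (inj₁ refl) C i j = FX.∉knowledge x refl C i j
  new∉knowledge w (inj₂ refl) C i j = FY.∉knowledge y refl C i j

  new∉mailbox : ∀ w → (w ≡ x ⊎ w ≡ y) → ∀ C {m} → m ∈ μ₀ C → w ∈ msgRefobs m → ⊥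
  new∉mailbox w (inj₁ refl) C i j = FX.∉mailbox x refl C i j
  new∉mailbox w (inj₂ refl) C i j = FY.∉mailbox y refl C i j

  createdUsing-pending′ : ∀ A′ w a → CreatedUsing w a ∈ K κ₁ A′ → Created a ∉ K κ₁ (target a) × count (introducing a) (μ₀ (target a)) ≡ 0
  createdUsing-pending′ A′ w a i with K-old A′ i (λ _ ()) (λ _ ())
  ... | k = c , proj₂ (createdUsing-pending I A′ w a k)
    where c : Created a ∉ K κ₁ (target a)
          c j with Created-old-or-new (target a) j
          ... | inj₁ l = proj₁ (createdUsing-pending I A′ w a k) l
          ... | inj₂ e = new∉knowledge a e A′ k (there (here refl))

  introducing⇒¬Created′ : ∀ a → 1 ≤ count (introducing a) (μ₀ (target a)) → Created a ∉ K κ₁ (target a)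
  introducing⇒¬Created′ a h j with Created-old-or-new (target a) j
  ... | inj₁ l = introducing⇒¬Created I a h l
  ... | inj₂ e = let (m , i , q) = count⇒∈ (introducing a) _ h in new∉mailbox a e (target a) i (introducing⇒mentioned a m q)

  Known-before : ∀ w → ¬ (w ≡ x ⊎ w ≡ y) → Known κ₁ w → Known κ₀ w
  Known-before w nn (inj₁ j) with Created-old-or-new (target w) j
  ... | inj₁ l = inj₁ l
  ... | inj₂ e = ⊥-elim (nn e)
  Known-before w nn (inj₂ (inj₁ (A′ , v , j))) = inj₂ (inj₁ (A′ , v , K-old A′ j (λ _ ()) (λ _ ())))
  Known-before w nn (inj₂ (inj₂ j)) = inj₂ (inj₂ j)

  known⇒live′ : ∀ w → Known κ₁ w → Internal κ₁ (target w) → Released w ∉ K κ₁ (target w) → Live κ₁ U′ w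
  known⇒live′ w s it nr with x ≟R w | y ≟R w
  ... | yes refl | _ = proj₂ us x (inj₁ refl) , inj₁ (≤-reflexive (sym presence-x))
  ... | no _ | yes refl = proj₂ us y (inj₂ refl) , inj₁ (≤-reflexive (sym presence-y))
  ... | no nx | no ny with Known-before w (λ { (inj₁ e) → nx (sym e) ; (inj₂ e) → ny (sym e) }) s
  ...   | s₀ with B∉Known w s₀
  ...     | (nO , nt) with known⇒live I w s₀ (Internal-before _ nt it) (λ j → nr (K-kept (target w) j))
  ...       | u , inj₁ p = proj₁ us w u (λ ()) , inj₁ (subst (1 ≤_) (sym (presence-unchanged w nx ny)) p)
  ...       | u , inj₂ e = proj₁ us w u (λ ()) , inj₂ (nothing-after (owner w) nO e)

  counts-agree′ : ∀ w → Internal κ₁ (owner w) → Internal κ₁ (target w) →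
       1 ≤ held κ₁ w → ownerCount κ₁ w ≡ targetCount κ₁ w
  counts-agree′ w io it h with x ≟R w | y ≟R w
  ... | yes refl | _ rewrite sent-unchanged A x
                           | FX.readings≡[] x refl sent A
                           | received-unchanged B x
                           | FX.readings≡[] x refl received B
                           | FX.along≡0 x refl B = refl
  ... | no _ | yes refl rewrite sent-unchanged (owner y) y
                              | FY.readings≡[] y refl sent (owner y)
                              | received-unchanged (target y) y
                              | FY.readings≡[] y refl received (target y)
                              | FY.along≡0 y refl (target y) = refl
  ... | no nx | no ny = trans (cong headOr0 (sent-unchanged (owner w) w))
          (trans (counts-agree I w (Internal-before _ (proj₁ mp) io) (Internal-before _ (proj₂ mp) it) h₀)
                 (cong (λ l → headOr0 l + count (along w) (μ₀ (target w))) (sym (received-unchanged (target w) w))))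
    where
    h₀ : 1 ≤ held κ₀ w
    h₀ = subst (λ k → 1 ≤ count (carrying w) (μ₀ (owner w)) + k) (activated-unchanged (owner w) w nx ny) h
    mp = B∉held w h₀

  release-count′ : ∀ w k → Internal κ₁ (owner w) → Internal κ₁ (target w) → Release w k ∈ μ₀ (target w) → k ≡ targetCount κ₁ w
  release-count′ w k io it h with B∉mailbox (target w) h (here refl)
  ... | (nO , nt) with x ≟R w | y ≟R w
  ...   | yes refl | _ = ⊥-elim (FX.∉mailbox x refl (target x) h (here refl))
  ...   | no _ | yes refl = ⊥-elim (FY.∉mailbox y refl (target y) h (here refl))
  ...   | no nx | no ny = trans (release-count I w k (Internal-before _ nO io) (Internal-before _ nt it) h)
                                (cong (λ l → headOr0 l + count (along w) (μ₀ (target w))) (sym (received-unchanged (target w) w)))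

  invariant : Invariant κ₁ U′
  invariant = record
    { external-absent = λ B′ i → nothing-after B′ (λ { refl → proj₁ (proj₂ FB) i }) (external-absent I B′ i)
    ; app-addressed = app-addressed I
    ; info-addressed = info-addressed I
    ; release-addressed = release-addressed I
    ; createdUsing-owner = λ A′ w a i → let (o , q) = createdUsing-owner I A′ w a (K-old A′ i (λ _ ()) (λ _ ())) in o , K-kept A′ q
    ; presence≤1 = presence≤1′
    ; released⇒presence≡0 = released⇒presence≡0′
    ; createdUsing-unique = λ A1 A2 w1 w2 a i j → createdUsing-unique I A1 A2 w1 w2 a (K-old A1 i (λ _ ()) (λ _ ())) (K-old A2 j (λ _ ()) (λ _ ()))
    ; createdUsing-pending = createdUsing-pending′
    ; introducing≤1 = introducing≤1 I
    ; introducing⇒¬Created = introducing⇒¬Created′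
    ; known⇒live = known⇒live′
    ; sent-readings≤1 = λ C w → subst (λ l → length l ≤ 1) (sym (sent-unchanged C w)) (sent-readings≤1 I C w)
    ; counts-agree = counts-agree′
    ; release-count = release-count′
    }

module AfterSend {α₀ : Actor → Maybe AState} {μ₀ : Actor → List Msg} {ρ₀ χ₀ : List Actor} {Φ : KSet}
  {U U′ : Refob → Set} (x : Refob) (yz : List (Refob × Token)) (A : Actor)
  (hα : α₀ A ≡ just (busy Φ)) (ox : owner x ≡ A) (hx : Φ ⊢ Activated x)
  (hyz : All (λ p → owner (proj₁ p) ≡ A × Φ ⊢ Activated (proj₁ p)) yz)
  (uz : Unique (map proj₂ yz))
  (fz : All (λ p → FreshToken (cfg α₀ μ₀ ρ₀ χ₀) (proj₂ p)) yz)
  (I : Invariant (cfg α₀ μ₀ ρ₀ χ₀) U) (us : UnreleasedStep (sendE x yz A) U U′) where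

  B = target x
  fr : Refob × Token → Refob
  fr p = ref (proj₂ p) B (target (proj₁ p))
  Z = sendCreated B yz
  CUs = sendCU B yz
  Φ′ = IncSent x Φ ++ CUs
  v = busy Φ′
  α₁ = upd α₀ A (just v)
  m = App x Z
  μ₁ = put μ₀ B m
  κ₀ = cfg α₀ μ₀ ρ₀ χ₀
  κ₁ = cfg α₁ μ₁ ρ₀ χ₀

  Z∈ : ∀ {z} → z ∈ Z → Σ (Refob × Token) λ p → p ∈ yz × z ≡ fr p
  Z∈ i = ∈-map⁻ fr i

  CU∈ : ∀ {φ} → φ ∈ CUs → Σ (Refob × Token) λ p → p ∈ yz × φ ≡ CreatedUsing (proj₁ p) (fr p)
  CU∈ i = ∈-map⁻ (λ p → CreatedUsing (proj₁ p) (fr p)) i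

  tokens-Z : map token Z ≡ map proj₂ yz
  tokens-Z = go yz
    where go : ∀ l → map token (sendCreated B l) ≡ map proj₂ l
          go [] = refl
          go (p ∷ l) = cong (proj₂ p ∷_) (go l)

  owners-Z : ∀ l → All (λ r → owner r ≡ B) (sendCreated B l)
  owners-Z [] = []
  owners-Z (p ∷ l) = refl ∷ owners-Z l

  module FZ {z} (i : z ∈ Z) where
    p = proj₁ (Z∈ i)
    pi = proj₁ (proj₂ (Z∈ i))
    ze = proj₂ (proj₂ (Z∈ i))
    tz : token z ≡ proj₂ p
    tz = cong token ze
    open FreshTokenLemmas κ₀ (proj₂ p) (lookup fz pi) public

  module FP {p} (pi : p ∈ yz) = FreshTokenLemmas κ₀ (proj₂ p) (lookup fz pi)

  KA₀ : K κ₀ A ≡ Φ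
  KA₀ rewrite hα = refl

  actx : Activated x ∈ K κ₀ A
  actx = subst (Activated x ∈_) (sym KA₀) (⊢Activated⁻ hx)

  x∉Z : x ∉ Z
  x∉Z i = FZ.∉knowledge i x (FZ.tz i) A actx (here refl)

  x≢created : ∀ {y} → y ∈ Z → x ≢ y
  x≢created i refl = x∉Z i

  K-kept : ∀ C {φ} → NotCounter sent φ → φ ∈ K κ₀ C → φ ∈ K κ₁ C
  K-kept C {φ} nsc = knowledge-upd α₀ A v hα (λ L L′ → φ ∈ L′ → φ ∈ L) (λ h → ∈-++⁺ˡ (∈-increment⁺ sent x Φ nsc h)) (λ _ h → h) C

  K-old-or-new : ∀ C {φ} → NotCounter sent φ → φ ∈ K κ₁ C → φ ∈ K κ₀ C ⊎ (A ≡ C × φ ∈ CUs)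
  K-old-or-new C {φ} nsc = f (updCase α₀ A (just v) C)
    where
    f : UpdCase α₀ A (just v) C → φ ∈ knowledgeOf (α₁ C) → φ ∈ K κ₀ C ⊎ (A ≡ C × φ ∈ CUs)
    f (isOther _ q) h rewrite q = inj₁ h
    f (isSame refl q) h rewrite q | hα with ∈-++⁻ (IncSent x Φ) h
    ... | inj₁ i = inj₁ (∈-increment⁻ sent x Φ nsc i)
    ... | inj₂ i = inj₂ (refl , i)

  K-old : ∀ C {φ} → NotCounter sent φ → (∀ a b → φ ≢ CreatedUsing a b) → φ ∈ K κ₁ C → φ ∈ K κ₀ C
  K-old C nsc nc h with K-old-or-new C nsc h
  ... | inj₁ i = i
  ... | inj₂ (_ , i) with CU∈ i
  ...   | p , _ , e = ⊥-elim (nc _ _ e)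

  sent-unchanged : ∀ C w → x ≢ w → readings sent w (K κ₁ C) ≡ readings sent w (K κ₀ C)
  sent-unchanged C w ne = knowledge-upd α₀ A v hα (λ L L′ → readings sent w L ≡ readings sent w L′)
    (trans (readings-++-map sent w (IncSent x Φ) _ (λ _ → _) yz)
           (readings-increment-other sent sent x w Φ (λ e → ne (sym (cong proj₂ e)))))
    (λ _ → refl) C

  sent-x-at-sender : readings sent x (K κ₁ A) ≡ incReadings (readings sent x (K κ₀ A))
  sent-x-at-sender rewrite upd-same α₀ A (just v) | hα =
    trans (readings-++-map sent x (IncSent x Φ) _ (λ _ → _) yz) (readings-increment-same sent x Φ)

  sent-x : ∀ C → readings sent x (K κ₁ C) ≡ readings sent x (K κ₀ C) ⊎ (A ≡ C × readings sent x (K κ₁ C) ≡ incReadings (readings sent x (K κ₀ C)))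
  sent-x C with updCase α₀ A (just v) C
  ... | isSame refl _ = inj₂ (refl , sent-x-at-sender)
  ... | isOther _ q rewrite q = inj₁ refl

  received-unchanged : ∀ C w → readings received w (K κ₁ C) ≡ readings received w (K κ₀ C)
  received-unchanged C w = knowledge-upd α₀ A v hα (λ L L′ → readings received w L ≡ readings received w L′)
    (trans (readings-++-map received w (IncSent x Φ) _ (λ _ → _) yz) (readings-increment-other sent received x w Φ (λ ())))
    (λ _ → refl) C

  activated-unchanged : ∀ C w → activated w (K κ₁ C) ≡ activated w (K κ₀ C)
  activated-unchanged C w = activated-cong w _ _ (K-old C _ (λ _ _ ())) (K-kept C _)

  presence-others : ∀ w → w ∉ Z → presence κ₁ w ≡ presence κ₀ w
  presence-others w ni rewrite activated-unchanged (owner w) w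
                             | count-put-weightless μ₀ B m (carrying w) (∉⇒occurrences≡0 w Z ni) (owner w)
                             | count-put-weightless μ₀ B m (releasing w) refl (target w) = refl

  presence-created : ∀ w → (i : w ∈ Z) → presence κ₁ w ≡ 1
  presence-created w i rewrite lookup (owners-Z yz) i
                             | activated-unchanged B w
                             | count-put-same (carrying w) μ₀ B m
                             | Unique⇒occurrences≡1 Z (subst Unique (sym tokens-Z) uz) i
                             | count-put-weightless μ₀ B m (releasing w) refl (target w)
                             | FZ.carrying≡0 i w (FZ.tz i) B | FZ.activated≡0 i w (FZ.tz i) B
                             | FZ.releasing≡0 i w (FZ.tz i) (target w) = refl

  targetCount-unchanged : ∀ w → x ≢ w → targetCount κ₁ w ≡ targetCount κ₀ w
  targetCount-unchanged w ne rewrite received-unchanged (target w) w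
                                   | count-put-weightless μ₀ B m (along w) (indicator-no (x ≟R w) ne) (target w) = refl

  targetCount-x : targetCount κ₁ x ≡ suc (targetCount κ₀ x)
  targetCount-x rewrite received-unchanged B x | count-put-same (along x) μ₀ B m | indicator-yes (x ≟R x) refl = +-suc _ _

  ownerCount-x : ownerCount κ₁ x ≡ suc (ownerCount κ₀ x)
  ownerCount-x rewrite ox = trans (cong headOr0 sent-x-at-sender) (headOr0-incReadings (readings sent x (K κ₀ A)))

  Internal-before : ∀ C → Internal κ₁ C → Internal κ₀ C
  Internal-before = upd-Internal⁻ α₀ A v hα

  ∈-mailbox-after : ∀ C {m′} → m′ ∈ μ₁ C → m′ ∈ μ₀ C ⊎ (B ≡ C × m′ ≡ m)
  ∈-mailbox-after C = ∈-put⁻ μ₀ B m C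

  createdUsing-owner′ : ∀ A′ w a → CreatedUsing w a ∈ K κ₁ A′ → owner w ≡ A′ × Activated w ∈ K κ₁ A′
  createdUsing-owner′ A′ w a i with K-old-or-new A′ _ i
  ... | inj₁ j = let (o , q) = createdUsing-owner I A′ w a j in o , K-kept A′ _ q
  ... | inj₂ (refl , j) with CU∈ j
  ...   | p , pi , refl = proj₁ (lookup hyz pi) , K-kept A _ (subst (Activated (proj₁ p) ∈_) (sym KA₀) (⊢Activated⁻ (proj₂ (lookup hyz pi))))

  presence≤1′ : ∀ w → presence κ₁ w ≤ 1
  presence≤1′ w with w ∈R? Z
  ... | yes i = ≤-reflexive (presence-created w i)
  ... | no ni = subst (_≤ 1) (sym (presence-others w ni)) (presence≤1 I w)

  released⇒presence≡0′ : ∀ w → Released w ∈ K κ₁ (target w) → presence κ₁ w ≡ 0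
  released⇒presence≡0′ w j with K-old (target w) _ (λ _ _ ()) j | w ∈R? Z
  ... | k | yes i = ⊥-elim (FZ.∉knowledge i w (FZ.tz i) (target w) k (here refl))
  ... | k | no ni = trans (presence-others w ni) (released⇒presence≡0 I w k)

  createdUsing-unique′ : ∀ A1 A2 w1 w2 a → CreatedUsing w1 a ∈ K κ₁ A1 → CreatedUsing w2 a ∈ K κ₁ A2 → A1 ≡ A2 × w1 ≡ w2
  createdUsing-unique′ A1 A2 w1 w2 a i j with K-old-or-new A1 _ i | K-old-or-new A2 _ j
  ... | inj₁ i′ | inj₁ j′ = createdUsing-unique I A1 A2 w1 w2 a i′ j′
  ... | inj₁ i′ | inj₂ (_ , j′) with CU∈ j′
  ...   | p , pi , refl = ⊥-elim (FP.∉knowledge pi a refl A1 i′ (there (here refl)))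
  createdUsing-unique′ A1 A2 w1 w2 a i j | inj₂ (_ , i′) | inj₁ j′ with CU∈ i′
  ...   | p , pi , refl = ⊥-elim (FP.∉knowledge pi a refl A2 j′ (there (here refl)))
  createdUsing-unique′ A1 A2 w1 w2 a i j | inj₂ (refl , i′) | inj₂ (refl , j′) with CU∈ i′ | CU∈ j′
  ...   | p , pi , refl | p′ , pi′ , e with Unique-proj₂-injective yz uz pi pi′ (cong token (proj₂ (CreatedUsing-injective e)))
  ...     | refl = refl , sym (proj₁ (CreatedUsing-injective e))

  createdUsing-pending′ : ∀ A′ w a → CreatedUsing w a ∈ K κ₁ A′ → Created a ∉ K κ₁ (target a) × count (introducing a) (μ₁ (target a)) ≡ 0
  createdUsing-pending′ A′ w a i with K-old-or-new A′ _ i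
  ... | inj₁ j = let (c , b) = createdUsing-pending I A′ w a j in (λ k → c (K-old (target a) _ (λ _ _ ()) k)) , trans (count-put-weightless μ₀ B m (introducing a) refl (target a)) b
  ... | inj₂ (_ , j) with CU∈ j
  ...   | p , pi , refl = (λ k → FP.∉knowledge pi (fr p) refl (target (fr p)) (K-old (target (fr p)) _ (λ _ _ ()) k) (here refl)) ,
                          trans (count-put-weightless μ₀ B m (introducing (fr p)) refl (target (fr p))) (FP.introducing≡0 pi (fr p) refl (target (fr p)))

  Known-before : ∀ y → y ∉ Z → Known κ₁ y → Known κ₀ y
  Known-before y ni (inj₁ j) = inj₁ (K-old (target y) _ (λ _ _ ()) j)
  Known-before y ni (inj₂ (inj₁ (A′ , w , j))) with K-old-or-new A′ _ j
  ... | inj₁ k = inj₂ (inj₁ (A′ , w , k))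
  ... | inj₂ (_ , k) with CU∈ k
  ...   | p , pi , refl = ⊥-elim (ni (∈-map⁺ fr pi))
  Known-before y ni (inj₂ (inj₂ (C , w , B′ , j))) with ∈-mailbox-after C j
  ... | inj₁ k = inj₂ (inj₂ (C , w , B′ , k))
  ... | inj₂ (_ , ())

  known⇒live′ : ∀ y → Known κ₁ y → Internal κ₁ (target y) → Released y ∉ K κ₁ (target y) → Live κ₁ U′ y
  known⇒live′ y s it nr with y ∈R? Z
  ... | yes i = proj₂ us y i , inj₁ (≤-reflexive (sym (presence-created y i)))
  ... | no ni with known⇒live I y (Known-before y ni s) (Internal-before _ it) (λ j → nr (K-kept (target y) _ j))
  ...   | u , inj₁ p = proj₁ us y u (λ ()) , inj₁ (subst (1 ≤_) (sym (presence-others y ni)) p)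
  ...   | u , inj₂ e = proj₁ us y u (λ ()) , inj₂ (upd-nothing⁺ α₀ A v hα (owner y) e)

  sent-readings≤1′ : ∀ C w → length (readings sent w (K κ₁ C)) ≤ 1
  sent-readings≤1′ C w with x ≟R w
  ... | no ne = subst (λ l → length l ≤ 1) (sym (sent-unchanged C w ne)) (sent-readings≤1 I C w)
  ... | yes refl with sent-x C
  ...   | inj₁ e = subst (λ l → length l ≤ 1) (sym e) (sent-readings≤1 I C x)
  ...   | inj₂ (_ , e) rewrite e = length-incReadings (readings sent x (K κ₀ C)) (sent-readings≤1 I C x)

  counts-agree′ : ∀ y → Internal κ₁ (owner y) → Internal κ₁ (target y) →
       1 ≤ held κ₁ y → ownerCount κ₁ y ≡ targetCount κ₁ y
  counts-agree′ y io it h with y ∈R? Z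
  ... | yes i rewrite sent-unchanged (owner y) y (x≢created i)
                    | FZ.readings≡[] i y (FZ.tz i) sent (owner y)
                    | targetCount-unchanged y (x≢created i)
                    | FZ.readings≡[] i y (FZ.tz i) received (target y)
                    | FZ.along≡0 i y (FZ.tz i) (target y) = refl
  ... | no ni with counts-agree I y (Internal-before _ io) (Internal-before _ it)
                    (subst (1 ≤_) (cong₂ _+_ (count-put-weightless μ₀ B m (carrying y) (∉⇒occurrences≡0 y Z ni) (owner y)) (activated-unchanged (owner y) y)) h)
  ...   | e with x ≟R y
  ...     | no ne = trans (cong headOr0 (sent-unchanged (owner y) y ne)) (trans e (sym (targetCount-unchanged y ne)))
  ...     | yes refl = trans ownerCount-x (trans (cong suc e) (sym targetCount-x))

  release-count′ : ∀ y k → Internal κ₁ (owner y) → Internal κ₁ (target y) → Release y k ∈ μ₁ (target y) → k ≡ targetCount κ₁ y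
  release-count′ y k io it h with ∈-mailbox-after (target y) h
  ... | inj₂ (_ , ())
  ... | inj₁ j with x ≟R y
  ...   | no ne = trans (release-count I y k (Internal-before _ io) (Internal-before _ it) j) (sym (targetCount-unchanged y ne))
  ...   | yes refl = ⊥-elim (≤⇒≯ (presence≤1 I x) (activated+release⇒presence≥2 κ₀ x k (subst (λ C → Activated x ∈ K κ₀ C) (sym ox) actx) j))

  invariant : Invariant κ₁ U′
  invariant = record
    { external-absent = λ B′ i → upd-nothing⁺ α₀ A v hα B′ (external-absent I B′ i)
    ; app-addressed = λ C y R′ i → [ app-addressed I C y R′ , (λ { (refl , refl) → refl , owners-Z yz }) ]′ (∈-mailbox-after C i)
    ; info-addressed = λ C a b B′ i → [ info-addressed I C a b B′ , (λ { (_ , ()) }) ]′ (∈-mailbox-after C i)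
    ; release-addressed = λ C y k i → [ release-addressed I C y k , (λ { (_ , ()) }) ]′ (∈-mailbox-after C i)
    ; createdUsing-owner = createdUsing-owner′
    ; presence≤1 = presence≤1′
    ; released⇒presence≡0 = released⇒presence≡0′
    ; createdUsing-unique = createdUsing-unique′
    ; createdUsing-pending = createdUsing-pending′
    ; introducing≤1 = λ y → subst (_≤ 1) (sym (count-put-weightless μ₀ B m (introducing y) refl (target y))) (introducing≤1 I y)
    ; introducing⇒¬Created = λ y h j → introducing⇒¬Created I y (subst (1 ≤_) (count-put-weightless μ₀ B m (introducing y) refl (target y)) h) (K-old (target y) _ (λ _ _ ()) j)
    ; known⇒live = known⇒live′
    ; sent-readings≤1 = sent-readings≤1′
    ; counts-agree = counts-agree′
    ; release-count = release-count′
    }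

module AfterReceive {α₀ : Actor → Maybe AState} {μ₀ μ₁ : Actor → List Msg} {ρ₀ χ₀ : List Actor} {Φ : KSet}
  {U U′ : Refob → Set} (x : Refob) (B : Actor) (R : List Refob)
  (hα : α₀ B ≡ just (idle Φ)) (cs : Consume μ₀ B (App x R) μ₁)
  (I : Invariant (cfg α₀ μ₀ ρ₀ χ₀) U) (us : UnreleasedStep (receiveE x B R) U U′) where

  Φ′ = IncRecv x Φ ++ map Activated R
  v = busy Φ′
  α₁ = upd α₀ B (just v)
  m = App x R
  κ₀ = cfg α₀ μ₀ ρ₀ χ₀
  κ₁ = cfg α₁ μ₁ ρ₀ χ₀
  open Consumed {μ₀} {μ₁} {B} {m} cs
  count-weightless = count-consume-weightless {μ₀} {μ₁} {B} {m} cs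

  tx : target x ≡ B
  tx = proj₁ (app-addressed I B x R m∈)
  oR : All (λ r → owner r ≡ B) R
  oR = proj₂ (app-addressed I B x R m∈)

  owned-by-B : ∀ {r} → r ∈ R → owner r ≡ B
  owned-by-B = lookup oR

  K-kept : ∀ C {φ} → NotCounter received φ → φ ∈ K κ₀ C → φ ∈ K κ₁ C
  K-kept C {φ} nrc = knowledge-upd α₀ B v hα (λ L L′ → φ ∈ L′ → φ ∈ L) (λ h → ∈-++⁺ˡ (∈-increment⁺ received x Φ nrc h)) (λ _ h → h) C

  K-old-or-new : ∀ C {φ} → NotCounter received φ → φ ∈ K κ₁ C → φ ∈ K κ₀ C ⊎ (B ≡ C × Σ Refob λ r → r ∈ R × φ ≡ Activated r)
  K-old-or-new C {φ} nrc = f (updCase α₀ B (just v) C)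
    where
    f : UpdCase α₀ B (just v) C → φ ∈ knowledgeOf (α₁ C) → φ ∈ K κ₀ C ⊎ (B ≡ C × Σ Refob λ r → r ∈ R × φ ≡ Activated r)
    f (isOther _ q) h rewrite q = inj₁ h
    f (isSame refl q) h rewrite q | hα with ∈-++⁻ (IncRecv x Φ) h
    ... | inj₁ i = inj₁ (∈-increment⁻ received x Φ nrc i)
    ... | inj₂ i = inj₂ (refl , ∈-map⁻ Activated i)

  K-old : ∀ C {φ} → NotCounter received φ → (∀ r → φ ≢ Activated r) → φ ∈ K κ₁ C → φ ∈ K κ₀ C
  K-old C nrc na h with K-old-or-new C nrc h
  ... | inj₁ i = i
  ... | inj₂ (_ , r , _ , e) = ⊥-elim (na r e)

  sent-unchanged : ∀ C w → readings sent w (K κ₁ C) ≡ readings sent w (K κ₀ C)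
  sent-unchanged C w = knowledge-upd α₀ B v hα (λ L L′ → readings sent w L ≡ readings sent w L′)
    (trans (readings-++-map sent w (IncRecv x Φ) Activated (λ _ → _) R) (readings-increment-other received sent x w Φ (λ ())))
    (λ _ → refl) C

  received-unchanged : ∀ C w → x ≢ w → readings received w (K κ₁ C) ≡ readings received w (K κ₀ C)
  received-unchanged C w ne = knowledge-upd α₀ B v hα (λ L L′ → readings received w L ≡ readings received w L′)
    (trans (readings-++-map received w (IncRecv x Φ) Activated (λ _ → _) R)
           (readings-increment-other received received x w Φ (λ e → ne (sym (cong proj₂ e)))))
    (λ _ → refl) C

  received-x : readings received x (K κ₁ B) ≡ incReadings (readings received x (K κ₀ B))
  received-x rewrite upd-same α₀ B (just v) | hα =
    trans (readings-++-map received x (IncRecv x Φ) Activated (λ _ → _) R) (readings-increment-same received x Φ)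

  activated-unchanged : ∀ C w → w ∉ R → activated w (K κ₁ C) ≡ activated w (K κ₀ C)
  activated-unchanged C w ni = activated-cong w _ _ f (K-kept C _)
    where f : Activated w ∈ K κ₁ C → Activated w ∈ K κ₀ C
          f h with K-old-or-new C _ h
          ... | inj₁ i = i
          ... | inj₂ (_ , r , i , e) rewrite Activated-injective e = ⊥-elim (ni i)

  activated-received : ∀ w → w ∈ R → activated w (K κ₁ B) ≡ 1
  activated-received w i = activated-∈ j
    where j : Activated w ∈ K κ₁ B
          j rewrite upd-same α₀ B (just v) = ∈-++⁺ʳ (IncRecv x Φ) (∈-map⁺ Activated i)

  carrying-unchanged : ∀ w → w ∉ R → ∀ C → count (carrying w) (μ₁ C) ≡ count (carrying w) (μ₀ C)
  carrying-unchanged w ni C = count-weightless (carrying w) (∉⇒occurrences≡0 w R ni) C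

  presence-unchanged : ∀ w → w ∉ R → presence κ₁ w ≡ presence κ₀ w
  presence-unchanged w ni rewrite activated-unchanged (owner w) w ni
                                | carrying-unchanged w ni (owner w)
                                | count-weightless (releasing w) refl (target w) = refl

  app≥ : ∀ w → w ∈ R → 1 ≤ count (carrying w) (μ₀ (owner w))
  app≥ w i rewrite owned-by-B i | count-same (carrying w) = ≤-trans (∈⇒occurrences≥1 i) (m≤m+n _ _)

  presence-before≥1 : ∀ w → w ∈ R → 1 ≤ presence κ₀ w
  presence-before≥1 w i = ≤-trans (app≥ w i) (≤-trans (m≤m+n _ _) (m≤m+n _ _))

  carrying+releasing≡0 : ∀ w → w ∈ R → count (carrying w) (μ₁ (owner w)) + count (releasing w) (μ₁ (target w)) ≡ 0
  carrying+releasing≡0 w i = n≤0⇒n≡0 (≤-pred (≤-trans le (presence≤1 I w)))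
    where
    a₁ = count (carrying w) (μ₁ (owner w))
    r₁ = count (releasing w) (μ₁ (target w))
    cR = occurrences w R
    q0 : count (carrying w) (μ₀ (owner w)) ≡ cR + a₁
    q0 rewrite owned-by-B i = count-same (carrying w)
    cR≥ : 1 ≤ cR
    cR≥ = ∈⇒occurrences≥1 i
    le : a₁ + r₁ < presence κ₀ w
    le rewrite q0 | count-weightless (releasing w) refl (target w) =
      ≤-trans (+-mono-≤ {1 + a₁} {cR + a₁} (+-monoˡ-≤ a₁ cR≥) ≤-refl) (+-mono-≤ (m≤m+n (cR + a₁) (activated w (K κ₀ (owner w)))) (≤-refl {count (releasing w) (μ₀ (target w))}))

  targetCount-unchanged : ∀ w → targetCount κ₁ w ≡ targetCount κ₀ w
  targetCount-unchanged w with x ≟R w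
  ... | no ne rewrite received-unchanged (target w) w ne | count-weightless (along w) (indicator-no (x ≟R w) ne) (target w) = refl
  ... | yes refl rewrite tx
                       | received-x
                       | count-same (along x)
                       | indicator-yes (x ≟R x) refl
                       | headOr0-incReadings (readings received x (K κ₀ B)) = sym (+-suc _ _)

  Internal-before : ∀ C → Internal κ₁ C → Internal κ₀ C
  Internal-before = upd-Internal⁻ α₀ B v hα

  Known-before : ∀ y → Known κ₁ y → Known κ₀ y
  Known-before y (inj₁ j) = inj₁ (K-old (target y) _ (λ _ ()) j)
  Known-before y (inj₂ (inj₁ (A , w , j))) = inj₂ (inj₁ (A , w , K-old A _ (λ _ ()) j))
  Known-before y (inj₂ (inj₂ (C , w , B′ , j))) = inj₂ (inj₂ (C , w , B′ , ∈⁻ C j))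

  presence-received≡1 : ∀ w → w ∈ R → presence κ₁ w ≡ 1
  presence-received≡1 w i rewrite owned-by-B i | activated-received w i with owned-by-B i
  ... | e = trans (cong (_+ count (releasing w) (μ₁ (target w))) (+-comm (count (carrying w) (μ₁ B)) 1))
                  (cong suc (subst (λ c → count (carrying w) (μ₁ c) + count (releasing w) (μ₁ (target w)) ≡ 0) e (carrying+releasing≡0 w i)))

  presence≤1′ : ∀ w → presence κ₁ w ≤ 1
  presence≤1′ w with w ∈R? R
  ... | yes i = ≤-reflexive (presence-received≡1 w i)
  ... | no ni = subst (_≤ 1) (sym (presence-unchanged w ni)) (presence≤1 I w)

  released⇒presence≡0′ : ∀ w → Released w ∈ K κ₁ (target w) → presence κ₁ w ≡ 0
  released⇒presence≡0′ w j with released⇒presence≡0 I w (K-old (target w) _ (λ _ ()) j) | w ∈R? R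
  ... | e | yes i = ⊥-elim (≡0⇒≱1 e (presence-before≥1 w i))
  ... | e | no ni = trans (presence-unchanged w ni) e

  known⇒live′ : ∀ y → Known κ₁ y → Internal κ₁ (target y) → Released y ∉ K κ₁ (target y) → Live κ₁ U′ y
  known⇒live′ y s it nr with known⇒live I y (Known-before y s) (Internal-before _ it) (λ j → nr (K-kept (target y) _ j)) | y ∈R? R
  ... | u , _ | yes i = proj₁ us y u (λ ()) , inj₁ (≤-reflexive (sym (presence-received≡1 y i)))
  ... | u , inj₁ p | no ni = proj₁ us y u (λ ()) , inj₁ (subst (1 ≤_) (sym (presence-unchanged y ni)) p)
  ... | u , inj₂ e | no ni = proj₁ us y u (λ ()) , inj₂ (upd-nothing⁺ α₀ B v hα (owner y) e)

  counts-agree′ : ∀ y → Internal κ₁ (owner y) → Internal κ₁ (target y) →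
       1 ≤ held κ₁ y → ownerCount κ₁ y ≡ targetCount κ₁ y
  counts-agree′ y io it h = trans (cong headOr0 (sent-unchanged (owner y) y)) (trans (counts-agree I y (Internal-before _ io) (Internal-before _ it) h₀) (sym (targetCount-unchanged y)))
    where
    h₀ : 1 ≤ held κ₀ y
    h₀ with y ∈R? R
    ... | yes i = ≤-trans (app≥ y i) (m≤m+n _ _)
    ... | no ni = subst (1 ≤_) (cong₂ _+_ (carrying-unchanged y ni (owner y)) (activated-unchanged (owner y) y ni)) h

  invariant : Invariant κ₁ U′
  invariant = record
    { external-absent = λ B′ i → upd-nothing⁺ α₀ B v hα B′ (external-absent I B′ i)
    ; app-addressed = λ C y R′ i → app-addressed I C y R′ (∈⁻ C i)
    ; info-addressed = λ C a b B′ i → info-addressed I C a b B′ (∈⁻ C i)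
    ; release-addressed = λ C y k i → release-addressed I C y k (∈⁻ C i)
    ; createdUsing-owner = λ A w a i → let (o , q) = createdUsing-owner I A w a (K-old A _ (λ _ ()) i) in o , K-kept A _ q
    ; presence≤1 = presence≤1′
    ; released⇒presence≡0 = released⇒presence≡0′
    ; createdUsing-unique = λ A A′ w w′ y i j → createdUsing-unique I A A′ w w′ y (K-old A _ (λ _ ()) i) (K-old A′ _ (λ _ ()) j)
    ; createdUsing-pending = λ A w y i → let (a , b) = createdUsing-pending I A w y (K-old A _ (λ _ ()) i) in
               (λ j → a (K-old (target y) _ (λ _ ()) j)) , trans (count-weightless (introducing y) refl (target y)) b
    ; introducing≤1 = λ y → subst (_≤ 1) (sym (count-weightless (introducing y) refl (target y))) (introducing≤1 I y)
    ; introducing⇒¬Created = λ y h j → introducing⇒¬Created I y (subst (1 ≤_) (count-weightless (introducing y) refl (target y)) h) (K-old (target y) _ (λ _ ()) j)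
    ; known⇒live = known⇒live′
    ; sent-readings≤1 = λ A w → subst (λ l → length l ≤ 1) (sym (sent-unchanged A w)) (sent-readings≤1 I A w)
    ; counts-agree = counts-agree′
    ; release-count = λ y k io it h → trans (release-count I y k (Internal-before _ io) (Internal-before _ it) (∈⁻ (target y) h)) (sym (targetCount-unchanged y))
    }

module AfterSendInfo {α₀ : Actor → Maybe AState} {μ₀ : Actor → List Msg} {ρ₀ χ₀ : List Actor} {Φ : KSet}
  {U U′ : Refob → Set} (y z : Refob)
  (hα : α₀ (owner y) ≡ just (busy Φ)) (htz : target z ≡ target y) (hcu : CreatedUsing y z ∈ Φ)
  (I : Invariant (cfg α₀ μ₀ ρ₀ χ₀) U) (us : UnreleasedStep (sendInfoE y z) U U′) where

  Aₒ = owner y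
  Cₜ = target y
  φcu = CreatedUsing y z
  Φ1 = remove φcu Φ
  Φ′ = increment sent y Φ1
  v = busy Φ′
  α₁ = upd α₀ Aₒ (just v)
  m = Info y z (owner z)
  μ₁ = put μ₀ Cₜ m
  κ₀ = cfg α₀ μ₀ ρ₀ χ₀
  κ₁ = cfg α₁ μ₁ ρ₀ χ₀

  Φ′⊆Φ : ∀ {φ} → NotCounter sent φ → φ ∈ Φ′ → φ ∈ Φ
  Φ′⊆Φ nsc h = proj₁ (∈-remove⁻ φcu Φ (∈-increment⁻ sent y Φ1 nsc h))

  Φ⊆Φ′ : ∀ {φ} → NotCounter sent φ → φ ∈ Φ → φ ≢ φcu → φ ∈ Φ′
  Φ⊆Φ′ nsc h ne = ∈-increment⁺ sent y Φ1 nsc (∈-remove⁺ φcu Φ h ne)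

  K-old : ∀ C {φ} → NotCounter sent φ → φ ∈ K κ₁ C → φ ∈ K κ₀ C
  K-old C {φ} nsc = knowledge-upd α₀ Aₒ v hα (λ L L′ → φ ∈ L → φ ∈ L′) (Φ′⊆Φ nsc) (λ _ h → h) C

  K-kept : ∀ C {φ} → NotCounter sent φ → φ ≢ φcu → φ ∈ K κ₀ C → φ ∈ K κ₁ C
  K-kept C {φ} nsc ne = knowledge-upd α₀ Aₒ v hα (λ L L′ → φ ∈ L′ → φ ∈ L) (λ h → Φ⊆Φ′ nsc h ne) (λ _ h → h) C

  KA₀ : K κ₀ Aₒ ≡ Φ
  KA₀ rewrite hα = refl

  cu∉ : φcu ∉ K κ₁ Aₒ
  cu∉ i = proj₂ (∈-remove⁻ φcu Φ (∈-increment⁻ sent y Φ1 _ (at-Aₒ i))) refl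
    where at-Aₒ : φcu ∈ K κ₁ Aₒ → φcu ∈ Φ′
          at-Aₒ i rewrite upd-same α₀ Aₒ (just v) = i

  cu∈ : φcu ∈ K κ₀ Aₒ
  cu∈ = subst (φcu ∈_) (sym KA₀) hcu

  sent-unchanged : ∀ C w → y ≢ w → readings sent w (K κ₁ C) ≡ readings sent w (K κ₀ C)
  sent-unchanged C w ne = knowledge-upd α₀ Aₒ v hα (λ L L′ → readings sent w L ≡ readings sent w L′)
    (trans (readings-increment-other sent sent y w Φ1 (λ e → ne (sym (cong proj₂ e)))) (readings-remove sent w φcu Φ _)) (λ _ → refl) C

  sent-y-at-owner : readings sent y (K κ₁ Aₒ) ≡ incReadings (readings sent y (K κ₀ Aₒ))
  sent-y-at-owner rewrite upd-same α₀ Aₒ (just v) | hα =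
    trans (readings-increment-same sent y Φ1) (cong incReadings (readings-remove sent y φcu Φ _))

  sent-y : ∀ C → readings sent y (K κ₁ C) ≡ readings sent y (K κ₀ C) ⊎ (Aₒ ≡ C × readings sent y (K κ₁ C) ≡ incReadings (readings sent y (K κ₀ C)))
  sent-y C with updCase α₀ Aₒ (just v) C
  ... | isSame refl _ = inj₂ (refl , sent-y-at-owner)
  ... | isOther _ q rewrite q = inj₁ refl

  received-unchanged : ∀ C w → readings received w (K κ₁ C) ≡ readings received w (K κ₀ C)
  received-unchanged C w = knowledge-upd α₀ Aₒ v hα (λ L L′ → readings received w L ≡ readings received w L′)
    (trans (readings-increment-other sent received y w Φ1 (λ ())) (readings-remove received w φcu Φ _)) (λ _ → refl) C

  activated-unchanged : ∀ C w → activated w (K κ₁ C) ≡ activated w (K κ₀ C)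
  activated-unchanged C w = activated-cong w _ _ (K-old C _) (K-kept C _ (λ ()))

  presence-unchanged : ∀ w → presence κ₁ w ≡ presence κ₀ w
  presence-unchanged w rewrite activated-unchanged (owner w) w
                             | count-put-weightless μ₀ Cₜ m (carrying w) refl (owner w)
                             | count-put-weightless μ₀ Cₜ m (releasing w) refl (target w) = refl

  targetCount-unchanged : ∀ w → y ≢ w → targetCount κ₁ w ≡ targetCount κ₀ w
  targetCount-unchanged w ne rewrite received-unchanged (target w) w
                                   | count-put-weightless μ₀ Cₜ m (along w) (indicator-no (y ≟R w) ne) (target w) = refl

  targetCount-y : targetCount κ₁ y ≡ suc (targetCount κ₀ y)
  targetCount-y rewrite received-unchanged Cₜ y | count-put-same (along y) μ₀ Cₜ m | indicator-yes (y ≟R y) refl = +-suc _ _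

  ownerCount-y : ownerCount κ₁ y ≡ suc (ownerCount κ₀ y)
  ownerCount-y = trans (cong headOr0 sent-y-at-owner) (headOr0-incReadings (readings sent y (K κ₀ Aₒ)))

  Internal-before : ∀ C → Internal κ₁ C → Internal κ₀ C
  Internal-before = upd-Internal⁻ α₀ Aₒ v hα

  ∈-mailbox-after : ∀ C {m′} → m′ ∈ μ₁ C → m′ ∈ μ₀ C ⊎ (Cₜ ≡ C × m′ ≡ m)
  ∈-mailbox-after C = ∈-put⁻ μ₀ Cₜ m C

  infoz0 : count (introducing z) (μ₀ (target z)) ≡ 0
  infoz0 = proj₂ (createdUsing-pending I Aₒ y z cu∈)

  introducing-unchanged : ∀ w → z ≢ w → count (introducing w) (μ₁ (target w)) ≡ count (introducing w) (μ₀ (target w))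
  introducing-unchanged w ne = count-put-weightless μ₀ Cₜ m (introducing w) (indicator-no (z ≟R w) ne) (target w)

  infoz : count (introducing z) (μ₁ (target z)) ≡ 1
  infoz rewrite htz | count-put-same (introducing z) μ₀ Cₜ m | indicator-yes (z ≟R z) refl | sym htz | infoz0 = refl

  activated-y : Activated y ∈ K κ₀ Aₒ
  activated-y = proj₂ (createdUsing-owner I Aₒ y z cu∈)

  Known-before : ∀ x → Known κ₁ x → Known κ₀ x
  Known-before x (inj₁ j) = inj₁ (K-old (target x) _ j)
  Known-before x (inj₂ (inj₁ (A , w , j))) = inj₂ (inj₁ (A , w , K-old A _ j))
  Known-before x (inj₂ (inj₂ (C , w , B′ , j))) with ∈-mailbox-after C j
  ... | inj₁ k = inj₂ (inj₂ (C , w , B′ , k))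
  ... | inj₂ (_ , refl) = inj₂ (inj₁ (Aₒ , y , cu∈))

  createdUsing-pending′ : ∀ A w x → CreatedUsing w x ∈ K κ₁ A → Created x ∉ K κ₁ (target x) × count (introducing x) (μ₁ (target x)) ≡ 0
  createdUsing-pending′ A w x i with createdUsing-pending I A w x (K-old A _ i)
  ... | a , b with z ≟R x
  ...   | no ne = (λ j → a (K-old (target x) _ j)) , trans (introducing-unchanged x ne) b
  ...   | yes refl with createdUsing-unique I A Aₒ w y z (K-old A _ i) cu∈
  ...     | refl , refl = ⊥-elim (cu∉ i)

  introducing≤1′ : ∀ x → count (introducing x) (μ₁ (target x)) ≤ 1
  introducing≤1′ x with z ≟R x
  ... | no ne = subst (_≤ 1) (sym (introducing-unchanged x ne)) (introducing≤1 I x)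
  ... | yes refl = ≤-reflexive infoz

  introducing⇒¬Created′ : ∀ x → 1 ≤ count (introducing x) (μ₁ (target x)) → Created x ∉ K κ₁ (target x)
  introducing⇒¬Created′ x h j with z ≟R x
  ... | no ne = introducing⇒¬Created I x (subst (1 ≤_) (introducing-unchanged x ne) h) (K-old (target x) _ j)
  ... | yes refl = proj₁ (createdUsing-pending I Aₒ y z cu∈) (K-old (target z) _ j)

  known⇒live′ : ∀ x → Known κ₁ x → Internal κ₁ (target x) → Released x ∉ K κ₁ (target x) → Live κ₁ U′ x
  known⇒live′ x s it nr with known⇒live I x (Known-before x s) (Internal-before _ it) (λ j → nr (K-kept (target x) _ (λ ()) j))
  ... | u , inj₁ p = proj₁ us x u (λ ()) , inj₁ (subst (1 ≤_) (sym (presence-unchanged x)) p)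
  ... | u , inj₂ e = proj₁ us x u (λ ()) , inj₂ (upd-nothing⁺ α₀ Aₒ v hα (owner x) e)

  sent-readings≤1′ : ∀ C w → length (readings sent w (K κ₁ C)) ≤ 1
  sent-readings≤1′ C w with y ≟R w
  ... | no ne = subst (λ l → length l ≤ 1) (sym (sent-unchanged C w ne)) (sent-readings≤1 I C w)
  ... | yes refl with sent-y C
  ...   | inj₁ e = subst (λ l → length l ≤ 1) (sym e) (sent-readings≤1 I C y)
  ...   | inj₂ (_ , e) rewrite e = length-incReadings (readings sent y (K κ₀ C)) (sent-readings≤1 I C y)

  counts-agree′ : ∀ x → Internal κ₁ (owner x) → Internal κ₁ (target x) →
       1 ≤ held κ₁ x → ownerCount κ₁ x ≡ targetCount κ₁ x
  counts-agree′ x io it h with counts-agree I x (Internal-before _ io) (Internal-before _ it)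
                      (subst (1 ≤_) (cong₂ _+_ (count-put-weightless μ₀ Cₜ m (carrying x) refl (owner x)) (activated-unchanged (owner x) x)) h)
  ... | e with y ≟R x
  ...   | no ne = trans (cong headOr0 (sent-unchanged (owner x) x ne)) (trans e (sym (targetCount-unchanged x ne)))
  ...   | yes refl = trans ownerCount-y (trans (cong suc e) (sym targetCount-y))

  release-count′ : ∀ x k → Internal κ₁ (owner x) → Internal κ₁ (target x) → Release x k ∈ μ₁ (target x) → k ≡ targetCount κ₁ x
  release-count′ x k io it h with ∈-mailbox-after (target x) h
  ... | inj₂ (_ , ())
  ... | inj₁ j with y ≟R x
  ...   | no ne = trans (release-count I x k (Internal-before _ io) (Internal-before _ it) j) (sym (targetCount-unchanged x ne))
  ...   | yes refl = ⊥-elim (≤⇒≯ (presence≤1 I y) (activated+release⇒presence≥2 κ₀ y k activated-y j))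

  invariant : Invariant κ₁ U′
  invariant = record
    { external-absent = λ B′ i → upd-nothing⁺ α₀ Aₒ v hα B′ (external-absent I B′ i)
    ; app-addressed = λ C x R i → [ app-addressed I C x R , (λ { (_ , ()) }) ]′ (∈-mailbox-after C i)
    ; info-addressed = λ C a b B′ i → [ info-addressed I C a b B′ , (λ { (e , refl) → e , trans htz e }) ]′ (∈-mailbox-after C i)
    ; release-addressed = λ C x k i → [ release-addressed I C x k , (λ { (_ , ()) }) ]′ (∈-mailbox-after C i)
    ; createdUsing-owner = λ A w a i → let (o , q) = createdUsing-owner I A w a (K-old A _ i) in o , K-kept A _ (λ ()) q
    ; presence≤1 = λ x → subst (_≤ 1) (sym (presence-unchanged x)) (presence≤1 I x)
    ; released⇒presence≡0 = λ x i → trans (presence-unchanged x) (released⇒presence≡0 I x (K-old (target x) _ i))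
    ; createdUsing-unique = λ A A′ w w′ x i j → createdUsing-unique I A A′ w w′ x (K-old A _ i) (K-old A′ _ j)
    ; createdUsing-pending = createdUsing-pending′
    ; introducing≤1 = introducing≤1′
    ; introducing⇒¬Created = introducing⇒¬Created′
    ; known⇒live = known⇒live′
    ; sent-readings≤1 = sent-readings≤1′
    ; counts-agree = counts-agree′
    ; release-count = release-count′
    }

module AfterInfo {α₀ : Actor → Maybe AState} {μ₀ μ₁ : Actor → List Msg} {ρ₀ χ₀ : List Actor} {Φ : KSet}
  {U U′ : Refob → Set} (y z : Refob) (B C₀ : Actor)
  (hα : α₀ C₀ ≡ just (idle Φ)) (cs : Consume μ₀ C₀ (Info y z B) μ₁)
  (I : Invariant (cfg α₀ μ₀ ρ₀ χ₀) U) (us : UnreleasedStep (infoE y z B C₀) U U′) where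

  Φ′ = IncRecv y Φ ++ Created z ∷ []
  v = idle Φ′
  α₁ = upd α₀ C₀ (just v)
  κ₀ = cfg α₀ μ₀ ρ₀ χ₀
  κ₁ = cfg α₁ μ₁ ρ₀ χ₀
  m = Info y z B
  open Consumed {μ₀} {μ₁} {C₀} {m} cs
  count-weightless = count-consume-weightless {μ₀} {μ₁} {C₀} {m} cs

  ty : target y ≡ C₀
  ty = proj₁ (info-addressed I C₀ y z B m∈)

  K-kept : ∀ C {φ} → NotCounter received φ → φ ∈ K κ₀ C → φ ∈ K κ₁ C
  K-kept C {φ} nrc = knowledge-upd α₀ C₀ v hα (λ L L′ → φ ∈ L′ → φ ∈ L) (λ h → ∈-++⁺ˡ (∈-increment⁺ received y Φ nrc h)) (λ _ h → h) C

  K-old-or-new : ∀ C {φ} → NotCounter received φ → φ ∈ K κ₁ C → φ ∈ K κ₀ C ⊎ (C₀ ≡ C × φ ≡ Created z)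
  K-old-or-new C {φ} nrc = f (updCase α₀ C₀ (just v) C)
    where
    f : UpdCase α₀ C₀ (just v) C → φ ∈ knowledgeOf (α₁ C) → φ ∈ K κ₀ C ⊎ (C₀ ≡ C × φ ≡ Created z)
    f (isOther _ q) h rewrite q = inj₁ h
    f (isSame refl q) h rewrite q | hα with ∈-++⁻ (IncRecv y Φ) h
    ... | inj₁ i = inj₁ (∈-increment⁻ received y Φ nrc i)
    ... | inj₂ (here e) = inj₂ (refl , e)

  K-old : ∀ C {φ} → NotCounter received φ → (∀ w → φ ≢ Created w) → φ ∈ K κ₁ C → φ ∈ K κ₀ C
  K-old C nrc nc h with K-old-or-new C nrc h
  ... | inj₁ i = i
  ... | inj₂ (_ , e) = ⊥-elim (nc z e)

  sent-unchanged : ∀ C w → readings sent w (K κ₁ C) ≡ readings sent w (K κ₀ C)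
  sent-unchanged C w = knowledge-upd α₀ C₀ v hα (λ L L′ → readings sent w L ≡ readings sent w L′)
    (trans (readings-++-map sent w (IncRecv y Φ) Created (λ _ → _) (z ∷ [])) (readings-increment-other received sent y w Φ (λ ()))) (λ _ → refl) C

  received-unchanged : ∀ C w → y ≢ w → readings received w (K κ₁ C) ≡ readings received w (K κ₀ C)
  received-unchanged C w ne = knowledge-upd α₀ C₀ v hα (λ L L′ → readings received w L ≡ readings received w L′)
    (trans (readings-++-map received w (IncRecv y Φ) Created (λ _ → _) (z ∷ [])) (readings-increment-other received received y w Φ (λ e → ne (sym (cong proj₂ e))))) (λ _ → refl) C

  received-y : readings received y (K κ₁ C₀) ≡ incReadings (readings received y (K κ₀ C₀))
  received-y rewrite upd-same α₀ C₀ (just v)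
                   | hα = trans (readings-++-map received y (IncRecv y Φ) Created (λ _ → _) (z ∷ [])) (readings-increment-same received y Φ)

  activated-unchanged : ∀ C w → activated w (K κ₁ C) ≡ activated w (K κ₀ C)
  activated-unchanged C w = activated-cong w _ _ (K-old C _ (λ _ ())) (K-kept C _)

  presence-unchanged : ∀ w → presence κ₁ w ≡ presence κ₀ w
  presence-unchanged w rewrite activated-unchanged (owner w) w
                             | count-weightless (carrying w) refl (owner w)
                             | count-weightless (releasing w) refl (target w) = refl

  targetCount-unchanged : ∀ w → targetCount κ₁ w ≡ targetCount κ₀ w
  targetCount-unchanged w with y ≟R w
  ... | no ne rewrite received-unchanged (target w) w ne | count-weightless (along w) (indicator-no (y ≟R w) ne) (target w) = refl
  ... | yes refl rewrite ty
                       | received-y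
                       | count-same (along y)
                       | indicator-yes (y ≟R y) refl
                       | headOr0-incReadings (readings received y (K κ₀ C₀)) =
    sym (+-suc _ _)

  Internal-before : ∀ C → Internal κ₁ C → Internal κ₀ C
  Internal-before = upd-Internal⁻ α₀ C₀ v hα

  Known-before : ∀ x → Known κ₁ x → Known κ₀ x
  Known-before x (inj₁ j) with K-old-or-new (target x) _ j
  ... | inj₁ i = inj₁ i
  ... | inj₂ (_ , refl) = inj₂ (inj₂ (C₀ , y , B , m∈))
  Known-before x (inj₂ (inj₁ (A , w , j))) = inj₂ (inj₁ (A , w , K-old A _ (λ _ ()) j))
  Known-before x (inj₂ (inj₂ (C , w , B′ , j))) = inj₂ (inj₂ (C , w , B′ , ∈⁻ C j))

  introducing-z≥1 : 1 ≤ count (introducing z) (μ₀ (target z))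
  introducing-z≥1 = info⇒introducing≥1 κ₀ I C₀ y z B m∈

  createdUsing-pending′ : ∀ A w x → CreatedUsing w x ∈ K κ₁ A → Created x ∉ K κ₁ (target x) × count (introducing x) (μ₁ (target x)) ≡ 0
  createdUsing-pending′ A w x i with createdUsing-pending I A w x (K-old A _ (λ _ ()) i)
  ... | a , b = c , n≤0⇒n≡0 (subst (count (introducing x) (μ₁ (target x)) ≤_) b (count-decreases (introducing x) (target x)))
    where
    c : Created x ∉ K κ₁ (target x)
    c j with K-old-or-new (target x) _ j
    ... | inj₁ k = a k
    ... | inj₂ (_ , refl) = ≡0⇒≱1 b introducing-z≥1

  introducing⇒¬Created′ : ∀ x → 1 ≤ count (introducing x) (μ₁ (target x)) → Created x ∉ K κ₁ (target x)
  introducing⇒¬Created′ x h j with K-old-or-new (target x) _ j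
  ... | inj₁ k = introducing⇒¬Created I x (≤-trans h (count-decreases (introducing x) (target x))) k
  ... | inj₂ (e , refl) = ⊥-elim (≡0⇒≱1 (m+1≤n≤1⇒m≡0 consumed (introducing≤1 I z)) h)
    where
    consumed : count (introducing z) (μ₁ (target z)) + 1 ≤ count (introducing z) (μ₀ (target z))
    consumed rewrite sym e = count-consume {μ₀} {μ₁} {C₀} {m} cs (introducing z) (subst (1 ≤_) (sym (indicator-yes (z ≟R z) refl)) ≤-refl)

  known⇒live′ : ∀ x → Known κ₁ x → Internal κ₁ (target x) → Released x ∉ K κ₁ (target x) → Live κ₁ U′ x
  known⇒live′ x s it nr with known⇒live I x (Known-before x s) (Internal-before _ it) (λ j → nr (K-kept (target x) _ j))
  ... | u , inj₁ p = proj₁ us x u (λ ()) , inj₁ (subst (1 ≤_) (sym (presence-unchanged x)) p)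
  ... | u , inj₂ e = proj₁ us x u (λ ()) , inj₂ (upd-nothing⁺ α₀ C₀ v hα (owner x) e)

  invariant : Invariant κ₁ U′
  invariant = record
    { external-absent = λ B′ i → upd-nothing⁺ α₀ C₀ v hα B′ (external-absent I B′ i)
    ; app-addressed = λ C x R i → app-addressed I C x R (∈⁻ C i)
    ; info-addressed = λ C a b B′ i → info-addressed I C a b B′ (∈⁻ C i)
    ; release-addressed = λ C x n i → release-addressed I C x n (∈⁻ C i)
    ; createdUsing-owner = λ A w a i → let (o , q) = createdUsing-owner I A w a (K-old A _ (λ _ ()) i) in o , K-kept A _ q
    ; presence≤1 = λ x → subst (_≤ 1) (sym (presence-unchanged x)) (presence≤1 I x)
    ; released⇒presence≡0 = λ x i → trans (presence-unchanged x) (released⇒presence≡0 I x (K-old (target x) _ (λ _ ()) i))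
    ; createdUsing-unique = λ A A′ w w′ x i j → createdUsing-unique I A A′ w w′ x (K-old A _ (λ _ ()) i) (K-old A′ _ (λ _ ()) j)
    ; createdUsing-pending = createdUsing-pending′
    ; introducing≤1 = λ x → ≤-trans (count-decreases (introducing x) (target x)) (introducing≤1 I x)
    ; introducing⇒¬Created = introducing⇒¬Created′
    ; known⇒live = known⇒live′
    ; sent-readings≤1 = λ A w → subst (λ l → length l ≤ 1) (sym (sent-unchanged A w)) (sent-readings≤1 I A w)
    ; counts-agree = λ x io it h → trans (cong headOr0 (sent-unchanged (owner x) x))
              (trans (counts-agree I x (Internal-before _ io) (Internal-before _ it)
                 (subst (1 ≤_) (cong₂ _+_ (count-weightless (carrying x) refl (owner x)) (activated-unchanged (owner x) x)) h)) (sym (targetCount-unchanged x)))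
    ; release-count = λ x n io it h → trans (release-count I x n (Internal-before _ io) (Internal-before _ it) (∈⁻ (target x) h)) (sym (targetCount-unchanged x))
    }

module AfterSendRelease {α₀ : Actor → Maybe AState} {μ₀ : Actor → List Msg} {ρ₀ χ₀ : List Actor} {Φ : KSet}
  {U U′ : Refob → Set} (x : Refob) (n : ℕ)
  (hα : α₀ (owner x) ≡ just (busy Φ)) (ha : Activated x ∈ Φ) (hs : Φ ⊢ SentCount x n)
  (hno : ∀ y → CreatedUsing x y ∉ Φ)
  (I : Invariant (cfg α₀ μ₀ ρ₀ χ₀) U) (us : UnreleasedStep (sendReleaseE x n) U U′) where

  Aₒ = owner x
  Bₜ = target x
  Φ′ = clear sent x (remove (Activated x) Φ)
  v = busy Φ′
  α₁ = upd α₀ Aₒ (just v)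
  m = Release x n
  μ₁ = put μ₀ Bₜ m
  κ₀ = cfg α₀ μ₀ ρ₀ χ₀
  κ₁ = cfg α₁ μ₁ ρ₀ χ₀
  Φ′⊆Φ : ∀ {φ} → φ ∈ Φ′ → φ ∈ Φ
  Φ′⊆Φ h = proj₁ (∈-remove⁻ (Activated x) Φ (∈-clear⁻ sent x _ h))

  Φ⊆Φ′ : ∀ {φ} → φ ∈ Φ → φ ≢ Activated x → NotCounter sent φ → φ ∈ Φ′
  Φ⊆Φ′ h n1 n2 = ∈-clear⁺ sent x _ n2 (∈-remove⁺ (Activated x) Φ h n1)

  K-old : ∀ C {φ} → φ ∈ K κ₁ C → φ ∈ K κ₀ C
  K-old C {φ} = knowledge-upd α₀ Aₒ v hα (λ L L′ → φ ∈ L → φ ∈ L′) Φ′⊆Φ (λ _ h → h) C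

  K-kept : ∀ C {φ} → φ ≢ Activated x → NotCounter sent φ → φ ∈ K κ₀ C → φ ∈ K κ₁ C
  K-kept C {φ} n1 n2 = knowledge-upd α₀ Aₒ v hα (λ L L′ → φ ∈ L′ → φ ∈ L) (λ h → Φ⊆Φ′ h n1 n2) (λ _ h → h) C

  KAₒ : K κ₀ Aₒ ≡ Φ
  KAₒ rewrite hα = refl

  sent-unchanged : ∀ C w → x ≢ w → readings sent w (K κ₁ C) ≡ readings sent w (K κ₀ C)
  sent-unchanged C w ne = knowledge-upd α₀ Aₒ v hα (λ L L′ → readings sent w L ≡ readings sent w L′)
    (trans (readings-clear-other sent sent x w (remove (Activated x) Φ) (λ e → ne (sym (cong proj₂ e)))) (readings-remove sent w (Activated x) Φ _)) (λ _ → refl) C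

  sent-x : ∀ C → readings sent x (K κ₁ C) ≡ readings sent x (K κ₀ C) ⊎ readings sent x (K κ₁ C) ≡ []
  sent-x C with updCase α₀ Aₒ (just v) C
  ... | isSame refl q rewrite q = inj₂ (readings-clear-same sent x (remove (Activated x) Φ))
  ... | isOther _ q rewrite q = inj₁ refl

  received-unchanged : ∀ C w → readings received w (K κ₁ C) ≡ readings received w (K κ₀ C)
  received-unchanged C w = knowledge-upd α₀ Aₒ v hα (λ L L′ → readings received w L ≡ readings received w L′)
    (trans (readings-clear-other sent received x w (remove (Activated x) Φ) (λ ())) (readings-remove received w (Activated x) Φ _)) (λ _ → refl) C

  activated-unchanged : ∀ C w → x ≢ w → activated w (K κ₁ C) ≡ activated w (K κ₀ C)
  activated-unchanged C w ne = activated-cong w _ _ (K-old C) (K-kept C (λ { refl → ne refl }) _)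

  x∈Aₒ : Activated x ∈ K κ₀ Aₒ
  x∈Aₒ = subst (Activated x ∈_) (sym KAₒ) ha

  activated-x-before : activated x (K κ₀ Aₒ) ≡ 1
  activated-x-before = activated-∈ x∈Aₒ

  activated-x-after : activated x (K κ₁ Aₒ) ≡ 0
  activated-x-after = activated-∉ λ i → proj₂ (∈-remove⁻ (Activated x) Φ (∈-clear⁻ sent x _ (at-Aₒ i))) refl
    where at-Aₒ : Activated x ∈ K κ₁ Aₒ → Activated x ∈ Φ′
          at-Aₒ i rewrite upd-same α₀ Aₒ (just v) = i

  presence-unchanged : ∀ w → presence κ₁ w ≡ presence κ₀ w
  presence-unchanged w with x ≟R w
  ... | no ne rewrite activated-unchanged (owner w) w ne | count-put-weightless μ₀ Bₜ m (carrying w) refl (owner w)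
                    | count-put-weightless μ₀ Bₜ m (releasing w) (indicator-no (x ≟R w) ne) (target w) = refl
  ... | yes refl rewrite activated-x-after
                       | activated-x-before
                       | count-put-weightless μ₀ Bₜ m (carrying x) refl Aₒ
                       | count-put-same (releasing x) μ₀ Bₜ m
                       | indicator-yes (x ≟R x) refl | +-identityʳ (count (carrying x) (μ₀ Aₒ)) = sym (+-assoc _ 1 _)

  targetCount-unchanged : ∀ w → targetCount κ₁ w ≡ targetCount κ₀ w
  targetCount-unchanged w rewrite received-unchanged (target w) w | count-put-weightless μ₀ Bₜ m (along w) refl (target w) = refl

  Internal-before : ∀ C → Internal κ₁ C → Internal κ₀ C
  Internal-before = upd-Internal⁻ α₀ Aₒ v hα

  n≡ownerCount : n ≡ ownerCount κ₀ x
  n≡ownerCount = ⊢counter-unique sent (sent-readings≤1 I Aₒ x) (subst (_⊢ SentCount x n) (sym KAₒ) hs)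

  ∈-mailbox-after : ∀ C {m′} → m′ ∈ μ₁ C → m′ ∈ μ₀ C ⊎ (Bₜ ≡ C × m′ ≡ m)
  ∈-mailbox-after C = ∈-put⁻ μ₀ Bₜ m C

  Known-before : ∀ y → Known κ₁ y → Known κ₀ y
  Known-before y (inj₁ j) = inj₁ (K-old (target y) j)
  Known-before y (inj₂ (inj₁ (A , w , j))) = inj₂ (inj₁ (A , w , K-old A j))
  Known-before y (inj₂ (inj₂ (C , w , B′ , j))) with ∈-mailbox-after C j
  ... | inj₁ k = inj₂ (inj₂ (C , w , B′ , k))
  ... | inj₂ (_ , ())

  createdUsing-owner′ : ∀ A w z → CreatedUsing w z ∈ K κ₁ A → owner w ≡ A × Activated w ∈ K κ₁ A
  createdUsing-owner′ A w z i with createdUsing-owner I A w z (K-old A i)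
  ... | o , a with x ≟R w
  ...   | yes refl rewrite sym o = ⊥-elim (hno z (subst (CreatedUsing x z ∈_) KAₒ (K-old Aₒ i)))
  ...   | no ne = o , K-kept A (λ { refl → ne refl }) _ a

  known⇒live′ : ∀ y → Known κ₁ y → Internal κ₁ (target y) → Released y ∉ K κ₁ (target y) → Live κ₁ U′ y
  known⇒live′ y s it nr with known⇒live I y (Known-before y s) (Internal-before _ it) (λ j → nr (K-kept (target y) (λ ()) _ j))
  ... | u , inj₁ p = proj₁ us y u (λ ()) , inj₁ (subst (1 ≤_) (sym (presence-unchanged y)) p)
  ... | u , inj₂ e = proj₁ us y u (λ ()) , inj₂ (upd-nothing⁺ α₀ Aₒ v hα (owner y) e)

  sent-readings≤1′ : ∀ C w → length (readings sent w (K κ₁ C)) ≤ 1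
  sent-readings≤1′ C w with x ≟R w
  ... | no ne = subst (λ l → length l ≤ 1) (sym (sent-unchanged C w ne)) (sent-readings≤1 I C w)
  ... | yes refl with sent-x C
  ...   | inj₁ e = subst (λ l → length l ≤ 1) (sym e) (sent-readings≤1 I C x)
  ...   | inj₂ e rewrite e = z≤n

  counts-agree′ : ∀ y → Internal κ₁ (owner y) → Internal κ₁ (target y) →
       1 ≤ held κ₁ y → ownerCount κ₁ y ≡ targetCount κ₁ y
  counts-agree′ y io it h with x ≟R y
  ... | no ne = trans (cong headOr0 (sent-unchanged (owner y) y ne))
         (trans (counts-agree I y (Internal-before _ io) (Internal-before _ it)
            (subst (1 ≤_) (cong₂ _+_ (count-put-weightless μ₀ Bₜ m (carrying y) refl (owner y)) (activated-unchanged (owner y) y ne)) h)) (sym (targetCount-unchanged y)))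
  ... | yes refl = ⊥-elim (≤⇒≯ (presence≤1 I x) presence≥2)
    where
    still-carried : 1 ≤ count (carrying x) (μ₀ Aₒ)
    still-carried = subst (1 ≤_) (trans (cong₂ _+_ (count-put-weightless μ₀ Bₜ m (carrying x) refl Aₒ) activated-x-after) (+-identityʳ _)) h
    presence≥2 : 2 ≤ presence κ₀ x
    presence≥2 = ≤-trans (+-mono-≤ still-carried (≤-reflexive (sym activated-x-before))) (m≤m+n _ _)

  release-count′ : ∀ y k → Internal κ₁ (owner y) → Internal κ₁ (target y) → Release y k ∈ μ₁ (target y) → k ≡ targetCount κ₁ y
  release-count′ y k io it h with ∈-mailbox-after (target y) h
  ... | inj₁ j = trans (release-count I y k (Internal-before _ io) (Internal-before _ it) j) (sym (targetCount-unchanged y))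
  ... | inj₂ (_ , refl) = trans n≡ownerCount (trans (counts-agree I x (Internal-before _ io) (Internal-before _ it)
           (activated⇒held≥1 κ₀ x x∈Aₒ)) (sym (targetCount-unchanged x)))

  invariant : Invariant κ₁ U′
  invariant = record
    { external-absent = λ B′ i → upd-nothing⁺ α₀ Aₒ v hα B′ (external-absent I B′ i)
    ; app-addressed = λ C y R i → [ app-addressed I C y R , (λ { (_ , ()) }) ]′ (∈-mailbox-after C i)
    ; info-addressed = λ C a b B′ i → [ info-addressed I C a b B′ , (λ { (_ , ()) }) ]′ (∈-mailbox-after C i)
    ; release-addressed = λ C y k i → [ release-addressed I C y k , (λ { (e , refl) → e }) ]′ (∈-mailbox-after C i)
    ; createdUsing-owner = createdUsing-owner′
    ; presence≤1 = λ y → subst (_≤ 1) (sym (presence-unchanged y)) (presence≤1 I y)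
    ; released⇒presence≡0 = λ y i → trans (presence-unchanged y) (released⇒presence≡0 I y (K-old (target y) i))
    ; createdUsing-unique = λ A A′ w w′ y i j → createdUsing-unique I A A′ w w′ y (K-old A i) (K-old A′ j)
    ; createdUsing-pending = λ A w y i → let (a , b) = createdUsing-pending I A w y (K-old A i) in
               (λ j → a (K-old (target y) j)) , trans (count-put-weightless μ₀ Bₜ m (introducing y) refl (target y)) b
    ; introducing≤1 = λ y → subst (_≤ 1) (sym (count-put-weightless μ₀ Bₜ m (introducing y) refl (target y))) (introducing≤1 I y)
    ; introducing⇒¬Created = λ y h j → introducing⇒¬Created I y (subst (1 ≤_) (count-put-weightless μ₀ Bₜ m (introducing y) refl (target y)) h) (K-old (target y) j)
    ; known⇒live = known⇒live′
    ; sent-readings≤1 = sent-readings≤1′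
    ; counts-agree = counts-agree′
    ; release-count = release-count′
    }

module AfterRelease {α₀ : Actor → Maybe AState} {μ₀ μ₁ : Actor → List Msg} {ρ₀ χ₀ : List Actor} {Φ : KSet}
  {U U′ : Refob → Set} (x : Refob) (n : ℕ)
  (hα : α₀ (target x) ≡ just (idle Φ)) (cs : Consume μ₀ (target x) (Release x n) μ₁)
  (I : Invariant (cfg α₀ μ₀ ρ₀ χ₀) U) (us : UnreleasedStep (releaseE x n) U U′) where

  B = target x
  v = idle (Released x ∷ Φ)
  α₁ = upd α₀ B (just v)
  κ₀ = cfg α₀ μ₀ ρ₀ χ₀
  κ₁ = cfg α₁ μ₁ ρ₀ χ₀
  open Consumed {μ₀} {μ₁} {B} {Release x n} cs
  count-weightless = count-consume-weightless {μ₀} {μ₁} {B} {Release x n} cs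
  count-consumed = count-consume {μ₀} {μ₁} {B} {Release x n} cs

  K-kept : ∀ C {φ} → φ ∈ K κ₀ C → φ ∈ K κ₁ C
  K-kept C {φ} = knowledge-upd α₀ B v hα (λ L L′ → φ ∈ L′ → φ ∈ L) there (λ _ h → h) C

  K-old-or-new : ∀ C {φ} → φ ∈ K κ₁ C → φ ∈ K κ₀ C ⊎ φ ≡ Released x
  K-old-or-new C {φ} = knowledge-upd α₀ B v hα (λ L L′ → φ ∈ L → φ ∈ L′ ⊎ φ ≡ Released x) f (λ _ h → inj₁ h) C
    where f : φ ∈ Released x ∷ Φ → φ ∈ Φ ⊎ φ ≡ Released x
          f (here e) = inj₂ e
          f (there h) = inj₁ h

  K-old : ∀ C {φ} → (∀ y → φ ≢ Released y) → φ ∈ K κ₁ C → φ ∈ K κ₀ C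
  K-old C {φ} nr h with K-old-or-new C h
  ... | inj₁ i = i
  ... | inj₂ e = ⊥-elim (nr x e)

  sent-unchanged : ∀ C y → readings sent y (K κ₁ C) ≡ readings sent y (K κ₀ C)
  sent-unchanged C y = knowledge-upd α₀ B v hα (λ L L′ → readings sent y L ≡ readings sent y L′) refl (λ _ → refl) C

  received-unchanged : ∀ C y → readings received y (K κ₁ C) ≡ readings received y (K κ₀ C)
  received-unchanged C y = knowledge-upd α₀ B v hα (λ L L′ → readings received y L ≡ readings received y L′) refl (λ _ → refl) C

  activated-unchanged : ∀ C y → activated y (K κ₁ C) ≡ activated y (K κ₀ C)
  activated-unchanged C y = activated-cong y _ _ (K-old C (λ _ ())) (K-kept C)

  relIn : Released x ∈ K κ₁ B
  relIn rewrite upd-same α₀ B (just v) = here refl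

  presence-decreases : ∀ y → presence κ₁ y ≤ presence κ₀ y
  presence-decreases y rewrite activated-unchanged (owner y) y = +-mono-≤ (+-mono-≤ (count-decreases (carrying y) (owner y)) ≤-refl) (count-decreases (releasing y) (target y))

  presence-unchanged : ∀ y → x ≢ y → presence κ₁ y ≡ presence κ₀ y
  presence-unchanged y ne rewrite activated-unchanged (owner y) y | count-weightless (carrying y) refl (owner y)
                | count-weightless (releasing y) (indicator-no (x ≟R y) ne) (target y) = refl

  presence-x : presence κ₁ x + 1 ≤ presence κ₀ x
  presence-x rewrite activated-unchanged (owner x) x
                   | +-assoc (count (carrying x) (μ₁ (owner x)) + activated x (K κ₀ (owner x))) (count (releasing x) (μ₁ B)) 1 =
    +-mono-≤ (+-mono-≤ (count-decreases (carrying x) (owner x)) ≤-refl) (count-consumed (releasing x) (subst (1 ≤_) (sym (indicator-yes (x ≟R x) refl)) ≤-refl))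

  targetCount-unchanged : ∀ y → targetCount κ₁ y ≡ targetCount κ₀ y
  targetCount-unchanged y rewrite received-unchanged (target y) y | count-weightless (along y) refl (target y) = refl

  introducing-unchanged : ∀ y C → count (introducing y) (μ₁ C) ≡ count (introducing y) (μ₀ C)
  introducing-unchanged y C = count-weightless (introducing y) refl C

  Internal-before : ∀ C → Internal κ₁ C → Internal κ₀ C
  Internal-before = upd-Internal⁻ α₀ B v hα

  Known-before : ∀ y → Known κ₁ y → Known κ₀ y
  Known-before y (inj₁ j) = inj₁ (K-old (target y) (λ _ ()) j)
  Known-before y (inj₂ (inj₁ (A , w , j))) = inj₂ (inj₁ (A , w , K-old A (λ _ ()) j))
  Known-before y (inj₂ (inj₂ (C , w , B′ , j))) = inj₂ (inj₂ (C , w , B′ , ∈⁻ C j))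

  released⇒presence≡0′ : ∀ y → Released y ∈ K κ₁ (target y) → presence κ₁ y ≡ 0
  released⇒presence≡0′ y i with x ≟R y
  ... | yes refl = m+1≤n≤1⇒m≡0 presence-x (presence≤1 I x)
  ... | no ne with K-old-or-new (target y) i
  ...   | inj₁ j = trans (presence-unchanged y ne) (released⇒presence≡0 I y j)
  ...   | inj₂ refl = ⊥-elim (ne refl)

  known⇒live′ : ∀ y → Known κ₁ y → Internal κ₁ (target y) → Released y ∉ K κ₁ (target y) → Live κ₁ U′ y
  known⇒live′ y s it nr with x ≟R y
  ... | yes refl = ⊥-elim (nr relIn)
  ... | no ne with known⇒live I y (Known-before y s) (Internal-before _ it) (λ j → nr (K-kept (target y) j))
  ...   | u , inj₁ p = proj₁ us y u ne , inj₁ (subst (1 ≤_) (sym (presence-unchanged y ne)) p)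
  ...   | u , inj₂ e = proj₁ us y u ne , inj₂ (upd-nothing⁺ α₀ B v hα (owner y) e)

  counts-agree′ : ∀ y → Internal κ₁ (owner y) → Internal κ₁ (target y) →
       1 ≤ held κ₁ y → ownerCount κ₁ y ≡ targetCount κ₁ y
  counts-agree′ y io it h = trans (cong headOr0 (sent-unchanged (owner y) y))
    (trans (counts-agree I y (Internal-before _ io) (Internal-before _ it)
      (≤-trans h (+-mono-≤ (count-decreases (carrying y) (owner y)) (≤-reflexive (activated-unchanged (owner y) y))))) (sym (targetCount-unchanged y)))

  invariant : Invariant κ₁ U′
  invariant = record
    { external-absent = λ B′ i → upd-nothing⁺ α₀ B v hα B′ (external-absent I B′ i)
    ; app-addressed = λ C y R i → app-addressed I C y R (∈⁻ C i)
    ; info-addressed = λ C y z B′ i → info-addressed I C y z B′ (∈⁻ C i)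
    ; release-addressed = λ C y m i → release-addressed I C y m (∈⁻ C i)
    ; createdUsing-owner = λ A w z i → let (o , a) = createdUsing-owner I A w z (K-old A (λ _ ()) i) in o , K-kept A a
    ; presence≤1 = λ y → ≤-trans (presence-decreases y) (presence≤1 I y)
    ; released⇒presence≡0 = released⇒presence≡0′
    ; createdUsing-unique = λ A A′ w w′ y i j → createdUsing-unique I A A′ w w′ y (K-old A (λ _ ()) i) (K-old A′ (λ _ ()) j)
    ; createdUsing-pending = λ A w y i → let (a , b) = createdUsing-pending I A w y (K-old A (λ _ ()) i) in
                         (λ j → a (K-old (target y) (λ _ ()) j)) , trans (introducing-unchanged y (target y)) b
    ; introducing≤1 = λ y → subst (_≤ 1) (sym (introducing-unchanged y (target y))) (introducing≤1 I y)
    ; introducing⇒¬Created = λ y h j → introducing⇒¬Created I y (subst (1 ≤_) (introducing-unchanged y (target y)) h) (K-old (target y) (λ _ ()) j)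
    ; known⇒live = known⇒live′
    ; sent-readings≤1 = λ A y → subst (λ l → length l ≤ 1) (sym (sent-unchanged A y)) (sent-readings≤1 I A y)
    ; counts-agree = counts-agree′
    ; release-count = λ y m io it h → trans (release-count I y m (Internal-before _ io) (Internal-before _ it) (∈⁻ (target y) h)) (sym (targetCount-unchanged y))
    }

module AfterCompaction {α₀ : Actor → Maybe AState} {μ₀ : Actor → List Msg} {ρ₀ χ₀ : List Actor} {Φ : KSet}
  {U U′ : Refob → Set} (x : Refob)
  (hα : α₀ (target x) ≡ just (idle Φ)) (hc : Created x ∈ Φ) (hr : Released x ∈ Φ)
  (I : Invariant (cfg α₀ μ₀ ρ₀ χ₀) U) (us : UnreleasedStep (compactionE x) U U′) where

  C₀ = target x
  Φ′ = clear received x (remove (Released x) (remove (Created x) Φ))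
  v = idle Φ′
  α₁ = upd α₀ C₀ (just v)
  κ₀ = cfg α₀ μ₀ ρ₀ χ₀
  κ₁ = cfg α₁ μ₀ ρ₀ χ₀

  Φ′⊆Φ : ∀ {φ} → φ ∈ Φ′ → φ ∈ Φ
  Φ′⊆Φ h = proj₁ (∈-remove⁻ (Created x) Φ (proj₁ (∈-remove⁻ (Released x) _ (∈-clear⁻ received x _ h))))

  Φ⊆Φ′ : ∀ {φ} → φ ∈ Φ → φ ≢ Created x → φ ≢ Released x → NotCounter received φ → φ ∈ Φ′
  Φ⊆Φ′ h n1 n2 n3 = ∈-clear⁺ received x _ n3 (∈-remove⁺ (Released x) _ (∈-remove⁺ (Created x) Φ h n1) n2)

  K-old : ∀ C {φ} → φ ∈ K κ₁ C → φ ∈ K κ₀ C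
  K-old C {φ} = knowledge-upd α₀ C₀ v hα (λ L L′ → φ ∈ L → φ ∈ L′) Φ′⊆Φ (λ _ h → h) C

  K-kept : ∀ C {φ} → φ ≢ Created x → φ ≢ Released x → NotCounter received φ → φ ∈ K κ₀ C → φ ∈ K κ₁ C
  K-kept C {φ} n1 n2 n3 = knowledge-upd α₀ C₀ v hα (λ L L′ → φ ∈ L′ → φ ∈ L) (λ h → Φ⊆Φ′ h n1 n2 n3) (λ _ h → h) C

  readings-unchanged : ∀ k C y → (k , y) ≢ (received , x) → readings k y (K κ₁ C) ≡ readings k y (K κ₀ C)
  readings-unchanged k C y ne = knowledge-upd α₀ C₀ v hα (λ L L′ → readings k y L ≡ readings k y L′)
    (trans (readings-clear-other received k x y (remove (Released x) (remove (Created x) Φ)) ne)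
      (trans (readings-remove k y (Released x) (remove (Created x) Φ) (released-NotCounter k))
             (readings-remove k y (Created x) Φ (created-NotCounter k))))
    (λ _ → refl) C
    where
    released-NotCounter : ∀ k → NotCounter k (Released x)
    released-NotCounter sent = _
    released-NotCounter received = _
    created-NotCounter : ∀ k → NotCounter k (Created x)
    created-NotCounter sent = _
    created-NotCounter received = _

  sent-unchanged : ∀ C y → readings sent y (K κ₁ C) ≡ readings sent y (K κ₀ C)
  sent-unchanged C y = readings-unchanged sent C y (λ ())

  received-unchanged : ∀ C y → y ≢ x → readings received y (K κ₁ C) ≡ readings received y (K κ₀ C)
  received-unchanged C y ne = readings-unchanged received C y (λ e → ne (cong proj₂ e))

  activated-unchanged : ∀ C y → activated y (K κ₁ C) ≡ activated y (K κ₀ C)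
  activated-unchanged C y = activated-cong y _ _ (K-old C) (K-kept C (λ ()) (λ ()) _)

  presence-unchanged : ∀ y → presence κ₁ y ≡ presence κ₀ y
  presence-unchanged y rewrite activated-unchanged (owner y) y = refl

  Internal-before : ∀ C → Internal κ₁ C → Internal κ₀ C
  Internal-before = upd-Internal⁻ α₀ C₀ v hα

  KC₀ : K κ₀ C₀ ≡ Φ
  KC₀ rewrite hα = refl

  presence-x≡0 : presence κ₀ x ≡ 0
  presence-x≡0 = released⇒presence≡0 I x (subst (Released x ∈_) (sym KC₀) hr)

  Known-before : ∀ y → Known κ₁ y → Known κ₀ y
  Known-before y (inj₁ j) = inj₁ (K-old (target y) j)
  Known-before y (inj₂ (inj₁ (A , w , j))) = inj₂ (inj₁ (A , w , K-old A j))
  Known-before y (inj₂ (inj₂ j)) = inj₂ (inj₂ j)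

  Created-x∈C₀ : Created x ∈ K κ₀ C₀
  Created-x∈C₀ = subst (Created x ∈_) (sym KC₀) hc

  known⇒live′ : ∀ y → Known κ₁ y → Internal κ₁ (target y) → Released y ∉ K κ₁ (target y) → Live κ₁ U′ y
  -- Once Created x is dropped nothing records x, since the invariant excluded a CreatedUsing
  -- or an Info for x while Created x was present.
  known⇒live′ y s it nr with y ≟R x
  known⇒live′ y (inj₁ j) it nr | yes refl = ⊥-elim (proj₂ (∈-remove⁻ (Created x) Φ (proj₁ (∈-remove⁻ (Released x) _ (∈-clear⁻ received x _ (at-C₀ j))))) refl)
    where at-C₀ : Created x ∈ K κ₁ C₀ → Created x ∈ Φ′
          at-C₀ j′ rewrite upd-same α₀ C₀ (just v) = j′
  known⇒live′ y (inj₂ (inj₁ (A , w , j))) it nr | yes refl = ⊥-elim (proj₁ (createdUsing-pending I A w x (K-old A j)) Created-x∈C₀)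
  known⇒live′ y (inj₂ (inj₂ (C , w , B′ , j))) it nr | yes refl = ⊥-elim (introducing⇒¬Created I x (info⇒introducing≥1 κ₀ I C w x B′ j) Created-x∈C₀)
  known⇒live′ y s it nr | no ne with known⇒live I y (Known-before y s) (Internal-before _ it)
                        (λ j → nr (K-kept (target y) (λ ()) (λ { refl → ne refl }) _ j))
  ... | u , inj₁ p = proj₁ us y u (λ ()) , inj₁ (subst (1 ≤_) (sym (presence-unchanged y)) p)
  ... | u , inj₂ e = proj₁ us y u (λ ()) , inj₂ (upd-nothing⁺ α₀ C₀ v hα (owner y) e)

  counts-agree′ : ∀ y → Internal κ₁ (owner y) → Internal κ₁ (target y) →
       1 ≤ held κ₁ y → ownerCount κ₁ y ≡ targetCount κ₁ y
  counts-agree′ y io it h with y ≟R x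
  ... | yes refl = ⊥-elim (≡0⇒≱1 presence-x≡0 (held⇒presence≥1 κ₀ x (subst (λ k → 1 ≤ count (carrying x) (μ₀ (owner x)) + k) (activated-unchanged (owner x) x) h)))
  ... | no ne = trans (cong headOr0 (sent-unchanged (owner y) y))
    (trans (counts-agree I y (Internal-before _ io) (Internal-before _ it) (subst (λ k → 1 ≤ count (carrying y) (μ₀ (owner y)) + k) (activated-unchanged (owner y) y) h))
           (cong (λ l → headOr0 l + count (along y) (μ₀ (target y))) (sym (received-unchanged (target y) y ne))))

  release-count′ : ∀ y m → Internal κ₁ (owner y) → Internal κ₁ (target y) → Release y m ∈ μ₀ (target y) → m ≡ targetCount κ₁ y
  release-count′ y m io it h with y ≟R x
  ... | yes refl = ⊥-elim (≡0⇒≱1 presence-x≡0 (release⇒presence≥1 κ₀ x m h))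
  ... | no ne = trans (release-count I y m (Internal-before _ io) (Internal-before _ it) h)
           (cong (λ l → headOr0 l + count (along y) (μ₀ (target y))) (sym (received-unchanged (target y) y ne)))

  invariant : Invariant κ₁ U′
  invariant = record
    { external-absent = λ B′ i → upd-nothing⁺ α₀ C₀ v hα B′ (external-absent I B′ i)
    ; app-addressed = app-addressed I
    ; info-addressed = info-addressed I
    ; release-addressed = release-addressed I
    ; createdUsing-owner = λ A w z i → let (o , a) = createdUsing-owner I A w z (K-old A i) in o , K-kept A (λ ()) (λ ()) _ a
    ; presence≤1 = λ y → subst (_≤ 1) (sym (presence-unchanged y)) (presence≤1 I y)
    ; released⇒presence≡0 = λ y i → trans (presence-unchanged y) (released⇒presence≡0 I y (K-old (target y) i))
    ; createdUsing-unique = λ A A′ w w′ y i j → createdUsing-unique I A A′ w w′ y (K-old A i) (K-old A′ j)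
    ; createdUsing-pending = λ A w y i → let (a , b) = createdUsing-pending I A w y (K-old A i) in (λ j → a (K-old (target y) j)) , b
    ; introducing≤1 = introducing≤1 I
    ; introducing⇒¬Created = λ y h j → introducing⇒¬Created I y h (K-old (target y) j)
    ; known⇒live = known⇒live′
    ; sent-readings≤1 = λ A y → subst (λ l → length l ≤ 1) (sym (sent-unchanged A y)) (sent-readings≤1 I A y)
    ; counts-agree = counts-agree′
    ; release-count = release-count′
    }

module AfterIn {α₀ : Actor → Maybe AState} {μ₀ : Actor → List Msg} {ρ₀ χ₀ : List Actor}
  {U U′ : Refob → Set} (x : Refob) (A : Actor) (R : List Refob)
  (tx : target x ≡ A) (ox : α₀ (owner x) ≡ nothing) (oR : All (λ r → owner r ≡ A) R)
  (fR : All (λ r → FreshToken (cfg α₀ μ₀ ρ₀ χ₀) (token r)) R) (uR : Unique (map token R))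
  (I : Invariant (cfg α₀ μ₀ ρ₀ χ₀) U) (us : UnreleasedStep (inE x A R) U U′) where

  m = App x R
  μ₁ = put μ₀ A m
  κ₀ = cfg α₀ μ₀ ρ₀ χ₀
  κ₁ = cfg α₀ μ₁ ρ₀ (χ₀ ++ externalTargets α₀ R)

  module FR {r} (i : r ∈ R) = FreshTokenLemmas κ₀ (token r) (lookup fR i)

  ∈-mailbox-after : ∀ C {m′} → m′ ∈ μ₁ C → m′ ∈ μ₀ C ⊎ (A ≡ C × m′ ≡ m)
  ∈-mailbox-after C = ∈-put⁻ μ₀ A m C

  presence-others : ∀ w → w ∉ R → presence κ₁ w ≡ presence κ₀ w
  presence-others w ni rewrite count-put-weightless μ₀ A m (carrying w) (∉⇒occurrences≡0 w R ni) (owner w)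
                             | count-put-weightless μ₀ A m (releasing w) refl (target w) = refl

  presence-incoming : ∀ w → w ∈ R → presence κ₁ w ≡ 1
  presence-incoming w i rewrite lookup oR i
                              | count-put-same (carrying w) μ₀ A m
                              | Unique⇒occurrences≡1 R uR i
                              | count-put-weightless μ₀ A m (releasing w) refl (target w)
                              | FR.carrying≡0 i w refl A | FR.activated≡0 i w refl A
                              | FR.releasing≡0 i w refl (target w) = refl

  x≢internally-owned : ∀ w → Internal κ₀ (owner w) → x ≢ w
  x≢internally-owned w io refl = Internal⇒≢nothing κ₀ (owner x) io ox

  targetCount-unchanged : ∀ w → x ≢ w → targetCount κ₁ w ≡ targetCount κ₀ w
  targetCount-unchanged w ne rewrite count-put-weightless μ₀ A m (along w) (indicator-no (x ≟R w) ne) (target w) = refl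

  Known-before : ∀ y → Known κ₁ y → Known κ₀ y
  Known-before y (inj₁ j) = inj₁ j
  Known-before y (inj₂ (inj₁ j)) = inj₂ (inj₁ j)
  Known-before y (inj₂ (inj₂ (C , w , B′ , j))) with ∈-mailbox-after C j
  ... | inj₁ k = inj₂ (inj₂ (C , w , B′ , k))
  ... | inj₂ (_ , ())

  presence≤1′ : ∀ w → presence κ₁ w ≤ 1
  presence≤1′ w with w ∈R? R
  ... | yes i = ≤-reflexive (presence-incoming w i)
  ... | no ni = subst (_≤ 1) (sym (presence-others w ni)) (presence≤1 I w)

  released⇒presence≡0′ : ∀ w → Released w ∈ K κ₀ (target w) → presence κ₁ w ≡ 0
  released⇒presence≡0′ w j with w ∈R? R
  ... | yes i = ⊥-elim (FR.∉knowledge i w refl (target w) j (here refl))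
  ... | no ni = trans (presence-others w ni) (released⇒presence≡0 I w j)

  known⇒live′ : ∀ y → Known κ₁ y → Internal κ₀ (target y) → Released y ∉ K κ₀ (target y) → Live κ₁ U′ y
  known⇒live′ y s it nr with y ∈R? R
  ... | yes i = proj₂ us y i , inj₁ (≤-reflexive (sym (presence-incoming y i)))
  ... | no ni with known⇒live I y (Known-before y s) it nr
  ...   | u , inj₁ p = proj₁ us y u (λ ()) , inj₁ (subst (1 ≤_) (sym (presence-others y ni)) p)
  ...   | u , inj₂ e = proj₁ us y u (λ ()) , inj₂ e

  counts-agree′ : ∀ y → Internal κ₀ (owner y) → Internal κ₀ (target y) →
       1 ≤ held κ₁ y → ownerCount κ₀ y ≡ targetCount κ₁ y
  counts-agree′ y io it h with y ∈R? R
  ... | yes i rewrite FR.readings≡[] i y refl sent (owner y)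
                    | targetCount-unchanged y (x≢internally-owned y io)
                    | FR.readings≡[] i y refl received (target y)
                    | FR.along≡0 i y refl (target y) = refl
  ... | no ni = trans (counts-agree I y io it (subst (1 ≤_) (cong (_+ activated y (K κ₀ (owner y))) (count-put-weightless μ₀ A m (carrying y) (∉⇒occurrences≡0 y R ni) (owner y))) h))
                      (sym (targetCount-unchanged y (x≢internally-owned y io)))

  release-count′ : ∀ y k → Internal κ₀ (owner y) → Internal κ₀ (target y) → Release y k ∈ μ₁ (target y) → k ≡ targetCount κ₁ y
  release-count′ y k io it h with ∈-mailbox-after (target y) h
  ... | inj₁ j = trans (release-count I y k io it j) (sym (targetCount-unchanged y (x≢internally-owned y io)))
  ... | inj₂ (_ , ())

  invariant : Invariant κ₁ U′
  invariant = record
    { external-absent = λ B i → [ external-absent I B , externalTargets-absent α₀ R ]′ (∈-++⁻ χ₀ i)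
    ; app-addressed = λ C y R′ i → [ app-addressed I C y R′ , (λ { (refl , refl) → tx , oR }) ]′ (∈-mailbox-after C i)
    ; info-addressed = λ C a b B′ i → [ info-addressed I C a b B′ , (λ { (_ , ()) }) ]′ (∈-mailbox-after C i)
    ; release-addressed = λ C y k i → [ release-addressed I C y k , (λ { (_ , ()) }) ]′ (∈-mailbox-after C i)
    ; createdUsing-owner = createdUsing-owner I
    ; presence≤1 = presence≤1′
    ; released⇒presence≡0 = released⇒presence≡0′
    ; createdUsing-unique = createdUsing-unique I
    ; createdUsing-pending = λ A′ w y i → let (a , b) = createdUsing-pending I A′ w y i in a , trans (count-put-weightless μ₀ A m (introducing y) refl (target y)) b
    ; introducing≤1 = λ y → subst (_≤ 1) (sym (count-put-weightless μ₀ A m (introducing y) refl (target y))) (introducing≤1 I y)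
    ; introducing⇒¬Created = λ y h j → introducing⇒¬Created I y (subst (1 ≤_) (count-put-weightless μ₀ A m (introducing y) refl (target y)) h) j
    ; known⇒live = known⇒live′
    ; sent-readings≤1 = sent-readings≤1 I
    ; counts-agree = counts-agree′
    ; release-count = release-count′
    }

module Initially (A E x y : ℕ) (A≢E : A ≢ E) (U : Refob → Set)
  (hU : ∀ r → r ∈ ref x A E ∷ ref y A A ∷ [] → U r) where
  κ₀ = initialConfig A E x y
  L₀ : KSet
  L₀ = Activated (ref x A E) ∷ Created (ref y A A) ∷ Activated (ref y A A) ∷ []

  K-initial : ∀ C → K κ₀ C ≡ L₀ ⊎ K κ₀ C ≡ []
  K-initial C with A ≡ᵇ C
  ... | true = inj₁ refl
  ... | false = inj₂ refl

  KA : K κ₀ A ≡ L₀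
  KA rewrite ≡ᵇ-refl A = refl

  initial-fact : ∀ C {φ} → φ ∈ K κ₀ C → (φ ∈ L₀ → ⊥) → ⊥
  initial-fact C i f with K-initial C
  ... | inj₁ e = f (subst (_ ∈_) e i)
  ... | inj₂ e = ¬Any[] (subst (_ ∈_) e i)

  ¬initial-CreatedUsing : ∀ {a b} → CreatedUsing a b ∈ L₀ → ⊥
  ¬initial-CreatedUsing (here ())
  ¬initial-CreatedUsing (there (here ()))
  ¬initial-CreatedUsing (there (there (here ())))
  ¬initial-CreatedUsing (there (there (there ())))

  ¬initial-Released : ∀ {a} → Released a ∈ L₀ → ⊥
  ¬initial-Released (here ())
  ¬initial-Released (there (here ()))
  ¬initial-Released (there (there (here ())))
  ¬initial-Released (there (there (there ())))

  sent-readings≡[] : ∀ C w → readings sent w (K κ₀ C) ≡ []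
  sent-readings≡[] C w with K-initial C
  ... | inj₁ e rewrite e = refl
  ... | inj₂ e rewrite e = refl

  received-readings≡[] : ∀ C w → readings received w (K κ₀ C) ≡ []
  received-readings≡[] C w with K-initial C
  ... | inj₁ e rewrite e = refl
  ... | inj₂ e rewrite e = refl

  external-absent′ : ∀ B → B ∈ E ∷ [] → α κ₀ B ≡ nothing
  external-absent′ B (here refl) rewrite ≢⇒≡ᵇ-false A≢E = refl

  presence≤1′ : ∀ w → presence κ₀ w ≤ 1
  presence≤1′ w rewrite +-identityʳ (activated w (K κ₀ (owner w))) = indicator≤1 _

  known⇒live′ : ∀ w → Known κ₀ w → Internal κ₀ (target w) → Released w ∉ K κ₀ (target w) → Live κ₀ U w
  known⇒live′ w (inj₂ (inj₁ (C , v , i))) _ _ = ⊥-elim (initial-fact C i ¬initial-CreatedUsing)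
  known⇒live′ w (inj₂ (inj₂ (C , v , B , ())))
  known⇒live′ w (inj₁ i) _ _ with K-initial (target w)
  ... | inj₂ e = ⊥-elim (¬Any[] (subst (_ ∈_) e i))
  ... | inj₁ e with subst (_ ∈_) e i
  ...   | here ()
  ...   | there (here refl) =
    hU _ (there (here refl)) ,
    inj₁ (held⇒presence≥1 κ₀ _ (activated⇒held≥1 κ₀ _ (subst (_ ∈_) (sym KA) (there (there (here refl))))))
  ...   | there (there (here ()))
  ...   | there (there (there ()))

  invariant : Invariant κ₀ U
  invariant = record
    { external-absent = external-absent′
    ; app-addressed = λ C _ _ ()
    ; info-addressed = λ C _ _ _ ()
    ; release-addressed = λ C _ _ ()
    ; createdUsing-owner = λ C w z i → ⊥-elim (initial-fact C i ¬initial-CreatedUsing)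
    ; presence≤1 = presence≤1′
    ; released⇒presence≡0 = λ w i → ⊥-elim (initial-fact (target w) i ¬initial-Released)
    ; createdUsing-unique = λ C _ _ _ _ i _ → ⊥-elim (initial-fact C i ¬initial-CreatedUsing)
    ; createdUsing-pending = λ C _ _ i → ⊥-elim (initial-fact C i ¬initial-CreatedUsing)
    ; introducing≤1 = λ _ → z≤n
    ; introducing⇒¬Created = λ _ ()
    ; known⇒live = known⇒live′
    ; sent-readings≤1 = λ C w → subst (λ l → length l ≤ 1) (sym (sent-readings≡[] C w)) z≤n
    ; counts-agree = λ w _ _ _ → trans (cong headOr0 (sent-readings≡[] (owner w) w)) (sym (cong (λ l → headOr0 l + 0) (received-readings≡[] (target w) w)))
    ; release-count = λ _ _ _ _ ()
    }

step-preserves-invariant : ∀ {κ e κ′} (U U′ : Refob → Set) → Step κ e κ′ → Invariant κ U → UnreleasedStep e U U′ → Invariant κ′ U′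
step-preserves-invariant U U′ (Spawn x y hα oy _ _ Fx Fy FB) I us = AfterSpawn.invariant x y hα oy Fx Fy FB I us
step-preserves-invariant U U′ (Send x yz A hα ox hx hyz uz fz) I us = AfterSend.invariant x yz A hα ox hx hyz uz fz I us
step-preserves-invariant U U′ (Receive x B R hα cs) I us = AfterReceive.invariant x B R hα cs I us
step-preserves-invariant U U′ (Idle {α} {μ} {ρ} {χ} {Φ} A hα) I us =
  AfterSilentStep.invariant {cfg α μ ρ χ} {cfg (upd α A (just (idle Φ))) μ ρ χ} I (λ y u → proj₁ us y u (λ ()))
    (λ C → knowledge-upd α A (idle Φ) hα (λ L L′ → L ≡ L′) refl (λ _ → refl) C)
    (upd-nothing⁺ α A (idle Φ) hα) (λ _ → refl) (λ _ i → i)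
step-preserves-invariant U U′ (SendInfo y z hα tz hcu) I us = AfterSendInfo.invariant y z hα tz hcu I us
step-preserves-invariant U U′ (InfoStep y z B C hα cs) I us = AfterInfo.invariant y z B C hα cs I us
step-preserves-invariant U U′ (SendRelease x n hα ha hs hno) I us = AfterSendRelease.invariant x n hα ha hs hno I us
step-preserves-invariant U U′ (ReleaseStep x n hα cs hd) I us = AfterRelease.invariant x n hα cs I us
step-preserves-invariant U U′ (Compaction x hα hc hr) I us = AfterCompaction.invariant x hα hc hr I us
step-preserves-invariant U U′ (Snapshot {α} {μ} {ρ} {χ} A Φ hα) I us =
  AfterSilentStep.invariant {cfg α μ ρ χ} {cfg α μ ρ χ} I (λ y u → proj₁ us y u (λ ())) (λ _ → refl) (λ _ h → h) (λ _ → refl) (λ _ i → i)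
step-preserves-invariant U U′ (In x A R Aρ tx ox oR fR uR tρ) I us = AfterIn.invariant x A R tx ox oR fR uR I us
step-preserves-invariant U U′ (Out x B R Bχ cs) I us = AfterExternalConsume.invariant I (λ y u → proj₁ us y u (λ ())) Bχ cs
step-preserves-invariant U U′ (ReleaseOut B x n Bχ cs) I us = AfterExternalConsume.invariant I (λ y u → proj₁ us y u (λ ())) Bχ cs
step-preserves-invariant U U′ (InfoOut B C y z Cχ cs) I us = AfterExternalConsume.invariant I (λ y u → proj₁ us y u (λ ())) Cχ cs

-- The invariant along an execution

unreleased-step : ∀ ex s → s < len ex → UnreleasedStep (ev ex s) (UnreleasedAt ex s) (UnreleasedAt ex (suc s))
unreleased-step ex s s<len = still-unreleased , newly-created
  where
  still-unreleased : ∀ y → UnreleasedAt ex s y → ¬ Releases (ev ex s) y → UnreleasedAt ex (suc s) y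
  still-unreleased y (s₀ , s₀≤s , created , unreleased) ¬releases = s₀ , m≤n⇒m≤1+n s₀≤s , created , unreleased′
    where
    unreleased′ : ∀ s′ → s₀ ≤ s′ → s′ < suc s → ¬ Releases (ev ex s′) y
    unreleased′ s′ s₀≤s′ s′<1+s with m≤n⇒m<n∨m≡n (≤-pred s′<1+s)
    ... | inj₁ s′<s = unreleased s′ s₀≤s′ s′<s
    ... | inj₂ refl = ¬releases

  newly-created : ∀ y → Creates (ev ex s) y → UnreleasedAt ex (suc s) y
  newly-created y c = suc s , ≤-refl , (s<len , c) , λ s′ 1+s≤s′ s′<1+s _ → ≤⇒≯ 1+s≤s′ s′<1+s

invariant-at : ∀ ex s → s ≤ len ex → Invariant (κ ex s) (UnreleasedAt ex s)
invariant-at ex zero _ = subst (λ κ₀ → Invariant κ₀ (UnreleasedAt ex 0)) (sym (start ex))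
  (Initially.invariant (A₀ ex) (E₀ ex) (x₀ ex) (y₀ ex) (A₀≢E₀ ex) _ λ r i → 0 , z≤n , i , λ _ _ ())
invariant-at ex (suc s) s<len =
  step-preserves-invariant _ _ (steps ex s s<len) (invariant-at ex s (<⇒≤ s<len)) (unreleased-step ex s s<len)

-- Finalized snapshots

module ConsistentSnapshots (ex : Execution) (t : ℕ) (Q : Snapshots) (consistent : Consistent ex t Q) where

  snapshot⇒Internal : ∀ {A Φ} → Q A ≡ just Φ → Internal (κ ex t) A
  snapshot⇒Internal {A} {Φ} q = let (st , α≡ , _) = consistent A Φ q in st , α≡

  snapshot⇒K : ∀ {A Φ φ} → Q A ≡ just Φ → Φ ⊢ φ → K (κ ex t) A ⊢ φ
  snapshot⇒K {A} {Φ} {φ} q d with consistent A Φ q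
  ... | st , α≡ , equiv rewrite α≡ = proj₁ (equiv φ) d

  K⇒snapshot : ∀ {A Φ φ} → Q A ≡ just Φ → K (κ ex t) A ⊢ φ → Φ ⊢ φ
  K⇒snapshot {A} {Φ} {φ} q d with consistent A Φ q
  ... | st , α≡ , equiv rewrite α≡ = proj₂ (equiv φ) d

  QChain⇒Known : ∀ {x} → QChain Q x → Known (κ ex t) x
  QChain⇒Known (chain-base (_ , q , d) _) with ⊢Created⁻ (snapshot⇒K q d)
  ... | inj₁ i = inj₁ i
  ... | inj₂ (w , i) = inj₂ (inj₁ (_ , w , i))
  QChain⇒Known (chain-step {x′} _ _ (_ , q , d) _) = inj₂ (inj₁ (owner x′ , x′ , ⊢CreatedUsing⁻ (snapshot⇒K q d)))

  QChain⇒¬QReleased : ∀ {x} → QChain Q x → ¬ QReleased Q x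
  QChain⇒¬QReleased (chain-base _ ¬released) = ¬released
  QChain⇒¬QReleased (chain-step _ _ _ ¬released) = ¬released

  ¬QReleased⇒∉ : ∀ {x Φ} → Q (target x) ≡ just Φ → ¬ QReleased Q x → Released x ∉ K (κ ex t) (target x)
  ¬QReleased⇒∉ q ¬released i = ¬released (_ , q , K⇒snapshot q (ax i))

Terminated⇒mailbox-empty : ∀ ex t A → Terminated ex t A → μ (κ ex t) A ≡ []
Terminated⇒mailbox-empty ex t A (_ , unreachable) = unreachable (κ ex t) ε

quiescent-live⇒relevant : ∀ {κ U x} → Invariant κ U → Live κ U x → Internal κ (owner x) → Internal κ (target x) →
                          μ κ (owner x) ≡ [] → μ κ (target x) ≡ [] →
                          Activated x ∈ K κ (owner x) × ownerCount κ x ≡ value received x (K κ (target x))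
quiescent-live⇒relevant {κ} {U} {x} I (_ , live) io it owner-empty target-empty = activated⇒∈ x _ activated≥1 , agree
  where
  presence≡activated : presence κ x ≡ activated x (K κ (owner x))
  presence≡activated rewrite owner-empty | target-empty = +-identityʳ _

  activated≥1 : 1 ≤ activated x (K κ (owner x))
  activated≥1 = [ subst (1 ≤_) presence≡activated , (λ external → ⊥-elim (Internal⇒≢nothing κ (owner x) io external)) ]′ live

  agree : ownerCount κ x ≡ value received x (K κ (target x))
  agree = trans (counts-agree I x io it (subst (λ L → 1 ≤ count (carrying x) L + _) (sym owner-empty) activated≥1))
                (trans (cong (λ L → value received x (K κ (target x)) + count (along x) L) target-empty) (+-identityʳ _))

theorem6p7 : (ex : Execution) (t : ℕ) → t ≤ len ex →
    (S : Actor → Set) (Q : Snapshots) →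
    Closed ex t S →
    (∀ A → S A → Terminated ex t A) →
    (∀ A → (S A → InDom Q A) × (InDom Q A → S A)) →
    RecordedIn ex Q →
    Consistent ex t Q →
    Finalized Q
theorem6p7 ex t t≤len S Q closed terminated dom _ consistent x (ΦB , qB) chain =
  (ΦA , qA) , value sent x (K κt A) ,
  (ΦA , qA , K⇒snapshot qA (ax activated-x)) ,
  (ΦA , qA , K⇒snapshot qA (⊢value sent x (K κt A))) ,
  (ΦB , qB , K⇒snapshot qB (subst (λ n → K κt B ⊢ RecvCount x n) (sym counts-agree-x) (⊢value received x (K κt B))))
  where
  open ConsistentSnapshots ex t Q consistent
  κt = κ ex t
  A = owner x
  B = target x
  live = known⇒live (invariant-at ex t t≤len) x (QChain⇒Known chain) (snapshot⇒Internal qB)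
                    (¬QReleased⇒∉ qB (QChain⇒¬QReleased chain))
  SB = proj₂ (dom B) (ΦB , qB)
  SA = closed x SB (proj₁ live)
  ΦA = proj₁ (proj₁ (dom A) SA)
  qA = proj₂ (proj₁ (dom A) SA)
  relevant = quiescent-live⇒relevant (invariant-at ex t t≤len) live (snapshot⇒Internal qA) (snapshot⇒Internal qB)
               (Terminated⇒mailbox-empty ex t A (terminated A SA)) (Terminated⇒mailbox-empty ex t B (terminated B SB))
  activated-x = proj₁ relevant
  counts-agree-x = proj₂ relevant
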